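{- Let $G$ be a connected graph with $n$ vertices and diameter $d$, and write $\det(\lambda I-AD(G))=\lambda^n+c_1\lambda^{n-1}+\dots+c_n$. Then for each $k=1,2,\dots,n$, \[c_k=\sum_{\mathcal S}(-1)^{\,p(\mathcal S)+p_1(\mathcal S)}\,2^{p_1(\mathcal S)}\,d^{\,2a(\mathcal S)+a_1(\mathcal S)},\] where the sum runs over all adjacency-diametrical partitions $\mathcal S$ of $G$ whose parts together contain exactly $k$ vertices.
   Context: All graphs are finite, simple, undirected. For a connected graph $G$ with diameter $d$ and distance $d_G$, two distinct vertices $u,v$ are antipodal if $d_G(u,v)=d$. The adjacency-diametrical matrix $AD(G)$ is the matrix indexed by the vertices whose $(u,v)$-entry is $1$ if $d_G(u,v)=1$, $d$ if $d_G(u,v)=d$, and $0$ otherwise. An adjacency-diametrical cycle of length $k\ge 3$ is a cyclic arrangement $(u_1,\dots,u_k)$ of $k$ distinct vertices (considered up to rotation and reversal) such that for every $i$ (indices mod $k$) $u_i$ and $u_{i+1}$ are adjacent or antipodal; different cyclic arrangements of the same vertex set are different cycles. An adjacency-diametrical partition $\mathcal S$ of $G$ is a collection of pairwise disjoint parts (covering some subset of $V(G)$), each either (a) a $2$-element set $\{u,v\}$ with $u,v$ adjacent or antipodal, or (b) an adjacency-diametrical cycle of length $\ge 3$ (vertex set with its cyclic arrangement). $p(\mathcal S)$ and $p_1(\mathcal S)$ are the numbers of parts of type (a) and (b); $a(\mathcal S)$ is the number of type-(a) parts whose vertices are antipodal; $a_1(\mathcal S)$ is the total number, over type-(b) parts,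 of consecutive pairs $u_i,u_{i+1}$ that are antipodal. -}

module Defs where

open import Data.Bool using (Bool; true; false; _∧_; _∨_; not; if_then_else_)
open import Data.Nat as ℕ using (ℕ; zero; suc; _∸_; _⊔_; _≡ᵇ_; _≤_)
open import Data.Integer as ℤ using (ℤ; +_; -_; -1ℤ)
open import Data.Fin using (Fin; zero; suc; toℕ; punchIn; _≟_)
open import Data.Bool.ListAction using (any)
open import Data.List using (List; []; _∷_; _++_; map; foldr; allFin; concatMap; length; upTo; zip; drop; take; reverse)
open import Data.Nat.ListAction using (sum)
open import Data.List.Relation.Unary.All using (All)
open import Data.List.Relation.Unary.Unique.Propositional using (Unique)
open import Data.List.Relation.Binary.Permutation.Homogeneous using (Permutation)
open import Data.Product using (_×_; ∃; _,_; uncurry)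
open import Data.Sum using (_⊎_)
open import Relation.Binary.PropositionalEquality using (_≡_; _≢_)
open import Relation.Nullary.Decidable using (⌊_⌋)

record Graph (n : ℕ) : Set where
  field
    adj    : Fin n → Fin n → Bool
    sym    : ∀ u v → adj u v ≡ adj v u
    irrefl : ∀ u → adj u u ≡ false
open Graph public

module _ {n : ℕ} (G : Graph n) where

  reach : ℕ → Fin n → Fin n → Bool
  reach zero    u v = ⌊ u ≟ v ⌋
  reach (suc m) u v = reach m u v ∨ any (λ w → adj G u w ∧ reach m w v) (allFin n)

  -- connected: every pair of vertices is joined by a walk
  -- (a walk exists iff one of length ≤ n exists)
  Connected : Set
  Connected = ∀ u v → reach n u v ≡ true

-- least i < b with f i ≡ true, or b if there is none
least : ℕ → (ℕ → Bool) → ℕ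
least zero    f = zero
least (suc b) f = if f zero then zero else suc (least b (λ i → f (suc i)))

module _ {n : ℕ} (G : Graph n) where

  -- graph distance d_G(u,v): least m with a walk of length ≤ m
  -- (correct for connected graphs, where d_G(u,v) ≤ n - 1)
  dist : Fin n → Fin n → ℕ
  dist u v = least n (λ m → reach G m u v)

  diam : ℕ
  diam = foldr (λ u acc → foldr (λ v a → dist u v ⊔ a) acc (allFin n)) 0 (allFin n)

  Adjacent : Fin n → Fin n → Set
  Adjacent u v = adj G u v ≡ true

  Antipodal : Fin n → Fin n → Set
  Antipodal u v = u ≢ v × dist u v ≡ diam

  antipodal? : Fin n → Fin n → Bool
  antipodal? u v = not ⌊ u ≟ v ⌋ ∧ (dist u v ≡ᵇ diam)

  ADRel : Fin n → Fin n → Set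
  ADRel u v = Adjacent u v ⊎ Antipodal u v

  AD : Fin n → Fin n → ℤ
  AD u v = if adj G u v then + 1 else (if antipodal? u v then + diam else + 0)

-- Polynomials with integer coefficients: p i = coefficient of λ^i

Poly : Set
Poly = ℕ → ℤ

_+P_ : Poly → Poly → Poly
(p +P q) i = p i ℤ.+ q i

_*P_ : Poly → Poly → Poly
(p *P q) i = sum′ (map (λ a → p a ℤ.* q (i ∸ a)) (upTo (suc i)))
  where
  sum′ : List ℤ → ℤ
  sum′ = foldr ℤ._+_ (+ 0)

-P_ : Poly → Poly
(-P p) i = - (p i)

constP : ℤ → Poly
constP c zero    = c
constP c (suc i) = + 0

varP : Poly
varP (suc zero) = + 1
varP _          = + 0

sumP : List Poly → Poly
sumP = foldr _+P_ (constP (+ 0))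

det : ∀ m → (Fin m → Fin m → Poly) → Poly
det zero    M = constP (+ 1)
det (suc m) M = sumP (map term (allFin (suc m)))
  where
  term : Fin (suc m) → Poly
  term j = (constP (-1ℤ ℤ.^ toℕ j) *P M zero j)
           *P det m (λ r c → M (suc r) (punchIn j c))

charPoly : ∀ {n} → Graph n → Poly
charPoly {n} G = det n (λ u v → (if ⌊ u ≟ v ⌋ then varP else constP (+ 0)) +P (-P constP (AD G u v)))

coeff : ∀ {n} → Graph n → ℕ → ℤ
coeff {n} G k = charPoly G (n ∸ k)

-- a part: a 2-element set {u,v} (type (a)) or a cyclic arrangement (type (b))
data Part (n : ℕ) : Set where
  pair : Fin n → Fin n → Part n
  cyc  : List (Fin n) → Part n

cycPairs : ∀ {A : Set} → List A → List (A × A)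
cycPairs []       = []
cycPairs (x ∷ xs) = zip (x ∷ xs) (xs ++ (x ∷ []))

vertices : ∀ {n} → Part n → List (Fin n)
vertices (pair u v) = u ∷ v ∷ []
vertices (cyc us)   = us

rotate : ∀ {A : Set} → ℕ → List A → List A
rotate i xs = drop i xs ++ take i xs

data PartEq {n : ℕ} : Part n → Part n → Set where
  pair-same : ∀ {u v} → PartEq (pair u v) (pair u v)
  pair-flip : ∀ {u v} → PartEq (pair u v) (pair v u)
  cyc-rot   : ∀ {us} i → PartEq (cyc us) (cyc (rotate i us))
  cyc-rev   : ∀ {us} i → PartEq (cyc us) (cyc (rotate i (reverse us)))

Partition : ℕ → Set
Partition n = List (Part n)

PartitionEq : ∀ {n} → Partition n → Partition n → Set
PartitionEq = Permutation PartEq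

allVertices : ∀ {n} → Partition n → List (Fin n)
allVertices = concatMap vertices

size : ∀ {n} → Partition n → ℕ
size S = length (allVertices S)

module _ {n : ℕ} (G : Graph n) where

  ValidPart : Part n → Set
  ValidPart (pair u v) = ADRel G u v
  ValidPart (cyc us)   = 3 ≤ length us × Unique us × All (uncurry (ADRel G)) (cycPairs us)

  IsADPartition : Partition n → Set
  IsADPartition S = All ValidPart S × Unique (allVertices S)

  isPair : Part n → ℕ
  isPair (pair _ _) = 1
  isPair (cyc _)    = 0

  isCyc : Part n → ℕ
  isCyc (pair _ _) = 0
  isCyc (cyc _)    = 1

  b2n : Bool → ℕ
  b2n true  = 1
  b2n false = 0

  antiPair : Part n → ℕ
  antiPair (pair u v) = b2n (antipodal? G u v)
  antiPair (cyc _)    = 0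

  antiCyc : Part n → ℕ
  antiCyc (pair _ _) = 0
  antiCyc (cyc us)   = sum (map (λ { (u , v) → b2n (antipodal? G u v) }) (cycPairs us))

  p p₁ a a₁ : Partition n → ℕ
  p  S = sum (map isPair S)
  p₁ S = sum (map isCyc S)
  a  S = sum (map antiPair S)
  a₁ S = sum (map antiCyc S)

  weight : Partition n → ℤ
  weight S = ((-1ℤ ℤ.^ (p S ℕ.+ p₁ S)) ℤ.* ((+ 2) ℤ.^ p₁ S))
             ℤ.* ((+ diam G) ℤ.^ ((2 ℕ.* a S) ℕ.+ a₁ S))

sumℤ : List ℤ → ℤ
sumℤ = foldr ℤ._+_ (+ 0)

-- Only two facts about AD(G) matter: it is symmetric with zero diagonal, and on an adjacent or antipodal pair its entry is d, or 1, according
-- as the pair is antipodal or not. Expanding det(λI − A) row by row, and paying for the sign of each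
-- selected column by moving the matching row to the front, writes the coefficient of λ^(n−k) as a sum over
-- configurations: disjoint cyclic sequences covering k vertices, each weighted by minus the product of the
-- entries of A along it. A configuration of nonzero weight is an adjacency-diametrical partition; a pair
-- arises once and a longer cycle once in each orientation, whence the factor 2, and the products of
-- entries give the powers of d. Configurations are matched with the given representatives through
-- canonical forms: each part is rotated to start at its least vertex and oriented towards its smaller
-- neighbour, and the parts of a partition are bucketed by least vertex.

module Submission where

module Sums where

  open import Data.Integer using (ℤ; -_; _+_; _*_; _-_; 0ℤ; 1ℤ)
  open import Data.Integer.Properties using (+-identityˡ; +-assoc; *-zeroʳ; *-comm)
  open import Data.Integer.Tactic.RingSolver using (solve-∀)
  open import Data.List using (List; []; _∷_; map; _++_; concatMap)
  open import Data.List.Properties using (map-∘)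
  open import Data.List.Relation.Binary.Permutation.Propositional as ↭ using (_↭_; prep; swap; ↭-refl; ↭-trans)
  open import Data.List.Relation.Unary.All as All using (All; []; _∷_)
  import Data.List.Relation.Unary.All.Properties as All
  open import Data.Empty using (⊥-elim)
  open import Data.Product using (_×_; _,_; proj₁; proj₂)
  open import Data.Sum using (_⊎_; [_,_])
  open import Relation.Binary.PropositionalEquality using (_≡_; _≢_; refl; sym; trans; cong; cong₂)
  open import Relation.Nullary using (Dec; yes; no; ¬_)

  ∑ : ∀ {A : Set} → (A → ℤ) → List A → ℤ
  ∑ f []       = 0ℤ
  ∑ f (x ∷ xs) = f x + ∑ f xs

  alt∑ : ∀ {A : Set} → (A → ℤ) → List A → ℤ
  alt∑ f []       = 0ℤ
  alt∑ f (x ∷ xs) = f x - alt∑ f xs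

  module _ {A : Set} where

    ∑-cong : ∀ {f g : A → ℤ} → (∀ x → f x ≡ g x) → ∀ xs → ∑ f xs ≡ ∑ g xs
    ∑-cong f≗g []       = refl
    ∑-cong f≗g (x ∷ xs) = cong₂ _+_ (f≗g x) (∑-cong f≗g xs)

    ∑-congᴬ : ∀ {f g : A → ℤ} {xs} → All (λ x → f x ≡ g x) xs → ∑ f xs ≡ ∑ g xs
    ∑-congᴬ []         = refl
    ∑-congᴬ (eq ∷ eqs) = cong₂ _+_ eq (∑-congᴬ eqs)

    alt∑-cong : ∀ {f g : A → ℤ} → (∀ x → f x ≡ g x) → ∀ xs → alt∑ f xs ≡ alt∑ g xs
    alt∑-cong f≗g []       = refl
    alt∑-cong f≗g (x ∷ xs) = cong₂ _-_ (f≗g x) (alt∑-cong f≗g xs)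

    ∑-zero : ∀ (f : A → ℤ) → (∀ x → f x ≡ 0ℤ) → ∀ xs → ∑ f xs ≡ 0ℤ
    ∑-zero f f≗0 []       = refl
    ∑-zero f f≗0 (x ∷ xs) = cong₂ _+_ (f≗0 x) (∑-zero f f≗0 xs)

    ∑-zeroᴬ : ∀ {f : A → ℤ} {xs} → All (λ x → f x ≡ 0ℤ) xs → ∑ f xs ≡ 0ℤ
    ∑-zeroᴬ []         = refl
    ∑-zeroᴬ (eq ∷ eqs) = cong₂ _+_ eq (∑-zeroᴬ eqs)

    ∑-++ : ∀ (f : A → ℤ) xs ys → ∑ f (xs ++ ys) ≡ ∑ f xs + ∑ f ys
    ∑-++ f []       ys = sym (+-identityˡ _)
    ∑-++ f (x ∷ xs) ys = trans (cong (f x +_) (∑-++ f xs ys)) (sym (+-assoc (f x) _ _))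

    ∑-+ : ∀ (f g : A → ℤ) xs → ∑ (λ x → f x + g x) xs ≡ ∑ f xs + ∑ g xs
    ∑-+ f g []       = refl
    ∑-+ f g (x ∷ xs) = trans (cong (f x + g x +_) (∑-+ f g xs)) (interchange (f x) (g x) _ _)
      where
      interchange : ∀ a b c d → (a + b) + (c + d) ≡ (a + c) + (b + d)
      interchange = solve-∀

    ∑-neg : ∀ (f : A → ℤ) xs → ∑ (λ x → - f x) xs ≡ - ∑ f xs
    ∑-neg f []       = refl
    ∑-neg f (x ∷ xs) = trans (cong (- f x +_) (∑-neg f xs)) (neg-+ (f x) _)
      where
      neg-+ : ∀ a b → - a + - b ≡ - (a + b)
      neg-+ = solve-∀

    ∑-*ˡ : ∀ c (f : A → ℤ) xs → ∑ (λ x → c * f x) xs ≡ c * ∑ f xs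
    ∑-*ˡ c f []       = sym (*-zeroʳ c)
    ∑-*ˡ c f (x ∷ xs) = trans (cong (c * f x +_) (∑-*ˡ c f xs)) (distrib c (f x) _)
      where
      distrib : ∀ c a b → c * a + c * b ≡ c * (a + b)
      distrib = solve-∀

    ∑-*ʳ : ∀ (f : A → ℤ) c xs → ∑ (λ x → f x * c) xs ≡ ∑ f xs * c
    ∑-*ʳ f c xs = trans (∑-cong (λ x → *-comm (f x) c) xs) (trans (∑-*ˡ c f xs) (*-comm c (∑ f xs)))

    alt∑-neg : ∀ (f : A → ℤ) xs → alt∑ (λ x → - f x) xs ≡ - alt∑ f xs
    alt∑-neg f []       = refl
    alt∑-neg f (x ∷ xs) = trans (cong (λ t → - f x - t) (alt∑-neg f xs)) (neg-- (f x) _)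
      where
      neg-- : ∀ a b → - a - - b ≡ - (a - b)
      neg-- = solve-∀

    alt∑-sub : ∀ (f g : A → ℤ) xs → alt∑ (λ x → f x - g x) xs ≡ alt∑ f xs - alt∑ g xs
    alt∑-sub f g []       = refl
    alt∑-sub f g (x ∷ xs) = trans (cong (λ t → f x - g x - t) (alt∑-sub f g xs)) (interchange (f x) (g x) _ _)
      where
      interchange : ∀ a b c d → (a - b) - (c - d) ≡ (a - c) - (b - d)
      interchange = solve-∀

  module _ {A B : Set} where

    ∑-map : ∀ (f : B → ℤ) (g : A → B) xs → ∑ f (map g xs) ≡ ∑ (λ x → f (g x)) xs
    ∑-map f g []       = refl
    ∑-map f g (x ∷ xs) = cong (f (g x) +_) (∑-map f g xs)

    alt∑-map : ∀ (f : B → ℤ) (g : A → B) xs → alt∑ f (map g xs) ≡ alt∑ (λ x → f (g x)) xs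
    alt∑-map f g []       = refl
    alt∑-map f g (x ∷ xs) = cong (λ t → f (g x) - t) (alt∑-map f g xs)

    ∑-concatMap : ∀ (f : B → ℤ) (g : A → List B) xs → ∑ f (concatMap g xs) ≡ ∑ (λ x → ∑ f (g x)) xs
    ∑-concatMap f g []       = refl
    ∑-concatMap f g (x ∷ xs) = trans (∑-++ f (g x) (concatMap g xs)) (cong (∑ f (g x) +_) (∑-concatMap f g xs))

    ∑-comm : ∀ (f : A → B → ℤ) xs ys → ∑ (λ x → ∑ (f x) ys) xs ≡ ∑ (λ y → ∑ (λ x → f x y) xs) ys
    ∑-comm f []       ys = sym (∑-zero _ (λ _ → refl) ys)
    ∑-comm f (x ∷ xs) ys = trans (cong (∑ (f x) ys +_) (∑-comm f xs ys)) (sym (∑-+ (f x) _ ys))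

  select : ∀ {A : Set} → List A → List (A × List A)
  select []       = []
  select (x ∷ xs) = (x , xs) ∷ map (λ (y , ys) → y , x ∷ ys) (select xs)

  map-proj₁-select : ∀ {A : Set} (xs : List A) → map proj₁ (select xs) ≡ xs
  map-proj₁-select []       = refl
  map-proj₁-select (x ∷ xs) = cong (x ∷_) (trans (sym (map-∘ (select xs))) (map-proj₁-select xs))

  select-↭ : ∀ {A : Set} (W : List A) → All (λ (x , C) → W ↭ x ∷ C) (select W)
  select-↭ []      = []
  select-↭ (c ∷ C) = ↭-refl ∷ All.map⁺ (All.map (λ C↭ → ↭-trans (prep c C↭) (swap c _ ↭-refl)) (select-↭ C))

  module _ {A : Set} where

    ∑-select : ∀ (f : A × List A → ℤ) x xs →
               ∑ f (select (x ∷ xs)) ≡ f (x , xs) + ∑ (λ (y , ys) → f (y , x ∷ ys)) (select xs)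
    ∑-select f x xs = cong (f (x , xs) +_) (∑-map f _ (select xs))

    alt∑-select : ∀ (f : A × List A → ℤ) x xs →
                  alt∑ f (select (x ∷ xs)) ≡ f (x , xs) - alt∑ (λ (y , ys) → f (y , x ∷ ys)) (select xs)
    alt∑-select f x xs = cong (λ t → f (x , xs) - t) (alt∑-map f _ (select xs))

  ∏ : ∀ {A : Set} → (A → ℤ) → List A → ℤ
  ∏ f []       = 1ℤ
  ∏ f (x ∷ xs) = f x * ∏ f xs

  ∏-↭ : ∀ {A : Set} (f : A → ℤ) {xs ys} → xs ↭ ys → ∏ f xs ≡ ∏ f ys
  ∏-↭ f ↭.refl         = refl
  ∏-↭ f (prep x p)     = cong (f x *_) (∏-↭ f p)
  ∏-↭ f (swap x y p)   = trans (cong (λ t → f x * (f y * t)) (∏-↭ f p)) (swap-* (f x) (f y) _)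
    where
    swap-* : ∀ a b c → a * (b * c) ≡ b * (a * c)
    swap-* = solve-∀
  ∏-↭ f (↭.trans p q)  = trans (∏-↭ f p) (∏-↭ f q)

  ∏-congᴬ : ∀ {A : Set} {f g : A → ℤ} {xs} → All (λ x → f x ≡ g x) xs → ∏ f xs ≡ ∏ g xs
  ∏-congᴬ []         = refl
  ∏-congᴬ (eq ∷ eqs) = cong₂ _*_ eq (∏-congᴬ eqs)

  ∏≢0 : ∀ {A : Set} (f : A → ℤ) xs → ∏ f xs ≢ 0ℤ → All (λ x → f x ≢ 0ℤ) xs
  ∏≢0 f []       _   = []
  ∏≢0 f (x ∷ xs) ∏≢0′ =
    (λ fx≡0 → ∏≢0′ (cong (_* ∏ f xs) fx≡0)) ∷ ∏≢0 f xs (λ ∏≡0 → ∏≢0′ (trans (cong (f x *_) ∏≡0) (*-zeroʳ (f x))))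

  𝟙 : ∀ {P : Set} → Dec P → ℤ
  𝟙 (yes _) = 1ℤ
  𝟙 (no _)  = 0ℤ

  module _ {P : Set} where

    𝟙-yes : (p? : Dec P) → P → 𝟙 p? ≡ 1ℤ
    𝟙-yes (yes _) _ = refl
    𝟙-yes (no ¬p) p = ⊥-elim (¬p p)

    𝟙-no : (p? : Dec P) → ¬ P → 𝟙 p? ≡ 0ℤ
    𝟙-no (yes p) ¬p = ⊥-elim (¬p p)
    𝟙-no (no _)  _  = refl

    𝟙-guard : (p? : Dec P) {x y : ℤ} → (P → x ≡ y) → 𝟙 p? * x ≡ 𝟙 p? * y
    𝟙-guard (yes p) x≡y = cong (1ℤ *_) (x≡y p)
    𝟙-guard (no _)  x≡y = refl

  𝟙-cong : ∀ {P Q : Set} (p? : Dec P) (q? : Dec Q) → (P → Q) → (Q → P) → 𝟙 p? ≡ 𝟙 q?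
  𝟙-cong (yes p) q? P→Q Q→P = sym (𝟙-yes q? (P→Q p))
  𝟙-cong (no ¬p) q? P→Q Q→P = sym (𝟙-no q? (λ q → ¬p (Q→P q)))

  𝟙-× : ∀ {P Q R : Set} (p? : Dec P) (q? : Dec Q) (r? : Dec R) →
        (P → Q × R) → (Q → R → P) → 𝟙 p? ≡ 𝟙 q? * 𝟙 r?
  𝟙-× (yes p) q?      r? split join = sym (cong₂ _*_ (𝟙-yes q? (proj₁ (split p))) (𝟙-yes r? (proj₂ (split p))))
  𝟙-× (no ¬p) (yes q) r? split join = sym (cong (1ℤ *_) (𝟙-no r? (λ r → ¬p (join q r))))
  𝟙-× (no ¬p) (no _)  r? split join = refl

  𝟙-⊎ : ∀ {P Q R : Set} (p? : Dec P) (q? : Dec Q) (r? : Dec R) →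
        (P → Q ⊎ R) → (Q → P) → (R → P) → ¬ (Q × R) → 𝟙 p? ≡ 𝟙 q? + 𝟙 r?
  𝟙-⊎ (yes p) (yes q) (yes r) split inj₁⇒ inj₂⇒ excl = ⊥-elim (excl (q , r))
  𝟙-⊎ (yes p) (yes q) (no _)  split inj₁⇒ inj₂⇒ excl = refl
  𝟙-⊎ (yes p) (no _)  (yes r) split inj₁⇒ inj₂⇒ excl = refl
  𝟙-⊎ (yes p) (no ¬q) (no ¬r) split inj₁⇒ inj₂⇒ excl = ⊥-elim ([ ¬q , ¬r ] (split p))
  𝟙-⊎ (no ¬p) (yes q) r?      split inj₁⇒ inj₂⇒ excl = ⊥-elim (¬p (inj₁⇒ q))
  𝟙-⊎ (no ¬p) (no _)  (yes r) split inj₁⇒ inj₂⇒ excl = ⊥-elim (¬p (inj₂⇒ r))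
  𝟙-⊎ (no ¬p) (no _)  (no _)  split inj₁⇒ inj₂⇒ excl = refl

module Lists where

  open import Data.Empty using (⊥-elim)
  open import Data.List using (List; []; _∷_; _++_; length; filter)
  open import Data.List.Properties using (filter-accept; filter-reject; partition-defn)
  open import Data.List.Membership.Propositional using (_∈_; _∉_)
  open import Data.List.Membership.Propositional.Properties using (∈-++⁺ʳ)
  open import Data.List.Relation.Unary.All as All using (All; []; _∷_)
  import Data.List.Relation.Unary.All.Properties as All
  open import Data.List.Relation.Unary.Any using (here; there)
  open import Data.List.Relation.Unary.Unique.Propositional using (Unique; []; _∷_)
  open import Data.List.Relation.Binary.Permutation.Propositional using (_↭_; prep; ↭-trans; ↭⇒↭ₛ; ↭ₛ⇒↭)
  open import Data.List.Relation.Binary.Permutation.Propositional.Properties using (↭-length; ∈-resp-↭; shift; ++-comm)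
  import Data.List.Relation.Binary.Permutation.Setoid.Properties as ↭ₛ
  open import Data.Nat using (_≤_; s≤s)
  open import Data.Nat.Properties using (≤-reflexive)
  open import Data.Product using (_×_; _,_; proj₁; proj₂)
  open import Relation.Binary.PropositionalEquality using (_≡_; _≢_; refl; sym; trans; cong; subst; setoid)
  open import Relation.Nullary using (yes; no; ¬?)
  open import Relation.Unary using (Decidable)

  module _ {A : Set} where

    Unique-resp-↭ : ∀ {xs ys : List A} → xs ↭ ys → Unique xs → Unique ys
    Unique-resp-↭ xs↭ys = ↭ₛ.Unique-resp-↭ (setoid A) (↭⇒↭ₛ xs↭ys)

    Unique-++⁻ : ∀ (xs : List A) {ys} → Unique (xs ++ ys) → Unique xs × Unique ys
    Unique-++⁻ []       u            = [] , u
    Unique-++⁻ (x ∷ xs) (x∉ ∷ u) with Unique-++⁻ xs u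
    ... | uxs , uys = All.++⁻ˡ xs x∉ ∷ uxs , uys

    Unique-++-disjoint : ∀ {x : A} xs {ys} → Unique (xs ++ ys) → x ∈ xs → x ∉ ys
    Unique-++-disjoint (z ∷ zs) (z∉ ∷ u) (here refl) x∈ys = All.lookup z∉ (∈-++⁺ʳ zs x∈ys) refl
    Unique-++-disjoint (z ∷ zs) (z∉ ∷ u) (there x∈)  x∈ys = Unique-++-disjoint zs u x∈ x∈ys

    Unique-middle : ∀ (xs : List A) {m ys} → Unique (xs ++ m ∷ ys) → All (_≢ m) xs × All (m ≢_) ys
    Unique-middle []       (m∉ ∷ _) = [] , m∉
    Unique-middle (x ∷ xs) (x∉ ∷ u) with Unique-middle xs u | All.++⁻ʳ xs x∉
    ... | xs≢m , m≢ys | x≢m ∷ _ = x≢m ∷ xs≢m , m≢ys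

    ↭-front : ∀ xs (x : A) ys → xs ++ x ∷ ys ↭ x ∷ ys ++ xs
    ↭-front xs x ys = ↭-trans (shift x xs ys) (prep x (++-comm xs ys))

    filter-↭ : ∀ {P : A → Set} (P? : Decidable P) xs → xs ↭ filter P? xs ++ filter (λ x → ¬? (P? x)) xs
    filter-↭ P? xs =
      subst (λ (ys , zs) → xs ↭ ys ++ zs) (partition-defn P? xs) (↭ₛ⇒↭ (↭ₛ.partition-↭ (setoid A) P? xs))

    filter-filter : ∀ {P Q R : A → Set} (P? : Decidable P) (Q? : Decidable Q) (R? : Decidable R) →
                    (∀ {x} → R x → P x × Q x) → (∀ {x} → P x → Q x → R x) →
                    ∀ xs → filter P? (filter Q? xs) ≡ filter R? xs
    filter-filter P? Q? R? R⇒P×Q P×Q⇒R []       = refl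
    filter-filter P? Q? R? R⇒P×Q P×Q⇒R (x ∷ xs) with Q? x | R? x
    ... | yes q | yes r = trans (filter-accept P? (proj₁ (R⇒P×Q r)))
                                (cong (x ∷_) (filter-filter P? Q? R? R⇒P×Q P×Q⇒R xs))
    ... | yes q | no ¬r = trans (filter-reject P? (λ p → ¬r (P×Q⇒R p q)))
                                (filter-filter P? Q? R? R⇒P×Q P×Q⇒R xs)
    ... | no ¬q | yes r = ⊥-elim (¬q (proj₂ (R⇒P×Q r)))
    ... | no ¬q | no ¬r = filter-filter P? Q? R? R⇒P×Q P×Q⇒R xs

    ∈-length≤1⇒≡ : ∀ {x : A} {xs} → x ∈ xs → length xs ≤ 1 → xs ≡ x ∷ []
    ∈-length≤1⇒≡ {xs = _ ∷ []}    (here refl) _ = refl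
    ∈-length≤1⇒≡ {xs = _ ∷ _ ∷ _} _ (s≤s ())

    ↭-length≤1⇒≡ : ∀ {xs ys : List A} → xs ↭ ys → length xs ≤ 1 → xs ≡ ys
    ↭-length≤1⇒≡ {[]}    {[]}    p _ = refl
    ↭-length≤1⇒≡ {[]}    {_ ∷ _} p _ with () ← ↭-length p
    ↭-length≤1⇒≡ {x ∷ []} p len = sym (∈-length≤1⇒≡ (∈-resp-↭ p (here refl)) (≤-reflexive (sym (↭-length p))))
    ↭-length≤1⇒≡ {_ ∷ _ ∷ _} p (s≤s ())

module ListDeterminant where

  open Sums
  open import Defs using (Poly; _*P_; sumP; constP; det)
  open import Data.Integer using (ℤ; -_; _+_; _*_; _-_; 0ℤ; 1ℤ; -1ℤ; _^_)
  open import Data.Integer.Properties using (+-identityʳ; *-zeroʳ; *-assoc)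
  open import Data.Integer.Tactic.RingSolver using (solve-∀)
  open import Data.Nat using (ℕ; zero; suc; _∸_)
  open import Data.Fin using (Fin; zero; suc; toℕ; punchIn)
  open import Data.List using (List; []; _∷_; map; _++_; foldr; tabulate; applyUpTo)
  open import Data.List.Properties using (++-assoc)
  open import Data.Product using (_×_; _,_; proj₁; proj₂)
  open import Function using (_∘_; id)
  open import Relation.Binary.PropositionalEquality using (_≡_; refl; sym; trans; cong; cong₂; module ≡-Reasoning)

  -- (a , b) stands for the polynomial a + b λ
  Linear : Set
  Linear = ℤ × ℤ

  linearPoly : Linear → Poly
  linearPoly (a , b) zero          = a
  linearPoly (a , b) (suc zero)    = b
  linearPoly (a , b) (suc (suc _)) = 0ℤ

  infixr 7 _*ₗ_

  _*ₗ_ : Linear → Poly → Poly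
  ((a , b) *ₗ p) zero    = a * p zero
  ((a , b) *ₗ p) (suc i) = a * p (suc i) + b * p i

  negₗ : Linear → Linear
  negₗ (a , b) = - a , - b

  *ₗ-cong : ∀ u {p q : Poly} → (∀ i → p i ≡ q i) → ∀ i → (u *ₗ p) i ≡ (u *ₗ q) i
  *ₗ-cong (a , b) p≗q zero    = cong (a *_) (p≗q zero)
  *ₗ-cong (a , b) p≗q (suc i) = cong₂ (λ x y → a * x + b * y) (p≗q (suc i)) (p≗q i)

  *ₗ-negʳ : ∀ u (p : Poly) i → (u *ₗ (λ j → - p j)) i ≡ - (u *ₗ p) i
  *ₗ-negʳ (a , b) p zero    = neg a (p zero)
    where
    neg : ∀ a x → a * - x ≡ - (a * x)
    neg = solve-∀
  *ₗ-negʳ (a , b) p (suc i) = neg a b (p (suc i)) (p i)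
    where
    neg : ∀ a b x y → a * - x + b * - y ≡ - (a * x + b * y)
    neg = solve-∀

  *ₗ-negˡ : ∀ u (p : Poly) i → (negₗ u *ₗ p) i ≡ - (u *ₗ p) i
  *ₗ-negˡ (a , b) p zero    = neg a (p 0)
    where
    neg : ∀ a x → - a * x ≡ - (a * x)
    neg = solve-∀
  *ₗ-negˡ (a , b) p (suc i) = neg a b (p (suc i)) (p i)
    where
    neg : ∀ a b x y → - a * x + - b * y ≡ - (a * x + b * y)
    neg = solve-∀

  *ₗ-comm : ∀ u v (p : Poly) i → (u *ₗ v *ₗ p) i ≡ (v *ₗ u *ₗ p) i
  *ₗ-comm (a , b) (c , d) p zero          = comm a c (p 0)
    where
    comm : ∀ a c x → a * (c * x) ≡ c * (a * x)
    comm = solve-∀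
  *ₗ-comm (a , b) (c , d) p (suc zero)    = comm a b c d (p 1) (p 0)
    where
    comm : ∀ a b c d x y → a * (c * x + d * y) + b * (c * y) ≡ c * (a * x + b * y) + d * (a * y)
    comm = solve-∀
  *ₗ-comm (a , b) (c , d) p (suc (suc i)) = comm a b c d (p (suc (suc i))) (p (suc i)) (p i)
    where
    comm : ∀ a b c d x y z →
           a * (c * x + d * y) + b * (c * y + d * z) ≡ c * (a * x + b * y) + d * (a * y + b * z)
    comm = solve-∀

  *ₗ-alt∑ : ∀ {A : Set} u (g : A → Poly) xs i →
            (u *ₗ (λ j → alt∑ (λ x → g x j) xs)) i ≡ alt∑ (λ x → (u *ₗ g x) i) xs
  *ₗ-alt∑ (a , b) g []       zero    = *-zeroʳ a
  *ₗ-alt∑ (a , b) g []       (suc i) = zero-sum a b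
    where
    zero-sum : ∀ a b → a * 0ℤ + b * 0ℤ ≡ 0ℤ
    zero-sum = solve-∀
  *ₗ-alt∑ (a , b) g (x ∷ xs) zero    =
    trans (distrib a (g x 0) _) (cong (λ t → a * g x 0 - t) (*ₗ-alt∑ (a , b) g xs zero))
    where
    distrib : ∀ a x y → a * (x - y) ≡ a * x - a * y
    distrib = solve-∀
  *ₗ-alt∑ (a , b) g (x ∷ xs) (suc i) =
    trans (distrib a b (g x (suc i)) _ (g x i) _)
          (cong (λ t → a * g x (suc i) + b * g x i - t) (*ₗ-alt∑ (a , b) g xs (suc i)))
    where
    distrib : ∀ a b x y z w → a * (x - y) + b * (z - w) ≡ (a * x + b * z) - (a * y + b * w)
    distrib = solve-∀

  *ₗ-const : ∀ c (p : Poly) i → ((c , 0ℤ) *ₗ p) i ≡ c * p i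
  *ₗ-const c p zero    = refl
  *ₗ-const c p (suc i) = drop c (p (suc i)) (p i)
    where
    drop : ∀ c x y → c * x + 0ℤ * y ≡ c * x
    drop = solve-∀

  module _ {V : Set} (e : V → V → Linear) where

    -- the determinant of the submatrix of e with rows R and columns C, expanded along its first row
    detL : List V → List V → Poly
    detL []      C   = constP 1ℤ
    detL (r ∷ R) C i = alt∑ (λ (c , C′) → (e r c *ₗ detL R C′) i) (select C)

    expand₂ : (V → V → List V → Poly) → List V → Poly
    expand₂ h C i = alt∑ (λ (x , C′) → alt∑ (λ (y , C″) → h x y C″ i) (select C′)) (select C)

    expand₂-cong : ∀ {h h′} → (∀ x y R i → h x y R i ≡ h′ x y R i) → ∀ C i → expand₂ h C i ≡ expand₂ h′ C i
    expand₂-cong h≗h′ C i = alt∑-cong (λ (_ , C′) → alt∑-cong (λ _ → h≗h′ _ _ _ i) (select C′)) (select C)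

    expand₂-∷ : ∀ h c C i →
                expand₂ h (c ∷ C) i ≡ alt∑ (λ (y , C′) → h c y C′ i) (select C)
                                      - (alt∑ (λ (x , C′) → h x c C′ i) (select C) - expand₂ (λ x y R → h x y (c ∷ R)) C i)
    expand₂-∷ h c C i =
      trans (alt∑-select (λ (x , C′) → alt∑ (λ (y , C″) → h x y C″ i) (select C′)) c C)
            (cong (λ t → alt∑ (λ (y , C′) → h c y C′ i) (select C) - t)
                  (trans (alt∑-cong (λ (x , C′) → alt∑-select (λ (y , C″) → h x y C″ i) c C′) (select C))
                         (alt∑-sub _ _ (select C))))

    expand₂-flip : ∀ C h i → expand₂ (λ x y R → h y x R) C i ≡ - expand₂ h C i
    expand₂-flip []      h i = refl
    expand₂-flip (c ∷ C) h i = begin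
        expand₂ (λ x y R → h y x R) (c ∷ C) i
      ≡⟨ expand₂-∷ (λ x y R → h y x R) c C i ⟩
        B - (A - expand₂ (λ x y R → h y x (c ∷ R)) C i)
      ≡⟨ cong (λ t → B - (A - t)) (expand₂-flip C (λ x y R → h x y (c ∷ R)) i) ⟩
        B - (A - - expand₂ (λ x y R → h x y (c ∷ R)) C i)
      ≡⟨ rearrange B A _ ⟩
        - (A - (B - expand₂ (λ x y R → h x y (c ∷ R)) C i))
      ≡⟨ cong -_ (sym (expand₂-∷ h c C i)) ⟩
        - expand₂ h (c ∷ C) i ∎
      where
      open ≡-Reasoning
      A : ℤ
      A = alt∑ (λ (y , C′) → h c y C′ i) (select C)
      B : ℤ
      B = alt∑ (λ (x , C′) → h x c C′ i) (select C)
      rearrange : ∀ b a t → b - (a - - t) ≡ - (a - (b - t))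
      rearrange = solve-∀

    detL-∷∷ : ∀ a b R C i → detL (a ∷ b ∷ R) C i ≡ expand₂ (λ x y R′ → e a x *ₗ e b y *ₗ detL R R′) C i
    detL-∷∷ a b R C i =
      alt∑-cong (λ (x , C′) → *ₗ-alt∑ (e a x) (λ (y , C″) → e b y *ₗ detL R C″) (select C′) i) (select C)

    detL-swap : ∀ P a b R C i → detL (P ++ a ∷ b ∷ R) C i ≡ - detL (P ++ b ∷ a ∷ R) C i
    detL-swap [] a b R C i = begin
        detL (a ∷ b ∷ R) C i
      ≡⟨ detL-∷∷ a b R C i ⟩
        expand₂ (λ x y R′ → e a x *ₗ e b y *ₗ detL R R′) C i
      ≡⟨ expand₂-cong (λ x y R′ → *ₗ-comm (e a x) (e b y) (detL R R′)) C i ⟩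
        expand₂ (λ x y R′ → e b y *ₗ e a x *ₗ detL R R′) C i
      ≡⟨ expand₂-flip C (λ x y R′ → e b x *ₗ e a y *ₗ detL R R′) i ⟩
        - expand₂ (λ x y R′ → e b x *ₗ e a y *ₗ detL R R′) C i
      ≡⟨ cong -_ (sym (detL-∷∷ b a R C i)) ⟩
        - detL (b ∷ a ∷ R) C i ∎
      where open ≡-Reasoning
    detL-swap (p ∷ P) a b R C i =
      trans (alt∑-cong (λ (x , C′) → trans (*ₗ-cong (e p x) (detL-swap P a b R C′) i)
                                           (*ₗ-negʳ (e p x) (detL (P ++ b ∷ a ∷ R) C′) i)) (select C))
            (alt∑-neg _ (select C))

    -- moving the k-th row of X to the front costs exactly the sign of the k-th term
    alt∑≡∑-rowToFront : ∀ P X (u : V × List V → Linear) (C : V × List V → List V) i →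
      alt∑ (λ xr → (u xr *ₗ detL (P ++ X) (C xr)) i) (select X)
        ≡ ∑ (λ xr → (u xr *ₗ detL (P ++ proj₁ xr ∷ proj₂ xr) (C xr)) i) (select X)
    alt∑≡∑-rowToFront P []      u C i = refl
    alt∑≡∑-rowToFront P (c ∷ X) u C i = begin
        alt∑ (λ xr → (u xr *ₗ detL (P ++ c ∷ X) (C xr)) i) (select (c ∷ X))
      ≡⟨ alt∑-select (λ xr → (u xr *ₗ detL (P ++ c ∷ X) (C xr)) i) c X ⟩
        H - alt∑ (λ xr → (u′ xr *ₗ detL (P ++ c ∷ X) (C′ xr)) i) (select X)
      ≡⟨ cong (H +_) (sym (alt∑-neg _ (select X))) ⟩
        H + alt∑ (λ xr → - (u′ xr *ₗ detL (P ++ c ∷ X) (C′ xr)) i) (select X)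
      ≡⟨ cong (H +_) (alt∑-cong negate (select X)) ⟩
        H + alt∑ (λ xr → (negₗ (u′ xr) *ₗ detL ((P ++ c ∷ []) ++ X) (C′ xr)) i) (select X)
      ≡⟨ cong (H +_) (alt∑≡∑-rowToFront (P ++ c ∷ []) X (negₗ ∘ u′) C′ i) ⟩
        H + ∑ (λ xr → (negₗ (u′ xr) *ₗ detL ((P ++ c ∷ []) ++ proj₁ xr ∷ proj₂ xr) (C′ xr)) i) (select X)
      ≡⟨ cong (H +_) (∑-cong swapBack (select X)) ⟩
        H + ∑ (λ xr → (u′ xr *ₗ detL (P ++ proj₁ xr ∷ c ∷ proj₂ xr) (C′ xr)) i) (select X)
      ≡⟨ sym (∑-select (λ xr → (u xr *ₗ detL (P ++ proj₁ xr ∷ proj₂ xr) (C xr)) i) c X) ⟩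
        ∑ (λ xr → (u xr *ₗ detL (P ++ proj₁ xr ∷ proj₂ xr) (C xr)) i) (select (c ∷ X)) ∎
      where
      open ≡-Reasoning
      H = (u (c , X) *ₗ detL (P ++ c ∷ X) (C (c , X))) i
      u′ : V × List V → Linear
      u′ (x , r) = u (x , c ∷ r)
      C′ : V × List V → List V
      C′ (x , r) = C (x , c ∷ r)
      negate : ∀ xr → - (u′ xr *ₗ detL (P ++ c ∷ X) (C′ xr)) i
                      ≡ (negₗ (u′ xr) *ₗ detL ((P ++ c ∷ []) ++ X) (C′ xr)) i
      negate xr = trans (sym (*ₗ-negˡ (u′ xr) _ i))
                        (cong (λ L → (negₗ (u′ xr) *ₗ detL L (C′ xr)) i) (sym (++-assoc P (c ∷ []) X)))
      swapBack : ∀ xr → (negₗ (u′ xr) *ₗ detL ((P ++ c ∷ []) ++ proj₁ xr ∷ proj₂ xr) (C′ xr)) i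
                        ≡ (u′ xr *ₗ detL (P ++ proj₁ xr ∷ c ∷ proj₂ xr) (C′ xr)) i
      swapBack (x , r) = begin
          (negₗ (u′ (x , r)) *ₗ detL ((P ++ c ∷ []) ++ x ∷ r) (C′ (x , r))) i
        ≡⟨ cong (λ L → (negₗ (u′ (x , r)) *ₗ detL L (C′ (x , r))) i) (++-assoc P (c ∷ []) (x ∷ r)) ⟩
          (negₗ (u′ (x , r)) *ₗ detL (P ++ c ∷ x ∷ r) (C′ (x , r))) i
        ≡⟨ *ₗ-negˡ (u′ (x , r)) _ i ⟩
          - (u′ (x , r) *ₗ detL (P ++ c ∷ x ∷ r) (C′ (x , r))) i
        ≡⟨ sym (*ₗ-negʳ (u′ (x , r)) _ i) ⟩
          (u′ (x , r) *ₗ (λ j → - detL (P ++ c ∷ x ∷ r) (C′ (x , r)) j)) i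
        ≡⟨ *ₗ-cong (u′ (x , r)) (λ j → sym (detL-swap P x c r (C′ (x , r)) j)) i ⟩
          (u′ (x , r) *ₗ detL (P ++ x ∷ c ∷ r) (C′ (x , r))) i ∎

  private
    sum-applyUpTo-zero : ∀ k (g : ℕ → ℕ) (F : ℕ → ℤ) → (∀ x → F (g x) ≡ 0ℤ) →
                         foldr _+_ 0ℤ (map F (applyUpTo g k)) ≡ 0ℤ
    sum-applyUpTo-zero zero    g F F∘g≗0 = refl
    sum-applyUpTo-zero (suc k) g F F∘g≗0 =
      cong₂ _+_ (F∘g≗0 0) (sum-applyUpTo-zero k (g ∘ suc) F (F∘g≗0 ∘ suc))

  *P-linear : ∀ (p q : Poly) → (∀ k → p (suc (suc k)) ≡ 0ℤ) → ∀ i → (p *P q) i ≡ ((p 0 , p 1) *ₗ q) i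
  *P-linear p q deg≤1 zero    = +-identityʳ _
  *P-linear p q deg≤1 (suc i) =
    cong (λ t → p 0 * q (suc i) + t)
         (trans (cong (p 1 * q i +_)
                      (sum-applyUpTo-zero i (λ x → suc (suc x)) (λ a → p a * q (suc i ∸ a))
                                          (λ x → cong (_* q (suc i ∸ suc (suc x))) (deg≤1 x))))
                (+-identityʳ _))

  sumP-map : ∀ {A : Set} (g : A → Poly) xs i → sumP (map g xs) i ≡ ∑ (λ x → g x i) xs
  sumP-map g []       zero    = refl
  sumP-map g []       (suc i) = refl
  sumP-map g (x ∷ xs) i       = cong (g x i +_) (sumP-map g xs i)

  ∑-tabulate : ∀ {A : Set} n (g : A → ℤ) (h : Fin n → A) → ∑ g (tabulate h) ≡ ∑ (g ∘ h) (tabulate id)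
  ∑-tabulate zero    g h = refl
  ∑-tabulate (suc n) g h =
    cong (g (h zero) +_) (trans (∑-tabulate n g (h ∘ suc)) (sym (∑-tabulate n (g ∘ h) suc)))

  alt∑-select-tabulate : ∀ {V : Set} m (cf : Fin (suc m) → V) (F : V → List V → ℤ) →
    alt∑ (λ (x , C) → F x C) (select (tabulate cf))
      ≡ ∑ (λ j → (-1ℤ ^ toℕ j) * F (cf j) (tabulate (cf ∘ punchIn j))) (tabulate id)
  alt∑-select-tabulate zero    cf F = last (F (cf zero) [])
    where
    last : ∀ x → x - 0ℤ ≡ 1ℤ * x + 0ℤ
    last = solve-∀
  alt∑-select-tabulate {V} (suc m) cf F = begin
      alt∑ (λ (x , C) → F x C) (select (tabulate cf))
    ≡⟨ alt∑-select (λ (x , C) → F x C) (cf zero) (tabulate (cf ∘ suc)) ⟩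
      X - alt∑ (λ (x , C) → F x (cf zero ∷ C)) (select (tabulate (cf ∘ suc)))
    ≡⟨ cong (λ t → X - t) (alt∑-select-tabulate m (cf ∘ suc) (λ x C → F x (cf zero ∷ C))) ⟩
      X - ∑ G (tabulate id)
    ≡⟨ signs X (∑ G (tabulate id)) ⟩
      1ℤ * X + -1ℤ * ∑ G (tabulate id)
    ≡⟨ cong (1ℤ * X +_) (sym (∑-*ˡ -1ℤ G (tabulate id))) ⟩
      1ℤ * X + ∑ (λ j → -1ℤ * G j) (tabulate id)
    ≡⟨ cong (1ℤ * X +_) (∑-cong (λ j → sym (*-assoc -1ℤ (-1ℤ ^ toℕ j) (F (cf (suc j)) (columns j)))) (tabulate id)) ⟩
      1ℤ * X + ∑ (H ∘ suc) (tabulate id)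
    ≡⟨ cong (1ℤ * X +_) (sym (∑-tabulate (suc m) H suc)) ⟩
      ∑ H (tabulate id) ∎
    where
    open ≡-Reasoning
    X : ℤ
    X = F (cf zero) (tabulate (cf ∘ suc))
    columns : Fin (suc m) → List V
    columns j = cf zero ∷ tabulate (cf ∘ suc ∘ punchIn j)
    G : Fin (suc m) → ℤ
    G j = (-1ℤ ^ toℕ j) * F (cf (suc j)) (columns j)
    H : Fin (suc (suc m)) → ℤ
    H j = (-1ℤ ^ toℕ j) * F (cf j) (tabulate (cf ∘ punchIn j))
    signs : ∀ x s → x - s ≡ 1ℤ * x + -1ℤ * s
    signs = solve-∀

  private
    scale : ∀ s a b (D : Poly) i → ((s * a , s * b + 0ℤ * a) *ₗ D) i ≡ s * ((a , b) *ₗ D) i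
    scale s a b D zero    = *-assoc s a (D 0)
    scale s a b D (suc i) = distrib s a b (D (suc i)) (D i)
      where
      distrib : ∀ s a b x y → s * a * x + (s * b + 0ℤ * a) * y ≡ s * (a * x + b * y)
      distrib = solve-∀

  laplaceTerm : ∀ s (p D D′ : Poly) u → (∀ i → p i ≡ linearPoly u i) → (∀ i → D i ≡ D′ i) →
                ∀ i → ((constP s *P p) *P D) i ≡ s * (u *ₗ D′) i
  laplaceTerm s p D D′ (a , b) p≗u D≗D′ i = begin
      ((constP s *P p) *P D) i
    ≡⟨ *P-linear (constP s *P p) D vanish i ⟩
      (((constP s *P p) 0 , (constP s *P p) 1) *ₗ D) i
    ≡⟨ cong₂ (λ x y → ((x , y) *ₗ D) i) (sp 0) (sp 1) ⟩
      ((s * a , s * b + 0ℤ * a) *ₗ D) i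
    ≡⟨ scale s a b D i ⟩
      s * ((a , b) *ₗ D) i
    ≡⟨ cong (s *_) (*ₗ-cong (a , b) D≗D′ i) ⟩
      s * ((a , b) *ₗ D′) i ∎
    where
    open ≡-Reasoning
    sp : ∀ i → (constP s *P p) i ≡ ((s , 0ℤ) *ₗ linearPoly (a , b)) i
    sp i = trans (*P-linear (constP s) p (λ _ → refl) i) (*ₗ-cong (s , 0ℤ) p≗u i)
    annihilate : ∀ s y → s * 0ℤ + 0ℤ * y ≡ 0ℤ
    annihilate = solve-∀
    vanish : ∀ k → (constP s *P p) (suc (suc k)) ≡ 0ℤ
    vanish k = trans (sp (suc (suc k))) (annihilate s (linearPoly (a , b) (suc k)))

  module _ {V : Set} (e : V → V → Linear) where

    det≡detL : ∀ m (M : Fin m → Fin m → Poly) (rf cf : Fin m → V) →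
               (∀ r c i → M r c i ≡ linearPoly (e (rf r) (cf c)) i) →
               ∀ i → det m M i ≡ detL e (tabulate rf) (tabulate cf) i
    det≡detL zero    M rf cf M≗e zero    = refl
    det≡detL zero    M rf cf M≗e (suc i) = refl
    det≡detL (suc m) M rf cf M≗e i = begin
        det (suc m) M i
      ≡⟨ sumP-map term (tabulate id) i ⟩
        ∑ (λ j → term j i) (tabulate id)
      ≡⟨ ∑-cong (λ j → laplaceTerm (-1ℤ ^ toℕ j) (M zero j) _ _ (e (rf zero) (cf j)) (M≗e zero j)
                         (det≡detL m (minor j) (rf ∘ suc) (cf ∘ punchIn j) (λ r c → M≗e (suc r) (punchIn j c))) i)
                (tabulate id) ⟩
        ∑ (λ j → (-1ℤ ^ toℕ j) * (e (rf zero) (cf j) *ₗ detL e (tabulate (rf ∘ suc)) (tabulate (cf ∘ punchIn j))) i)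
          (tabulate id)
      ≡⟨ sym (alt∑-select-tabulate m cf (λ x C → (e (rf zero) x *ₗ detL e (tabulate (rf ∘ suc)) C) i)) ⟩
        detL e (tabulate rf) (tabulate cf) i ∎
      where
      open ≡-Reasoning
      minor : Fin (suc m) → Fin m → Fin m → Poly
      minor j r c = M (suc r) (punchIn j c)
      term : Fin (suc m) → Poly
      term j = (constP (-1ℤ ^ toℕ j) *P M zero j) *P det m (minor j)

module Arrangements where

  open Sums
  open Lists
  open import Data.Empty using (⊥-elim)
  open import Data.Integer using (ℤ; _+_; _*_; 1ℤ)
  open import Data.Integer.Properties using (+-identityˡ; +-identityʳ; *-identityˡ; *-assoc)
  open import Data.Nat as ℕ using (ℕ; zero; suc; _≤_; z≤n; s≤s)
  open import Data.Nat.Properties using (≤-pred; +-assoc; +-suc)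
  open import Data.List using (List; []; _∷_; [_]; _++_; map; concatMap; concat; filter; length)
  open import Data.List.Properties using (filter-accept; filter-reject; filter-all; filter-++; ≡-dec; length-++)
  open import Data.List.Membership.Propositional using (_∈_; _∉_)
  open import Data.List.Membership.Propositional.Properties using (∈-filter⁺; ∈-filter⁻; ∈-∃++)
  open import Data.List.Relation.Unary.All as All using (All; []; _∷_)
  import Data.List.Relation.Unary.All.Properties as All
  open import Data.List.Relation.Unary.Any using (here; there)
  open import Data.List.Relation.Unary.Unique.Propositional using (Unique; []; _∷_)
  import Data.List.Relation.Unary.Unique.Propositional.Properties as Unique
  open import Data.List.Relation.Binary.Permutation.Propositional using (_↭_; prep; ↭-trans; ↭-reflexive)
  open import Data.List.Relation.Binary.Permutation.Propositional.Properties using (shift; ↭-length)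
  open import Data.Product using (_×_; _,_; proj₁; proj₂)
  open import Relation.Binary.Definitions using (DecidableEquality)
  open import Relation.Binary.PropositionalEquality using (_≡_; _≢_; refl; sym; trans; cong; cong₂; subst; module ≡-Reasoning)
  open import Relation.Nullary using (¬_; ¬?)

  module _ {V : Set} where

    -- (t , R) ∈ arrangements f W: t lists distinct elements of W (at most f of them) in some
    -- order, and R is what remains of W
    mutual
      arrangements : ℕ → List V → List (List V × List V)
      arrangements f W = ([] , W) ∷ arrangements⁺ f W

      arrangements⁺ : ℕ → List V → List (List V × List V)
      arrangements⁺ zero    W = []
      arrangements⁺ (suc f) W = concatMap (λ (x , C) → map (λ (q , R) → x ∷ q , R) (arrangements f C)) (select W)

    ∑-arrangements⁺ : ∀ f (F : List V → List V → ℤ) W →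
      ∑ (λ (t , R) → F t R) (arrangements⁺ (suc f) W)
        ≡ ∑ (λ (x , C) → ∑ (λ (q , R) → F (x ∷ q) R) (arrangements f C)) (select W)
    ∑-arrangements⁺ f F W = trans (∑-concatMap (λ (t , R) → F t R) _ (select W))
                                  (∑-cong (λ (x , C) → ∑-map (λ (t , R) → F t R) (λ (q , R) → x ∷ q , R) (arrangements f C)) (select W))

    arrangements⁺-nonempty : ∀ f (W : List V) → All (λ (t , _) → t ≢ []) (arrangements⁺ f W)
    arrangements⁺-nonempty zero    W = []
    arrangements⁺-nonempty (suc f) W =
      All.concat⁺ (All.map⁺ (All.universal (λ _ → All.map⁺ (All.universal (λ _ ()) _)) (select W)))

    -- (ω , k) ∈ configurations f W: ω lists vertex-disjoint cyclic sequences in W, each beginning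
    -- with its first vertex in the order of W, and k counts the vertices of W left uncovered
    configurations : ℕ → List V → List (List (List V) × ℕ)
    configurations f       []      = ([] , 0) ∷ []
    configurations zero    (v ∷ W) = []
    configurations (suc f) (v ∷ W) =
      map (λ (ω , k) → ω , suc k) (configurations f W) ++
      concatMap (λ (t , R) → map (λ (ω , k) → (v ∷ t) ∷ ω , k) (configurations f R)) (arrangements⁺ (suc f) W)

    ∑-configurations-∷ : ∀ f v W (G : List (List V) × ℕ → ℤ) →
      ∑ G (configurations (suc f) (v ∷ W))
        ≡ ∑ (λ (ω , k) → G (ω , suc k)) (configurations f W)
          + ∑ (λ (t , R) → ∑ (λ (ω , k) → G ((v ∷ t) ∷ ω , k)) (configurations f R)) (arrangements⁺ (suc f) W)
    ∑-configurations-∷ f v W G =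
      trans (∑-++ G (map (λ (ω , k) → ω , suc k) (configurations f W)) _)
            (cong₂ _+_ (∑-map G (λ (ω , k) → ω , suc k) (configurations f W))
                       (trans (∑-concatMap G _ (arrangements⁺ (suc f) W))
                              (∑-cong (λ (t , R) → ∑-map G (λ (ω , k) → (v ∷ t) ∷ ω , k) (configurations f R))
                                      (arrangements⁺ (suc f) W))))

  module Removal {V : Set} (_≟_ : DecidableEquality V) where

    open import Data.List.Membership.DecPropositional _≟_ using (_∈?_)

    infixl 6 _∖_

    _∖_ : List V → List V → List V
    W ∖ t = filter (λ y → ¬? (y ∈? t)) W

    ∖-[] : ∀ W → W ∖ [] ≡ W
    ∖-[] W = filter-all (λ y → ¬? (y ∈? [])) (All.universal (λ _ ()) W)

    ∖-∷ : ∀ y t W → W ∖ [ y ] ∖ t ≡ W ∖ (y ∷ t)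
    ∖-∷ y t W = filter-filter (λ z → ¬? (z ∈? t)) (λ z → ¬? (z ∈? [ y ])) (λ z → ¬? (z ∈? (y ∷ t)))
      (λ z∉ → (λ z∈ → z∉ (there z∈)) , (λ { (here z≡y) → z∉ (here z≡y) }))
      (λ z∉t z∉y → λ { (here z≡y) → z∉y (here z≡y) ; (there z∈) → z∉t z∈ }) W

    ∖-unique : ∀ t {W} → Unique W → Unique (W ∖ t)
    ∖-unique t = Unique.filter⁺ (λ y → ¬? (y ∈? t))

    ∈-∖⁻ : ∀ {t W y} → y ∈ W ∖ t → y ∈ W × y ∉ t
    ∈-∖⁻ {t} = ∈-filter⁻ (λ y → ¬? (y ∈? t))

    ∈-∖⁺ : ∀ {t W y} → y ∈ W → y ∉ t → y ∈ W ∖ t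
    ∈-∖⁺ {t} = ∈-filter⁺ (λ y → ¬? (y ∈? t))

    private
      ∖-disjoint : ∀ {x} W → All (_≢ x) W → W ∖ [ x ] ≡ W
      ∖-disjoint {x} W ≢x = filter-all (λ y → ¬? (y ∈? [ x ])) (All.map (λ y≢x → λ { (here y≡x) → y≢x y≡x }) ≢x)

    ∖-head : ∀ c C → All (c ≢_) C → (c ∷ C) ∖ [ c ] ≡ C
    ∖-head c C c≢ = trans (filter-reject (λ y → ¬? (y ∈? [ c ])) (λ c∉ → c∉ (here refl)))
                          (∖-disjoint C (All.map (λ c≢y y≡c → c≢y (sym y≡c)) c≢))

    ∖-cons : ∀ c x C → c ≢ x → (c ∷ C) ∖ [ x ] ≡ c ∷ C ∖ [ x ]
    ∖-cons c x C c≢x = filter-accept (λ y → ¬? (y ∈? [ x ])) (λ { (here c≡x) → c≢x c≡x })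

    ↭-∖-singleton : ∀ {x W} → Unique W → x ∈ W → W ↭ x ∷ W ∖ [ x ]
    ↭-∖-singleton {x} u x∈W with ∈-∃++ x∈W
    ... | a , b , refl = ↭-trans (shift x a b) (prep x (↭-reflexive (sym remove-x)))
      where
      open ≡-Reasoning
      remove-x : (a ++ x ∷ b) ∖ [ x ] ≡ a ++ b
      remove-x with Unique-middle a u
      ... | a≢x , x≢b = begin
          (a ++ x ∷ b) ∖ [ x ]
        ≡⟨ filter-++ (λ y → ¬? (y ∈? [ x ])) a (x ∷ b) ⟩
          a ∖ [ x ] ++ (x ∷ b) ∖ [ x ]
        ≡⟨ cong₂ _++_ (∖-disjoint a a≢x) (∖-head x b x≢b) ⟩
          a ++ b ∎

    select-spec : ∀ {W} → Unique W → All (λ (x , C) → x ∈ W × C ≡ W ∖ [ x ]) (select W)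
    select-spec {[]}    u          = []
    select-spec {c ∷ C} (c∉ ∷ u) =
      (here refl , sym (∖-head c C c∉)) ∷
      All.map⁺ (All.map (λ (y∈ , C′≡) → there y∈ , trans (cong (c ∷_) C′≡) (sym (∖-cons c _ C (λ c≡y → All.lookup c∉ y∈ c≡y))))
                        (select-spec u))

    IsArrangement : List V → List V × List V → Set
    IsArrangement W (t , R) = All (_∈ W) t × Unique t × R ≡ W ∖ t × length t ℕ.+ length R ≡ length W

    arrangements-spec : ∀ f {W} → Unique W → All (IsArrangement W) (arrangements f W)
    arrangements-spec f {W} u = ([] , [] , sym (∖-[] W) , refl) ∷ arrangements⁺-spec f
      where
      arrangements⁺-spec : ∀ f → All (IsArrangement W) (arrangements⁺ f W)
      arrangements⁺-spec zero    = []
      arrangements⁺-spec (suc f) = All.concat⁺ (All.map⁺ (All.map extend (select-spec u)))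
        where
        extend : ∀ {(y , C) : V × List V} → y ∈ W × C ≡ W ∖ [ y ] →
                 All (IsArrangement W) (map (λ (q , R) → y ∷ q , R) (arrangements f C))
        extend {y , _} (y∈ , refl) =
          All.map⁺ (All.map cons (arrangements-spec f (∖-unique [ y ] u)))
          where
          cons : ∀ {(p , R) : List V × List V} → IsArrangement (W ∖ [ y ]) (p , R) → IsArrangement W (y ∷ p , R)
          cons {p , R} (p⊆ , up , refl , len) =
            y∈ ∷ All.map (λ z∈ → proj₁ (∈-∖⁻ {[ y ]} {W} z∈)) p⊆ ,
            All.map (λ z∈ y≡z → proj₂ (∈-∖⁻ {[ y ]} {W} z∈) (here (sym y≡z))) p⊆ ∷ up ,
            ∖-∷ y p W ,
            trans (cong suc len) (sym (↭-length (↭-∖-singleton u y∈)))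

    ∑-arrangements⁺-cong : ∀ f W {F G : List V → List V → ℤ} → Unique W →
      (∀ t → t ≢ [] → All (_∈ W) t → Unique t → F t (W ∖ t) ≡ G t (W ∖ t)) →
      ∑ (λ (t , R) → F t R) (arrangements⁺ f W) ≡ ∑ (λ (t , R) → G t R) (arrangements⁺ f W)
    ∑-arrangements⁺-cong f W {F} {G} u F≗G with arrangements-spec f u
    ... | _ ∷ spec = ∑-congᴬ (All.zipWith agree (arrangements⁺-nonempty f W , spec))
      where
      agree : ∀ {(t , R) : List V × List V} → t ≢ [] × IsArrangement W (t , R) → F t R ≡ G t R
      agree {t , _} (t≢[] , t⊆ , ut , refl , _) = F≗G t t≢[] t⊆ ut

    infix 4 _≟ₗ_

    _≟ₗ_ : DecidableEquality (List V)
    _≟ₗ_ = ≡-dec _≟_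

    private
      ∑-𝟙-unique : ∀ {W} x₀ → Unique W → x₀ ∈ W → ∑ (λ x → 𝟙 (x ≟ x₀)) W ≡ 1ℤ
      ∑-𝟙-unique {c ∷ C} x₀ (c∉ ∷ u) (here refl) =
        trans (cong₂ _+_ (𝟙-yes (c ≟ c) refl) (∑-zeroᴬ (All.map (λ c≢x → 𝟙-no (_ ≟ c) (λ x≡c → c≢x (sym x≡c))) c∉)))
              (+-identityʳ 1ℤ)
      ∑-𝟙-unique {c ∷ C} x₀ (c∉ ∷ u) (there x₀∈) =
        trans (cong₂ _+_ (𝟙-no (c ≟ x₀) (λ c≡x₀ → All.lookup c∉ x₀∈ c≡x₀)) (∑-𝟙-unique x₀ u x₀∈)) (+-identityˡ 1ℤ)

    ∑-select-𝟙 : ∀ {W} x₀ (H : V → List V → ℤ) → Unique W → x₀ ∈ W →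
                 ∑ (λ (x , C) → 𝟙 (x ≟ x₀) * H x C) (select W) ≡ H x₀ (W ∖ [ x₀ ])
    ∑-select-𝟙 {W} x₀ H u x₀∈ = begin
        ∑ (λ (x , C) → 𝟙 (x ≟ x₀) * H x C) (select W)
      ≡⟨ ∑-congᴬ (All.map (λ (_ , C≡) → 𝟙-guard (_ ≟ x₀) (λ { refl → cong (H x₀) C≡ })) (select-spec u)) ⟩
        ∑ (λ (x , _) → 𝟙 (x ≟ x₀) * K) (select W)
      ≡⟨ ∑-*ʳ (λ (x , _) → 𝟙 (x ≟ x₀)) K (select W) ⟩
        ∑ (λ (x , _) → 𝟙 (x ≟ x₀)) (select W) * K
      ≡⟨ cong (_* K) (sym (∑-map (λ x → 𝟙 (x ≟ x₀)) proj₁ (select W))) ⟩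
        ∑ (λ x → 𝟙 (x ≟ x₀)) (map proj₁ (select W)) * K
      ≡⟨ cong (λ xs → ∑ (λ x → 𝟙 (x ≟ x₀)) xs * K) (map-proj₁-select W) ⟩
        ∑ (λ x → 𝟙 (x ≟ x₀)) W * K
      ≡⟨ cong (_* K) (∑-𝟙-unique x₀ u x₀∈) ⟩
        1ℤ * K
      ≡⟨ *-identityˡ K ⟩
        K ∎
      where
      open ≡-Reasoning
      K : ℤ
      K = H x₀ (W ∖ [ x₀ ])

    private
      𝟙-∷ : ∀ (x : V) q y t → 𝟙 (x ∷ q ≟ₗ y ∷ t) ≡ 𝟙 (x ≟ y) * 𝟙 (q ≟ₗ t)
      𝟙-∷ x q y t = 𝟙-× (x ∷ q ≟ₗ y ∷ t) (x ≟ y) (q ≟ₗ t) (λ { refl → refl , refl }) (λ { refl refl → refl })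

      shrink : ∀ {y t W} → Unique (y ∷ t) → All (_∈ W) t → All (_∈ W ∖ [ y ]) t
      shrink {y} {t} {W} (y∉ ∷ _) t⊆ =
        All.zipWith (λ (z∈ , y≢z) → ∈-∖⁺ {[ y ]} {W} z∈ (λ { (here z≡y) → y≢z (sym z≡y) })) (t⊆ , y∉)

    mutual
      ∑-arrangements-𝟙 : ∀ f W t₀ (G : List V → ℤ) → Unique W → Unique t₀ → All (_∈ W) t₀ → length W ≤ f →
                         ∑ (λ (t , _) → 𝟙 (t ≟ₗ t₀) * G t) (arrangements f W) ≡ G t₀
      ∑-arrangements-𝟙 f W [] G uW ut t⊆ len =
        trans (cong₂ _+_ (cong (_* G []) (𝟙-yes ([] ≟ₗ []) refl))
                         (∑-zeroᴬ (All.map (λ t≢[] → cong (_* _) (𝟙-no (_ ≟ₗ []) t≢[])) (arrangements⁺-nonempty f W))))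
              (trans (+-identityʳ _) (*-identityˡ (G [])))
      ∑-arrangements-𝟙 f W (y ∷ t) G uW ut t⊆ len =
        trans (cong₂ _+_ (cong (_* G []) (𝟙-no ([] ≟ₗ y ∷ t) (λ ()))) (∑-arrangements⁺-𝟙 f W y t G uW ut t⊆ len))
              (+-identityˡ _)

      ∑-arrangements⁺-𝟙 : ∀ f W y t (G : List V → ℤ) → Unique W → Unique (y ∷ t) → All (_∈ W) (y ∷ t) → length W ≤ f →
                          ∑ (λ (t′ , _) → 𝟙 (t′ ≟ₗ y ∷ t) * G t′) (arrangements⁺ f W) ≡ G (y ∷ t)
      ∑-arrangements⁺-𝟙 zero    []      y t G uW ut (() ∷ _) len
      ∑-arrangements⁺-𝟙 (suc f) W       y t G uW ut (y∈ ∷ t⊆) len = begin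
          ∑ (λ (t′ , _) → 𝟙 (t′ ≟ₗ y ∷ t) * G t′) (arrangements⁺ (suc f) W)
        ≡⟨ ∑-arrangements⁺ f (λ t′ _ → 𝟙 (t′ ≟ₗ y ∷ t) * G t′) W ⟩
          ∑ (λ (x , C) → ∑ (λ (q , _) → 𝟙 (x ∷ q ≟ₗ y ∷ t) * G (x ∷ q)) (arrangements f C)) (select W)
        ≡⟨ ∑-cong (λ (x , C) → trans (∑-cong (λ (q , _) → factor x q) (arrangements f C))
                                     (∑-*ˡ (𝟙 (x ≟ y)) (λ (q , _) → 𝟙 (q ≟ₗ t) * G (x ∷ q)) (arrangements f C)))
                  (select W) ⟩
          ∑ (λ (x , C) → 𝟙 (x ≟ y) * ∑ (λ (q , _) → 𝟙 (q ≟ₗ t) * G (x ∷ q)) (arrangements f C)) (select W)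
        ≡⟨ ∑-select-𝟙 y (λ x C → ∑ (λ (q , _) → 𝟙 (q ≟ₗ t) * G (x ∷ q)) (arrangements f C)) uW y∈ ⟩
          ∑ (λ (q , _) → 𝟙 (q ≟ₗ t) * G (y ∷ q)) (arrangements f (W ∖ [ y ]))
        ≡⟨ ∑-arrangements-𝟙 f (W ∖ [ y ]) t (λ q → G (y ∷ q)) (∖-unique [ y ] uW) (tail ut) (shrink ut t⊆) len′ ⟩
          G (y ∷ t) ∎
        where
        open ≡-Reasoning
        tail : ∀ {y : V} {t} → Unique (y ∷ t) → Unique t
        tail (_ ∷ u) = u
        factor : ∀ x q → 𝟙 (x ∷ q ≟ₗ y ∷ t) * G (x ∷ q) ≡ 𝟙 (x ≟ y) * (𝟙 (q ≟ₗ t) * G (x ∷ q))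
        factor x q = trans (cong (_* G (x ∷ q)) (𝟙-∷ x q y t)) (*-assoc (𝟙 (x ≟ y)) _ _)
        len′ : length (W ∖ [ y ]) ≤ f
        len′ = ≤-pred (subst (_≤ suc f) (↭-length (↭-∖-singleton uW y∈)) len)

    IsConfiguration : List V → List (List V) × ℕ → Set
    IsConfiguration W (ω , k) =
      All (_∈ W) (concat ω) × Unique (concat ω) × All (λ c → 2 ≤ length c) ω × length (concat ω) ℕ.+ k ≡ length W

    private
      IsConfiguration-∷ : ∀ {v W t ω k} → v ∉ W → t ≢ [] → IsArrangement W (t , W ∖ t) →
                          IsConfiguration (W ∖ t) (ω , k) → IsConfiguration (v ∷ W) ((v ∷ t) ∷ ω , k)
      IsConfiguration-∷ {v} {W} {t} {ω} {k} v∉W t≢[] (t⊆ , ut , _ , len-t) (ω⊆ , uω , long , len-ω) =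
        here refl ∷ All.++⁺ (All.map there t⊆) (All.map (λ z∈ → there (proj₁ (∈-∖⁻ {t} {W} z∈))) ω⊆) ,
        All.++⁺ (All.map v≢ t⊆) (All.map (λ z∈ → v≢ (proj₁ (∈-∖⁻ {t} {W} z∈))) ω⊆) ∷ Unique.++⁺ ut uω disjoint ,
        two≤ t t≢[] ∷ long ,
        cong suc (begin
          length (t ++ concat ω) ℕ.+ k         ≡⟨ cong (ℕ._+ k) (length-++ t) ⟩
          length t ℕ.+ length (concat ω) ℕ.+ k ≡⟨ +-assoc (length t) _ k ⟩
          length t ℕ.+ (length (concat ω) ℕ.+ k) ≡⟨ cong (length t ℕ.+_) len-ω ⟩
          length t ℕ.+ length (W ∖ t)          ≡⟨ len-t ⟩
          length W                             ∎)
        where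
        open ≡-Reasoning
        v≢ : ∀ {z} → z ∈ W → v ≢ z
        v≢ z∈ refl = v∉W z∈
        disjoint : ∀ {z} → ¬ (z ∈ t × z ∈ concat ω)
        disjoint (z∈t , z∈ω) = proj₂ (∈-∖⁻ {t} {W} (All.lookup ω⊆ z∈ω)) z∈t
        two≤ : ∀ (t : List V) → t ≢ [] → 2 ≤ length (v ∷ t)
        two≤ []      t≢[] = ⊥-elim (t≢[] refl)
        two≤ (_ ∷ _) _    = s≤s (s≤s z≤n)

    configurations-spec : ∀ f {W} → Unique W → All (IsConfiguration W) (configurations f W)
    configurations-spec f       {[]}    u         = ([] , [] , [] , refl) ∷ []
    configurations-spec zero    {v ∷ W} u         = []
    configurations-spec (suc f) {v ∷ W} (v∉W ∷ u) =
      All.++⁺ (All.map⁺ (All.map (λ (ω⊆ , uω , long , len) → All.map there ω⊆ , uω , long , trans (+-suc _ _) (cong suc len))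
                                 (configurations-spec f u)))
              (All.concat⁺ (All.map⁺ (All.zipWith cycle (arrangements⁺-nonempty (suc f) W , arrangements⁺-spec))))
      where
      arrangements⁺-spec : All (IsArrangement W) (arrangements⁺ (suc f) W)
      arrangements⁺-spec with arrangements-spec (suc f) u
      ... | _ ∷ spec = spec
      cycle : ∀ {(t , R) : List V × List V} → t ≢ [] × IsArrangement W (t , R) →
              All (IsConfiguration (v ∷ W)) (map (λ (ω , k) → (v ∷ t) ∷ ω , k) (configurations f R))
      cycle (t≢[] , arr@(_ , _ , refl , _)) =
        All.map⁺ (All.map (IsConfiguration-∷ (λ v∈ → All.lookup v∉W v∈ refl) t≢[] arr)
                          (configurations-spec f (∖-unique _ u)))

module Sachs where

  open Sums
  open Lists
  open ListDeterminant
  open Arrangements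
  open import Defs using (Poly; rotate)
  open import Data.Empty using (⊥-elim)
  open import Data.Integer using (ℤ; -_; _+_; _*_; _-_; 0ℤ; 1ℤ)
  open import Data.Integer.Properties using (*-zeroʳ; *-assoc; *-comm)
  open import Data.Integer.Tactic.RingSolver using (solve-∀)
  open import Data.Nat using (ℕ; zero; suc; _≤_; s≤s)
  open import Data.Nat.Properties using (≤-pred; ≤-trans; n≤1+n)
  open import Data.List using (List; []; _∷_; [_]; _++_; map; length; reverse; take; drop)
  open import Data.List.Properties using (length-filter; ++-identityʳ; take++drop≡id; unfold-reverse)
  open import Data.List.Relation.Unary.All as All using (All; []; _∷_)
  open import Data.List.Relation.Unary.Unique.Propositional using (Unique; []; _∷_)
  open import Data.List.Relation.Binary.Permutation.Propositional using (_↭_; prep)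
  open import Data.List.Relation.Binary.Permutation.Propositional.Properties using (↭-length; All-resp-↭)
  open import Data.Product using (_×_; _,_)
  open import Relation.Binary.Definitions using (DecidableEquality)
  open import Relation.Binary.PropositionalEquality using (_≡_; _≢_; refl; sym; trans; cong; cong₂; subst; module ≡-Reasoning)
  open import Relation.Nullary using (yes; no)

  δ : ℕ → ℕ → ℤ
  δ zero    zero    = 1ℤ
  δ zero    (suc _) = 0ℤ
  δ (suc _) zero    = 0ℤ
  δ (suc k) (suc i) = δ k i

  δ-nonzero : ∀ m i → δ m i ≢ 0ℤ → m ≡ i
  δ-nonzero zero    zero    _  = refl
  δ-nonzero zero    (suc i) nz = ⊥-elim (nz refl)
  δ-nonzero (suc m) zero    nz = ⊥-elim (nz refl)
  δ-nonzero (suc m) (suc i) nz = cong suc (δ-nonzero m i nz)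

  δ-refl : ∀ i → δ i i ≡ 1ℤ
  δ-refl zero    = refl
  δ-refl (suc i) = δ-refl i

  shift : Poly → Poly
  shift p zero    = 0ℤ
  shift p (suc i) = p i

  module Weights {V : Set} (A : V → V → ℤ) where

    pathWeight : V → List V → V → ℤ
    pathWeight u []      v = A u v
    pathWeight u (x ∷ p) v = A u x * pathWeight x p v

    cycleWeight : List V → ℤ
    cycleWeight []      = 1ℤ
    cycleWeight (v ∷ t) = - pathWeight v t v

    pathWeight-++ : ∀ u p x q v → pathWeight u (p ++ x ∷ q) v ≡ pathWeight u p x * pathWeight x q v
    pathWeight-++ u []      x q v = refl
    pathWeight-++ u (y ∷ p) x q v =
      trans (cong (A u y *_) (pathWeight-++ y p x q v)) (sym (*-assoc (A u y) _ _))

    cycleWeight-++-comm : ∀ xs ys → cycleWeight (xs ++ ys) ≡ cycleWeight (ys ++ xs)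
    cycleWeight-++-comm []       ys       = cong cycleWeight (sym (++-identityʳ ys))
    cycleWeight-++-comm (x ∷ xs) []       = cong cycleWeight (++-identityʳ (x ∷ xs))
    cycleWeight-++-comm (x ∷ xs) (y ∷ ys) = cong -_ (begin
        pathWeight x (xs ++ y ∷ ys) x      ≡⟨ pathWeight-++ x xs y ys x ⟩
        pathWeight x xs y * pathWeight y ys x ≡⟨ *-comm (pathWeight x xs y) _ ⟩
        pathWeight y ys x * pathWeight x xs y ≡⟨ sym (pathWeight-++ y ys x xs y) ⟩
        pathWeight y (ys ++ x ∷ xs) y      ∎)
      where open ≡-Reasoning

    cycleWeight-rotate : ∀ i us → cycleWeight (rotate i us) ≡ cycleWeight us
    cycleWeight-rotate i us =
      trans (cycleWeight-++-comm (drop i us) (take i us)) (cong cycleWeight (take++drop≡id i us))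

    module _ (A-sym : ∀ u v → A u v ≡ A v u) where

      pathWeight-reverse : ∀ u p v → pathWeight u p v ≡ pathWeight v (reverse p) u
      pathWeight-reverse u []      v = A-sym u v
      pathWeight-reverse u (x ∷ p) v = begin
          A u x * pathWeight x p v               ≡⟨ cong₂ _*_ (A-sym u x) (pathWeight-reverse x p v) ⟩
          A x u * pathWeight v (reverse p) x     ≡⟨ *-comm (A x u) _ ⟩
          pathWeight v (reverse p) x * A x u     ≡⟨ sym (pathWeight-++ v (reverse p) x [] u) ⟩
          pathWeight v (reverse p ++ [ x ]) u    ≡⟨ cong (λ q → pathWeight v q u) (sym (unfold-reverse x p)) ⟩
          pathWeight v (reverse (x ∷ p)) u       ∎
        where open ≡-Reasoning

      cycleWeight-reverseTail : ∀ v q → cycleWeight (v ∷ reverse q) ≡ cycleWeight (v ∷ q)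
      cycleWeight-reverseTail v q = cong -_ (sym (pathWeight-reverse v q v))

  module Expansion {V : Set} (_≟_ : DecidableEquality V) (A : V → V → ℤ) (A-diag : ∀ v → A v v ≡ 0ℤ) where

    open Removal _≟_
    open Weights A

    charEntry : V → V → Linear
    charEntry r c = - A r c , 𝟙 (r ≟ c)

    charEntry-offDiag : ∀ {r c} → r ≢ c → ∀ (p : Poly) i → (charEntry r c *ₗ p) i ≡ - A r c * p i
    charEntry-offDiag {r} {c} r≢c p i with r ≟ c
    ... | yes r≡c = ⊥-elim (r≢c r≡c)
    ... | no _    = *ₗ-const (- A r c) p i

    charEntry-diag : ∀ v (p : Poly) i → (charEntry v v *ₗ p) i ≡ shift p i
    charEntry-diag v p i with v ≟ v
    ... | no v≢v = ⊥-elim (v≢v refl)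
    charEntry-diag v p zero    | yes _ rewrite A-diag v = refl
    charEntry-diag v p (suc i) | yes _ rewrite A-diag v = λ-shift (p (suc i)) (p i)
      where
      λ-shift : ∀ x y → - 0ℤ * x + 1ℤ * y ≡ y
      λ-shift = solve-∀

    private
      Δ : List V → List V → Poly
      Δ = detL charEntry

    mutual
      detL-minor : ∀ f v d R → length R ≤ f → Unique (v ∷ d ∷ R) → ∀ i →
                   Δ (d ∷ R) (v ∷ R) i ≡ ∑ (λ (t , R′) → - pathWeight d t v * Δ R′ R′ i) (arrangements f R)
      detL-minor zero    v d []      len ((v≢d ∷ _) ∷ _) i =
        trans (cong (_- 0ℤ) (charEntry-offDiag (λ d≡v → v≢d (sym d≡v)) (Δ [] []) i)) (sub-zero (- A d v * Δ [] [] i))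
        where
        sub-zero : ∀ x → x - 0ℤ ≡ x + 0ℤ
        sub-zero = solve-∀
      detL-minor (suc f) v d R       len ((v≢d ∷ v∉R) ∷ d∉R ∷ u) i = begin
          Δ (d ∷ R) (v ∷ R) i
        ≡⟨ alt∑-select (λ (x , C) → (charEntry d x *ₗ Δ R C) i) v R ⟩
          (charEntry d v *ₗ Δ R R) i - alt∑ (λ (x , C) → (charEntry d x *ₗ Δ R (v ∷ C)) i) (select R)
        ≡⟨ cong₂ _-_ (charEntry-offDiag (λ d≡v → v≢d (sym d≡v)) (Δ R R) i) (alt∑-paths f d v R len (v∉R ∷ u) d∉R i) ⟩
          - A d v * Δ R R i - ∑ (λ (t , R′) → pathWeight d t v * Δ R′ R′ i) (arrangements⁺ (suc f) R)
        ≡⟨ cong (- A d v * Δ R R i +_) (sym (∑-neg (λ (t , R′) → pathWeight d t v * Δ R′ R′ i) (arrangements⁺ (suc f) R))) ⟩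
          - A d v * Δ R R i + ∑ (λ (t , R′) → - (pathWeight d t v * Δ R′ R′ i)) (arrangements⁺ (suc f) R)
        ≡⟨ cong (- A d v * Δ R R i +_) (∑-cong (λ (t , R′) → neg-* (pathWeight d t v) (Δ R′ R′ i)) (arrangements⁺ (suc f) R)) ⟩
          ∑ (λ (t , R′) → - pathWeight d t v * Δ R′ R′ i) (arrangements (suc f) R) ∎
        where
        open ≡-Reasoning
        neg-* : ∀ a b → - (a * b) ≡ - a * b
        neg-* = solve-∀

      alt∑-paths : ∀ f d v R → length R ≤ suc f → Unique (v ∷ R) → All (d ≢_) R → ∀ i →
                   alt∑ (λ (x , C) → (charEntry d x *ₗ Δ R (v ∷ C)) i) (select R)
                     ≡ ∑ (λ (t , R′) → pathWeight d t v * Δ R′ R′ i) (arrangements⁺ (suc f) R)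
      alt∑-paths f d v R len u d∉R i = begin
          alt∑ (λ (x , C) → (charEntry d x *ₗ Δ R (v ∷ C)) i) (select R)
        ≡⟨ alt∑≡∑-rowToFront charEntry [] R (λ (x , _) → charEntry d x) (λ (_ , C) → v ∷ C) i ⟩
          ∑ (λ (x , C) → (charEntry d x *ₗ Δ (x ∷ C) (v ∷ C)) i) (select R)
        ≡⟨ ∑-congᴬ (All.map (λ {(x , C)} → expand x C) (select-↭ R)) ⟩
          ∑ (λ (x , C) → ∑ (λ (q , R′) → pathWeight d (x ∷ q) v * Δ R′ R′ i) (arrangements f C)) (select R)
        ≡⟨ sym (∑-arrangements⁺ f (λ t R′ → pathWeight d t v * Δ R′ R′ i) R) ⟩
          ∑ (λ (t , R′) → pathWeight d t v * Δ R′ R′ i) (arrangements⁺ (suc f) R) ∎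
        where
        open ≡-Reasoning
        neg-neg : ∀ a w D → - a * (- w * D) ≡ a * w * D
        neg-neg = solve-∀
        expand : ∀ x C → R ↭ x ∷ C →
                 (charEntry d x *ₗ Δ (x ∷ C) (v ∷ C)) i
                   ≡ ∑ (λ (q , R′) → pathWeight d (x ∷ q) v * Δ R′ R′ i) (arrangements f C)
        expand x C R↭ with Unique-resp-↭ (prep v R↭) u | All-resp-↭ R↭ d∉R
        ... | uvxC | d≢x ∷ _ = begin
            (charEntry d x *ₗ Δ (x ∷ C) (v ∷ C)) i
          ≡⟨ charEntry-offDiag d≢x _ i ⟩
            - A d x * Δ (x ∷ C) (v ∷ C) i
          ≡⟨ cong (- A d x *_) (detL-minor f v x C (≤-pred (subst (_≤ suc f) (↭-length R↭) len)) uvxC i) ⟩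
            - A d x * ∑ (λ (q , R′) → - pathWeight x q v * Δ R′ R′ i) (arrangements f C)
          ≡⟨ sym (∑-*ˡ (- A d x) (λ (q , R′) → - pathWeight x q v * Δ R′ R′ i) (arrangements f C)) ⟩
            ∑ (λ (q , R′) → - A d x * (- pathWeight x q v * Δ R′ R′ i)) (arrangements f C)
          ≡⟨ ∑-cong (λ (q , R′) → neg-neg (A d x) (pathWeight x q v) (Δ R′ R′ i)) (arrangements f C) ⟩
            ∑ (λ (q , R′) → pathWeight d (x ∷ q) v * Δ R′ R′ i) (arrangements f C) ∎

    detL-diag-∷ : ∀ f v W → length W ≤ suc f → Unique (v ∷ W) → ∀ i →
                  Δ (v ∷ W) (v ∷ W) i
                    ≡ shift (Δ W W) i + ∑ (λ (t , R) → cycleWeight (v ∷ t) * Δ R R i) (arrangements⁺ (suc f) W)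
    detL-diag-∷ f v W len (v∉W ∷ uW) i = begin
        Δ (v ∷ W) (v ∷ W) i
      ≡⟨ alt∑-select (λ (x , C) → (charEntry v x *ₗ Δ W C) i) v W ⟩
        (charEntry v v *ₗ Δ W W) i - alt∑ (λ (x , C) → (charEntry v x *ₗ Δ W (v ∷ C)) i) (select W)
      ≡⟨ cong₂ _-_ (charEntry-diag v (Δ W W) i) (alt∑-paths f v v W len (v∉W ∷ uW) v∉W i) ⟩
        shift (Δ W W) i - ∑ (λ (t , R) → pathWeight v t v * Δ R R i) (arrangements⁺ (suc f) W)
      ≡⟨ cong (shift (Δ W W) i +_) (sym (∑-neg (λ (t , R) → pathWeight v t v * Δ R R i) (arrangements⁺ (suc f) W))) ⟩
        shift (Δ W W) i + ∑ (λ (t , R) → - (pathWeight v t v * Δ R R i)) (arrangements⁺ (suc f) W)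
      ≡⟨ cong (shift (Δ W W) i +_) (∑-cong (λ (t , R) → neg-* (pathWeight v t v) (Δ R R i)) (arrangements⁺ (suc f) W)) ⟩
        shift (Δ W W) i + ∑ (λ (t , R) → cycleWeight (v ∷ t) * Δ R R i) (arrangements⁺ (suc f) W) ∎
      where
      open ≡-Reasoning
      neg-* : ∀ a b → - (a * b) ≡ - a * b
      neg-* = solve-∀

    detL≡∑configurations : ∀ f W → length W ≤ f → Unique W → ∀ i →
      Δ W W i ≡ ∑ (λ (ω , k) → ∏ cycleWeight ω * δ k i) (configurations f W)
    detL≡∑configurations f       []      len       u            zero    = refl
    detL≡∑configurations f       []      len       u            (suc i) = refl
    detL≡∑configurations (suc f) (v ∷ W) (s≤s len) u@(_ ∷ uW) i = begin
        Δ (v ∷ W) (v ∷ W) i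
      ≡⟨ detL-diag-∷ f v W (≤-trans len (n≤1+n f)) u i ⟩
        shift (Δ W W) i + ∑ (λ (t , R) → cycleWeight (v ∷ t) * Δ R R i) (arrangements⁺ (suc f) W)
      ≡⟨ cong₂ _+_ (fixed i) (∑-arrangements⁺-cong (suc f) W uW (λ t _ _ _ → cycles t)) ⟩
        ∑ (λ (ω , k) → Term (ω , suc k)) (configurations f W)
          + ∑ (λ (t , R) → ∑ (λ (ω , k) → Term ((v ∷ t) ∷ ω , k)) (configurations f R)) (arrangements⁺ (suc f) W)
      ≡⟨ sym (∑-configurations-∷ f v W Term) ⟩
        ∑ Term (configurations (suc f) (v ∷ W)) ∎
      where
      open ≡-Reasoning
      Term : List (List V) × ℕ → ℤ
      Term (ω , k) = ∏ cycleWeight ω * δ k i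
      fixed : ∀ j → shift (Δ W W) j ≡ ∑ (λ (ω , k) → ∏ cycleWeight ω * δ (suc k) j) (configurations f W)
      fixed zero    = sym (∑-zero _ (λ (ω , _) → *-zeroʳ (∏ cycleWeight ω)) (configurations f W))
      fixed (suc j) = detL≡∑configurations f W len uW j
      cycles : ∀ t → cycleWeight (v ∷ t) * Δ (W ∖ t) (W ∖ t) i
                       ≡ ∑ (λ (ω , k) → Term ((v ∷ t) ∷ ω , k)) (configurations f (W ∖ t))
      cycles t = begin
          cycleWeight (v ∷ t) * Δ (W ∖ t) (W ∖ t) i
        ≡⟨ cong (cycleWeight (v ∷ t) *_)
                (detL≡∑configurations f (W ∖ t) (≤-trans (length-filter _ W) len) (∖-unique t uW) i) ⟩
          cycleWeight (v ∷ t) * ∑ Term (configurations f (W ∖ t))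
        ≡⟨ sym (∑-*ˡ (cycleWeight (v ∷ t)) Term (configurations f (W ∖ t))) ⟩
          ∑ (λ ωk → cycleWeight (v ∷ t) * Term ωk) (configurations f (W ∖ t))
        ≡⟨ ∑-cong (λ (ω , k) → sym (*-assoc (cycleWeight (v ∷ t)) (∏ cycleWeight ω) (δ k i))) (configurations f (W ∖ t)) ⟩
          ∑ (λ (ω , k) → Term ((v ∷ t) ∷ ω , k)) (configurations f (W ∖ t)) ∎

module CanonicalParts where

  open Lists
  open import Defs using (Part; pair; cyc; vertices; rotate; PartEq; pair-same; pair-flip; cyc-rot; cyc-rev)
  open import Data.Empty using (⊥-elim)
  open import Data.Fin using (Fin; toℕ)
  open import Data.Fin.Properties using (toℕ-injective; toℕ<n)
  open import Data.Nat as ℕ using (ℕ; _≤_; _⊓_; _≟_; _≤?_)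
  open import Data.Nat.Properties
    using (≤-refl; ≤-trans; ≤-antisym; <⇒≤; ≰⇒>; ⊓-assoc; ⊓-comm; ⊓-sel; m⊓n≤m; m⊓n≤n; m≤n⇒m⊓n≡m; <-irrefl)
  open import Data.List using (List; []; _∷_; [_]; _++_; length; reverse; take; drop)
  open import Data.List.Properties using (++-assoc; reverse-++; reverse-involutive; take++drop≡id; unfold-reverse; ++-identityʳ)
  open import Data.List.Membership.Propositional using (_∈_; find)
  open import Data.List.Membership.Propositional.Properties using (∈-∃++; ∈-++⁻)
  open import Data.List.Relation.Unary.All as All using (All; []; _∷_)
  import Data.List.Relation.Unary.All.Properties as All
  open import Data.List.Relation.Unary.Any as Any using (Any; here; there)
  open import Data.List.Relation.Unary.Unique.Propositional using (Unique; []; _∷_)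
  open import Data.List.Relation.Binary.Permutation.Propositional using (_↭_; refl; prep; swap; trans; ↭-sym)
  open import Data.List.Relation.Binary.Permutation.Propositional.Properties using (↭-reverse; All-resp-↭; ++-comm; shift)
  open import Data.Product using (_×_; _,_; proj₁; proj₂; ∃)
  open import Data.Sum using (_⊎_; inj₁; inj₂)
  open import Function using (_∘_)
  open import Relation.Binary.PropositionalEquality as ≡ using (_≡_; _≢_; refl; sym; cong; cong₂; subst; subst₂; module ≡-Reasoning)
  open import Relation.Nullary using (yes; no; ¬_)

  module _ {n : ℕ} where

    -- the least index of a vertex in the list, or n for the empty list
    minIndex : List (Fin n) → ℕ
    minIndex []       = n
    minIndex (x ∷ xs) = toℕ x ⊓ minIndex xs

    minIndex-↭ : ∀ {xs ys} → xs ↭ ys → minIndex xs ≡ minIndex ys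
    minIndex-↭ refl          = refl
    minIndex-↭ (prep x p)    = cong (toℕ x ⊓_) (minIndex-↭ p)
    minIndex-↭ (swap x y p)  = ≡.trans (cong (λ m → toℕ x ⊓ (toℕ y ⊓ m)) (minIndex-↭ p)) (⊓-swap (toℕ x) (toℕ y) _)
      where
      ⊓-swap : ∀ a b c → a ⊓ (b ⊓ c) ≡ b ⊓ (a ⊓ c)
      ⊓-swap a b c = ≡.trans (sym (⊓-assoc a b c)) (≡.trans (cong (_⊓ c) (⊓-comm a b)) (⊓-assoc b a c))
    minIndex-↭ (trans p q)   = ≡.trans (minIndex-↭ p) (minIndex-↭ q)

    minIndex-≤ : ∀ {x xs} → x ∈ xs → minIndex xs ≤ toℕ x
    minIndex-≤ {xs = y ∷ ys} (here refl) = m⊓n≤m (toℕ y) (minIndex ys)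
    minIndex-≤ {xs = y ∷ ys} (there x∈)  = ≤-trans (m⊓n≤n (toℕ y) (minIndex ys)) (minIndex-≤ x∈)

    minIndex-attained : ∀ x xs → ∃ λ m → m ∈ x ∷ xs × toℕ m ≡ minIndex (x ∷ xs)
    minIndex-attained x xs = find (attained x xs)
      where
      attained : ∀ x xs → Any (λ z → toℕ z ≡ minIndex (x ∷ xs)) (x ∷ xs)
      attained x []       = here (sym (m≤n⇒m⊓n≡m (<⇒≤ (toℕ<n x))))
      attained x (y ∷ ys) with ⊓-sel (toℕ x) (minIndex (y ∷ ys))
      ... | inj₁ x⊓≡x = here (sym x⊓≡x)
      ... | inj₂ x⊓≡m = there (Any.map (λ z≡m → ≡.trans z≡m (sym x⊓≡m)) (attained y ys))

    minIndex-least : ∀ {v : Fin n} xs → All (λ x → toℕ v ≤ toℕ x) xs → v ∈ xs → minIndex xs ≡ toℕ v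
    minIndex-least {v} (x ∷ xs) v≤ v∈ with minIndex-attained x xs
    ... | m , m∈ , m≡min = ≤-antisym (minIndex-≤ v∈) (subst (toℕ v ≤_) m≡min (All.lookup v≤ m∈))

    minIndex-∈ : ∀ xs (v : Fin n) → minIndex xs ≡ toℕ v → v ∈ xs
    minIndex-∈ []       v n≡v = ⊥-elim (<-irrefl (sym n≡v) (toℕ<n v))
    minIndex-∈ (x ∷ xs) v m≡v with minIndex-attained x xs
    ... | m , m∈ , m≡min = subst (_∈ x ∷ xs) (toℕ-injective (≡.trans m≡min m≡v)) m∈

    rotate-++ : ∀ (xs ys : List (Fin n)) → rotate (length xs) (xs ++ ys) ≡ ys ++ xs
    rotate-++ []       ys = refl
    rotate-++ (x ∷ xs) ys = cong₂ _++_ (proj₁ (dropTake xs ys)) (cong (x ∷_) (proj₂ (dropTake xs ys)))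
      where
      dropTake : ∀ (xs ys : List (Fin n)) → drop (length xs) (xs ++ ys) ≡ ys × take (length xs) (xs ++ ys) ≡ xs
      dropTake []       ys = refl , refl
      dropTake (x ∷ xs) ys = proj₁ (dropTake xs ys) , cong (x ∷_) (proj₂ (dropTake xs ys))

    rotate-↭ : ∀ i (us : List (Fin n)) → rotate i us ↭ us
    rotate-↭ i us = ≡.subst (rotate i us ↭_) (take++drop≡id i us) (++-comm (drop i us) (take i us))

    Avoids : ℕ → List (Fin n) → Set
    Avoids k = All (λ x → toℕ x ≢ k)

    Unique-avoids : ∀ a {m b} → Unique (a ++ m ∷ b) → Avoids (toℕ m) a × Avoids (toℕ m) b
    Unique-avoids a u with Unique-middle a u
    ... | a≢m , m≢b = All.map (λ x≢m → x≢m ∘ toℕ-injective) a≢m , All.map (λ m≢x → m≢x ∘ toℕ-injective ∘ sym) m≢b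

    breakAt : ℕ → List (Fin n) → List (Fin n) × List (Fin n)
    breakAt k []       = [] , []
    breakAt k (x ∷ xs) with toℕ x ≟ k
    ... | yes _ = [] , x ∷ xs
    ... | no  _ = x ∷ proj₁ (breakAt k xs) , proj₂ (breakAt k xs)

    rotateTo : ℕ → List (Fin n) → List (Fin n)
    rotateTo k us = proj₂ (breakAt k us) ++ proj₁ (breakAt k us)

    private
      breakAt-++ : ∀ k us → proj₁ (breakAt k us) ++ proj₂ (breakAt k us) ≡ us
      breakAt-++ k []       = refl
      breakAt-++ k (x ∷ xs) with toℕ x ≟ k
      ... | yes _ = refl
      ... | no  _ = cong (x ∷_) (breakAt-++ k xs)

      breakAt-middle : ∀ k a m b → Avoids k a → toℕ m ≡ k → breakAt k (a ++ m ∷ b) ≡ (a , m ∷ b)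
      breakAt-middle k []      m b []          m≡k with toℕ m ≟ k
      ... | yes _   = refl
      ... | no  m≢k = ⊥-elim (m≢k m≡k)
      breakAt-middle k (x ∷ a) m b (x≢k ∷ a≢k) m≡k with toℕ x ≟ k
      ... | yes x≡k = ⊥-elim (x≢k x≡k)
      ... | no  _   = cong (λ (c , d) → x ∷ c , d) (breakAt-middle k a m b a≢k m≡k)

    rotateTo-at : ∀ k a m b → Avoids k a → toℕ m ≡ k → rotateTo k (a ++ m ∷ b) ≡ m ∷ b ++ a
    rotateTo-at k a m b a≢k m≡k = cong (λ (c , d) → d ++ c) (breakAt-middle k a m b a≢k m≡k)

    rotateTo-is-rotate : ∀ k us → rotate (length (proj₁ (breakAt k us))) us ≡ rotateTo k us
    rotateTo-is-rotate k us =
      ≡.trans (cong (rotate (length (proj₁ (breakAt k us)))) (sym (breakAt-++ k us))) (rotate-++ (proj₁ (breakAt k us)) _)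

    private
      rotateTo-swap : ∀ {m} xs ys → Unique (xs ++ ys) → m ∈ xs → rotateTo (toℕ m) (xs ++ ys) ≡ rotateTo (toℕ m) (ys ++ xs)
      rotateTo-swap {m} xs ys u m∈xs with ∈-∃++ m∈xs
      ... | a , b , refl with Unique-avoids a (subst Unique (++-assoc a (m ∷ b) ys) u)
      ... | a≢m , bys≢m = begin
          rotateTo (toℕ m) ((a ++ m ∷ b) ++ ys)  ≡⟨ cong (rotateTo (toℕ m)) (++-assoc a (m ∷ b) ys) ⟩
          rotateTo (toℕ m) (a ++ m ∷ b ++ ys)    ≡⟨ rotateTo-at (toℕ m) a m (b ++ ys) a≢m refl ⟩
          m ∷ (b ++ ys) ++ a                     ≡⟨ cong (m ∷_) (++-assoc b ys a) ⟩
          m ∷ b ++ ys ++ a                       ≡⟨ sym (rotateTo-at (toℕ m) (ys ++ a) m b ysa≢m refl) ⟩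
          rotateTo (toℕ m) ((ys ++ a) ++ m ∷ b)  ≡⟨ cong (rotateTo (toℕ m)) (++-assoc ys a (m ∷ b)) ⟩
          rotateTo (toℕ m) (ys ++ a ++ m ∷ b)    ∎
        where
        open ≡-Reasoning
        ysa≢m : Avoids (toℕ m) (ys ++ a)
        ysa≢m = All.++⁺ (All.++⁻ʳ b bys≢m) a≢m

    rotateTo-rotate : ∀ i us {m} → Unique us → m ∈ us → rotateTo (toℕ m) (rotate i us) ≡ rotateTo (toℕ m) us
    rotateTo-rotate i us {m} u m∈ = begin
        rotateTo (toℕ m) (drop i us ++ take i us)  ≡⟨ sym (rotateTo-++-comm (take i us) (drop i us) u′ m∈′) ⟩
        rotateTo (toℕ m) (take i us ++ drop i us)  ≡⟨ cong (rotateTo (toℕ m)) (take++drop≡id i us) ⟩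
        rotateTo (toℕ m) us                        ∎
      where
      open ≡-Reasoning
      u′ : Unique (take i us ++ drop i us)
      u′ = subst Unique (sym (take++drop≡id i us)) u
      m∈′ : m ∈ take i us ++ drop i us
      m∈′ = subst (m ∈_) (sym (take++drop≡id i us)) m∈
      rotateTo-++-comm : ∀ xs ys → Unique (xs ++ ys) → m ∈ xs ++ ys → rotateTo (toℕ m) (xs ++ ys) ≡ rotateTo (toℕ m) (ys ++ xs)
      rotateTo-++-comm xs ys u m∈ with ∈-++⁻ xs m∈
      ... | inj₁ m∈xs = rotateTo-swap xs ys u m∈xs
      ... | inj₂ m∈ys = sym (rotateTo-swap ys xs (Unique-resp-↭ (++-comm xs ys) u) m∈ys)

    rotateTo-reverse : ∀ a m b → Avoids (toℕ m) a → Avoids (toℕ m) b →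
                       rotateTo (toℕ m) (reverse (a ++ m ∷ b)) ≡ m ∷ reverse (b ++ a)
    rotateTo-reverse a m b a≢m b≢m = begin
        rotateTo (toℕ m) (reverse (a ++ m ∷ b))          ≡⟨ cong (rotateTo (toℕ m)) reverse-middle ⟩
        rotateTo (toℕ m) (reverse b ++ m ∷ reverse a)    ≡⟨ rotateTo-at (toℕ m) (reverse b) m (reverse a) rb≢m refl ⟩
        m ∷ reverse a ++ reverse b                      ≡⟨ cong (m ∷_) (sym (reverse-++ b a)) ⟩
        m ∷ reverse (b ++ a)                            ∎
      where
      open ≡-Reasoning
      rb≢m : Avoids (toℕ m) (reverse b)
      rb≢m = All-resp-↭ (↭-sym (↭-reverse b)) b≢m
      reverse-middle : reverse (a ++ m ∷ b) ≡ reverse b ++ m ∷ reverse a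
      reverse-middle = ≡.trans (reverse-++ a (m ∷ b))
                               (≡.trans (cong (_++ reverse a) (unfold-reverse m b)) (++-assoc (reverse b) [ m ] (reverse a)))

    headIndex : List (Fin n) → ℕ
    headIndex []      = 0
    headIndex (x ∷ _) = toℕ x

    lastIndex : List (Fin n) → ℕ
    lastIndex []          = 0
    lastIndex (x ∷ [])    = toℕ x
    lastIndex (_ ∷ y ∷ r) = lastIndex (y ∷ r)

    -- a cycle m ∷ q is traversed so that the neighbour of m of smaller index comes second
    orient : List (Fin n) → List (Fin n)
    orient []      = []
    orient (m ∷ q) with headIndex q ≤? lastIndex q
    ... | yes _ = m ∷ q
    ... | no  _ = m ∷ reverse q

    headIndex-reverse : ∀ q → headIndex (reverse q) ≡ lastIndex q
    headIndex-reverse []          = refl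
    headIndex-reverse (x ∷ [])    = refl
    headIndex-reverse (x ∷ y ∷ r) = begin
        headIndex (reverse (x ∷ y ∷ r))          ≡⟨ cong headIndex (unfold-reverse x (y ∷ r)) ⟩
        headIndex (reverse (y ∷ r) ++ [ x ])     ≡⟨ cong (λ q → headIndex (q ++ [ x ])) (unfold-reverse y r) ⟩
        headIndex ((reverse r ++ [ y ]) ++ [ x ]) ≡⟨ headIndex-∷ʳ (reverse r) y ⟩
        headIndex (reverse r ++ [ y ])           ≡⟨ cong headIndex (sym (unfold-reverse y r)) ⟩
        headIndex (reverse (y ∷ r))              ≡⟨ headIndex-reverse (y ∷ r) ⟩
        lastIndex (y ∷ r)                        ∎
      where
      open ≡-Reasoning
      headIndex-∷ʳ : ∀ xs (y : Fin n) {x} → headIndex ((xs ++ [ y ]) ++ [ x ]) ≡ headIndex (xs ++ [ y ])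
      headIndex-∷ʳ []      y = refl
      headIndex-∷ʳ (_ ∷ _) y = refl

    lastIndex-reverse : ∀ q → lastIndex (reverse q) ≡ headIndex q
    lastIndex-reverse q = ≡.trans (sym (headIndex-reverse (reverse q))) (cong headIndex (reverse-involutive q))

    private
      lastIndex-attained : ∀ y r → Any (λ z → toℕ z ≡ lastIndex (y ∷ r)) (y ∷ r)
      lastIndex-attained y []      = here refl
      lastIndex-attained y (z ∷ r) = there (lastIndex-attained z r)

    headIndex≢lastIndex : ∀ {x y : Fin n} {r} → Unique (x ∷ y ∷ r) → headIndex (x ∷ y ∷ r) ≢ lastIndex (x ∷ y ∷ r)
    headIndex≢lastIndex {x} {y} {r} (x∉ ∷ _) x≡last with find (lastIndex-attained y r)
    ... | z , z∈ , z≡last = All.lookup x∉ z∈ (toℕ-injective (≡.trans x≡last (sym z≡last)))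

    orient-spec : ∀ (m : Fin n) q → ∃ λ q′ → orient (m ∷ q) ≡ m ∷ q′ × (q′ ≡ q ⊎ q′ ≡ reverse q) × headIndex q′ ≤ lastIndex q′
    orient-spec m q with headIndex q ≤? lastIndex q
    ... | yes h≤l = q , refl , inj₁ refl , h≤l
    ... | no  h≰l = reverse q , refl , inj₂ refl ,
                    subst₂ _≤_ (sym (headIndex-reverse q)) (sym (lastIndex-reverse q)) (<⇒≤ (≰⇒> h≰l))

    orient-reverse : ∀ m (q : List (Fin n)) → Unique q → orient (m ∷ reverse q) ≡ orient (m ∷ q)
    orient-reverse m []          u = refl
    orient-reverse m (x ∷ [])    u = refl
    orient-reverse m q@(x ∷ y ∷ r) u with headIndex q ≤? lastIndex q | headIndex (reverse q) ≤? lastIndex (reverse q)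
    ... | yes h≤l | yes h≤l′ = ⊥-elim (headIndex≢lastIndex u (≤-antisym h≤l
                                 (subst₂ _≤_ (headIndex-reverse q) (lastIndex-reverse q) h≤l′)))
    ... | yes _   | no _     = cong (m ∷_) (reverse-involutive q)
    ... | no _    | yes _    = refl
    ... | no h≰l  | no h≰l′  = ⊥-elim (h≰l′ (subst₂ _≤_ (sym (headIndex-reverse q)) (sym (lastIndex-reverse q))
                                                    (<⇒≤ (≰⇒> h≰l))))

    canonCycle : List (Fin n) → List (Fin n)
    canonCycle us = orient (rotateTo (minIndex us) us)

    private
      rotate-[] : ∀ i → rotate {Fin n} i [] ≡ []
      rotate-[] ℕ.zero    = refl
      rotate-[] (ℕ.suc i) = refl

      Unique-swap : ∀ a {m : Fin n} b → Unique (a ++ m ∷ b) → Unique (b ++ a)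
      Unique-swap a {m} b u with Unique-resp-↭ (shift m a b) u
      ... | _ ∷ uab = Unique-resp-↭ (++-comm a b) uab

    canonCycle-rotate : ∀ i us → Unique us → canonCycle (rotate i us) ≡ canonCycle us
    canonCycle-rotate i []       u = cong canonCycle (rotate-[] i)
    canonCycle-rotate i (x ∷ xs) u with minIndex-attained x xs
    ... | m , m∈ , m≡min = cong orient (begin
        rotateTo (minIndex (rotate i (x ∷ xs))) (rotate i (x ∷ xs))
      ≡⟨ cong (λ k → rotateTo k (rotate i (x ∷ xs))) (≡.trans (minIndex-↭ (rotate-↭ i (x ∷ xs))) (sym m≡min)) ⟩
        rotateTo (toℕ m) (rotate i (x ∷ xs))
      ≡⟨ rotateTo-rotate i (x ∷ xs) u m∈ ⟩
        rotateTo (toℕ m) (x ∷ xs)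
      ≡⟨ cong (λ k → rotateTo k (x ∷ xs)) m≡min ⟩
        rotateTo (minIndex (x ∷ xs)) (x ∷ xs) ∎)
      where open ≡-Reasoning

    canonCycle-reverse : ∀ us → Unique us → canonCycle (reverse us) ≡ canonCycle us
    canonCycle-reverse []       u = refl
    canonCycle-reverse (x ∷ xs) u with minIndex-attained x xs
    ... | m , m∈ , m≡min with ∈-∃++ m∈
    ... | a , b , us≡ with Unique-avoids a (subst Unique us≡ u)
    ... | a≢m , b≢m = begin
        orient (rotateTo (minIndex (reverse (x ∷ xs))) (reverse (x ∷ xs)))
      ≡⟨ cong (λ k → orient (rotateTo k (reverse (x ∷ xs)))) (≡.trans (minIndex-↭ (↭-reverse (x ∷ xs))) (sym m≡min)) ⟩
        orient (rotateTo (toℕ m) (reverse (x ∷ xs)))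
      ≡⟨ cong (λ us → orient (rotateTo (toℕ m) (reverse us))) us≡ ⟩
        orient (rotateTo (toℕ m) (reverse (a ++ m ∷ b)))
      ≡⟨ cong orient (rotateTo-reverse a m b a≢m b≢m) ⟩
        orient (m ∷ reverse (b ++ a))
      ≡⟨ orient-reverse m (b ++ a) (Unique-swap a b (subst Unique us≡ u)) ⟩
        orient (m ∷ b ++ a)
      ≡⟨ cong orient (sym (rotateTo-at (toℕ m) a m b a≢m refl)) ⟩
        orient (rotateTo (toℕ m) (a ++ m ∷ b))
      ≡⟨ cong (λ us → orient (rotateTo (toℕ m) us)) (sym us≡) ⟩
        orient (rotateTo (toℕ m) (x ∷ xs))
      ≡⟨ cong (λ k → orient (rotateTo k (x ∷ xs))) m≡min ⟩
        orient (rotateTo (minIndex (x ∷ xs)) (x ∷ xs)) ∎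
      where open ≡-Reasoning

    canonCycle-least : ∀ v t → All (λ z → toℕ v ≤ toℕ z) t → canonCycle (v ∷ t) ≡ orient (v ∷ t)
    canonCycle-least v t v≤t = cong orient (begin
        rotateTo (minIndex (v ∷ t)) (v ∷ t) ≡⟨ cong (λ k → rotateTo k (v ∷ t)) (minIndex-least (v ∷ t) (≤-refl ∷ v≤t) (here refl)) ⟩
        rotateTo (toℕ v) (v ∷ t)            ≡⟨ rotateTo-at (toℕ v) [] v t [] refl ⟩
        v ∷ t ++ []                         ≡⟨ cong (v ∷_) (++-identityʳ t) ⟩
        v ∷ t                               ∎)
      where open ≡-Reasoning

    key : Part n → ℕ
    key P = minIndex (vertices P)

    canon : Part n → Part n
    canon (pair a b) with toℕ a ≤? toℕ b
    ... | yes _ = pair a b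
    ... | no  _ = pair b a
    canon (cyc us) = cyc (canonCycle us)

    canon-pair-≤ : ∀ (a b : Fin n) → toℕ a ≤ toℕ b → canon (pair a b) ≡ pair a b
    canon-pair-≤ a b a≤b with toℕ a ≤? toℕ b
    ... | yes _   = refl
    ... | no  a≰b = ⊥-elim (a≰b a≤b)

    canon-pair-> : ∀ (a b : Fin n) → ¬ toℕ a ≤ toℕ b → canon (pair a b) ≡ pair b a
    canon-pair-> a b a≰b with toℕ a ≤? toℕ b
    ... | yes a≤b = ⊥-elim (a≰b a≤b)
    ... | no  _   = refl

    PartEq-vertices : ∀ {P Q : Part n} → PartEq P Q → vertices P ↭ vertices Q
    PartEq-vertices pair-same          = refl
    PartEq-vertices pair-flip          = swap _ _ refl
    PartEq-vertices (cyc-rot {us} i)   = ↭-sym (rotate-↭ i us)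
    PartEq-vertices (cyc-rev {us} i)   = ↭-sym (trans (rotate-↭ i (reverse us)) (↭-reverse us))

    key-PartEq : ∀ {P Q : Part n} → PartEq P Q → key P ≡ key Q
    key-PartEq = minIndex-↭ ∘ PartEq-vertices

    PartEq-refl : ∀ {P : Part n} → PartEq P P
    PartEq-refl {pair a b} = pair-same
    PartEq-refl {cyc us}   = subst (λ vs → PartEq (cyc us) (cyc vs)) (++-identityʳ us) (cyc-rot 0)

    PartEq-sym : ∀ {P Q : Part n} → PartEq P Q → PartEq Q P
    PartEq-sym pair-same        = pair-same
    PartEq-sym pair-flip        = pair-flip
    PartEq-sym (cyc-rot {us} i) =
      subst (λ vs → PartEq (cyc (rotate i us)) (cyc vs))
            (≡.trans (rotate-++ (drop i us) (take i us)) (take++drop≡id i us))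
            (cyc-rot (length (drop i us)))
    PartEq-sym (cyc-rev {us} i) =
      subst (λ vs → PartEq (cyc (rotate i (reverse us))) (cyc vs)) back (cyc-rev (length (reverse a)))
      where
      open ≡-Reasoning
      a b : List (Fin n)
      a = take i (reverse us)
      b = drop i (reverse us)
      back : rotate (length (reverse a)) (reverse (b ++ a)) ≡ us
      back = begin
        rotate (length (reverse a)) (reverse (b ++ a))    ≡⟨ cong (rotate (length (reverse a))) (reverse-++ b a) ⟩
        rotate (length (reverse a)) (reverse a ++ reverse b) ≡⟨ rotate-++ (reverse a) (reverse b) ⟩
        reverse b ++ reverse a                            ≡⟨ sym (reverse-++ a b) ⟩
        reverse (a ++ b)                                  ≡⟨ cong reverse (take++drop≡id i (reverse us)) ⟩
        reverse (reverse us)                              ≡⟨ reverse-involutive us ⟩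
        us                                                ∎

    canon-PartEq : ∀ {P Q : Part n} → PartEq P Q → Unique (vertices P) → canon P ≡ canon Q
    canon-PartEq pair-same u = refl
    canon-PartEq (pair-flip {a} {b}) u@((a≢b ∷ _) ∷ _) with toℕ a ≤? toℕ b | toℕ b ≤? toℕ a
    ... | yes a≤b | yes b≤a = ⊥-elim (a≢b (toℕ-injective (≤-antisym a≤b b≤a)))
    ... | yes _   | no  _   = refl
    ... | no  _   | yes _   = refl
    ... | no  a≰b | no  b≰a = ⊥-elim (a≰b (<⇒≤ (≰⇒> b≰a)))
    canon-PartEq (cyc-rot {us} i) u = cong cyc (sym (canonCycle-rotate i us u))
    canon-PartEq (cyc-rev {us} i) u = cong cyc (sym (≡.trans
      (canonCycle-rotate i (reverse us) (Unique-resp-↭ (↭-sym (↭-reverse us)) u)) (canonCycle-reverse us u)))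

    vertices-canon : ∀ P → vertices (canon P) ↭ vertices P
    vertices-canon (pair a b) with toℕ a ≤? toℕ b
    ... | yes _ = refl
    ... | no  _ = swap _ _ refl
    vertices-canon (cyc us) = trans (orient-↭ (rotateTo (minIndex us) us))
      (subst (_↭ us) (rotateTo-is-rotate (minIndex us) us) (rotate-↭ (length (proj₁ (breakAt (minIndex us) us))) us))
      where
      orient-↭ : ∀ vs → orient vs ↭ vs
      orient-↭ []      = refl
      orient-↭ (m ∷ q) with orient-spec m q
      ... | q′ , eq , inj₁ refl , _ = subst (_↭ m ∷ q) (sym eq) refl
      ... | q′ , eq , inj₂ refl , _ = subst (_↭ m ∷ q) (sym eq) (prep m (↭-reverse q))

    orient-fixed : ∀ m {x y r} → Unique (x ∷ y ∷ r) → headIndex (x ∷ y ∷ r) ≤ lastIndex (x ∷ y ∷ r) →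
                   orient (m ∷ x ∷ y ∷ r) ≡ m ∷ x ∷ y ∷ r
    orient-fixed m {x} {y} {r} u h≤l with orient-spec m (x ∷ y ∷ r)
    ... | _ , eq , inj₁ refl , _    = eq
    ... | _ , eq , inj₂ refl , h≤l′ = ⊥-elim (headIndex≢lastIndex u (≤-antisym h≤l
        (subst₂ _≤_ (headIndex-reverse (x ∷ y ∷ r)) (lastIndex-reverse (x ∷ y ∷ r)) h≤l′)))

module PartitionNormalForm where

  open Lists
  open CanonicalParts
  open import Defs using (Part; pair; cyc; vertices; rotate; PartEq; pair-flip; cyc-rot; cyc-rev; Partition; PartitionEq; allVertices; size)
  open import Data.Empty using (⊥-elim)
  open import Data.Fin using (Fin; toℕ)
  open import Data.Fin.Properties using (toℕ<n) renaming (_≟_ to _≟ᶠ_)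
  open import Data.Nat using (ℕ; suc; _≤_; _<_; z≤n; s≤s; _≟_; _≤?_)
  open import Data.List using (List; []; _∷_; [_]; _++_; map; filter; concatMap; length; upTo; reverse)
  open import Data.List.Properties
    using (∷-injectiveˡ; filter-accept; filter-reject; filter-none; length-map; map-concatMap; ≡-dec; unfold-reverse; length-reverse)
  open import Data.List.Membership.Propositional using (_∈_; _∉_)
  open import Data.List.Membership.Propositional.Properties using (∈-++⁺ˡ; ∈-++⁺ʳ; ∈-upTo⁺)
  open import Data.List.Relation.Unary.All as All using (All; []; _∷_)
  import Data.List.Relation.Unary.All.Properties as All
  open import Data.List.Relation.Unary.Any using (here; there)
  open import Data.List.Relation.Unary.Unique.Propositional using (Unique; []; _∷_)
  open import Data.List.Relation.Unary.Unique.Propositional.Properties using (upTo⁺)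
  open import Data.List.Relation.Binary.Permutation.Propositional as ↭ using (_↭_; prep; swap; ↭-refl; ↭-sym; ↭-trans)
  open import Data.List.Relation.Binary.Permutation.Propositional.Properties using (↭-length; shift; shifts; ++⁺; ++⁺ˡ)
  import Data.List.Relation.Binary.Permutation.Homogeneous as Homogeneous
  open import Data.List.Relation.Binary.Pointwise using (Pointwise; []; _∷_)
  import Data.List.Relation.Binary.Pointwise.Properties as Pointwise
  open import Data.Product using (_×_; _,_; proj₁; proj₂; ∃)
  open import Data.Sum using (inj₁; inj₂)
  open import Function using (_∘_)
  open import Relation.Binary.Definitions using (DecidableEquality)
  open import Relation.Binary.PropositionalEquality using (_≡_; _≢_; refl; sym; trans; cong; cong₂; subst)
  open import Relation.Nullary using (Dec; yes; no; ¬?)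

  module _ {n : ℕ} where

    PartitionEq-refl : ∀ {S : Partition n} → PartitionEq S S
    PartitionEq-refl = Homogeneous.refl (Pointwise.refl PartEq-refl)

    PartitionEq-sym : ∀ {S T : Partition n} → PartitionEq S T → PartitionEq T S
    PartitionEq-sym = Homogeneous.sym PartEq-sym

    ↭⇒PartitionEq : ∀ {S T : Partition n} → S ↭ T → PartitionEq S T
    ↭⇒PartitionEq ↭.refl         = PartitionEq-refl
    ↭⇒PartitionEq (prep P p)     = Homogeneous.prep PartEq-refl (↭⇒PartitionEq p)
    ↭⇒PartitionEq (swap P Q p)   = Homogeneous.swap PartEq-refl PartEq-refl (↭⇒PartitionEq p)
    ↭⇒PartitionEq (↭.trans p q)  = Homogeneous.trans (↭⇒PartitionEq p) (↭⇒PartitionEq q)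

    private
      PartitionEq-head : ∀ {P Q : Part n} {S} → PartEq P Q → PartitionEq (P ∷ S) (Q ∷ S)
      PartitionEq-head P≈Q = Homogeneous.prep P≈Q PartitionEq-refl

      PartitionEq-orient : ∀ vs {S} → PartitionEq (cyc vs ∷ S) (cyc (orient vs) ∷ S)
      PartitionEq-orient []      = PartitionEq-refl
      PartitionEq-orient (m ∷ q) with orient-spec m q
      ... | q′ , eq , inj₁ refl , _ = subst (λ vs → PartitionEq (cyc (m ∷ q) ∷ _) (cyc vs ∷ _)) (sym eq) PartitionEq-refl
      ... | q′ , eq , inj₂ refl , _ = subst (λ vs → PartitionEq (cyc (m ∷ q) ∷ _) (cyc vs ∷ _)) (sym eq)
          (PartitionEq-head (subst (λ vs → PartEq (cyc (m ∷ q)) (cyc vs)) reversal (cyc-rev (length q))))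
        where
        reversal : rotate (length q) (reverse (m ∷ q)) ≡ m ∷ reverse q
        reversal = trans (cong (rotate (length q)) (unfold-reverse m q))
                         (trans (cong (λ k → rotate k (reverse q ++ [ m ])) (sym (length-reverse q)))
                                (rotate-++ (reverse q) [ m ]))

      PartitionEq-canon-head : ∀ P {S} → PartitionEq (P ∷ S) (canon P ∷ S)
      PartitionEq-canon-head (pair a b) with toℕ a ≤? toℕ b
      ... | yes _ = PartitionEq-refl
      ... | no  _ = PartitionEq-head pair-flip
      PartitionEq-canon-head (cyc us) =
        Homogeneous.trans (PartitionEq-head (subst (λ vs → PartEq (cyc us) (cyc vs)) (rotateTo-is-rotate (minIndex us) us)
                                                   (cyc-rot (length (proj₁ (breakAt (minIndex us) us))))))
                          (PartitionEq-orient (rotateTo (minIndex us) us))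

    PartitionEq-canon : ∀ (S : Partition n) → PartitionEq S (map canon S)
    PartitionEq-canon []      = PartitionEq-refl
    PartitionEq-canon (P ∷ S) = Homogeneous.trans (PartitionEq-canon-head P) (Homogeneous.prep PartEq-refl (PartitionEq-canon S))

    WellFormed : Partition n → Set
    WellFormed S = All (λ P → 0 < length (vertices P)) S × Unique (allVertices S)

    parts-unique : ∀ (S : Partition n) → Unique (allVertices S) → All (Unique ∘ vertices) S
    parts-unique []      u = []
    parts-unique (P ∷ S) u with Unique-++⁻ (vertices P) u
    ... | uP , uS = uP ∷ parts-unique S uS

    PartitionEq-Unique : ∀ {S T : Partition n} → PartitionEq S T → All (Unique ∘ vertices) S → All (Unique ∘ vertices) T
    PartitionEq-Unique (Homogeneous.refl S≋T)   u         = pointwise S≋T u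
      where
      pointwise : ∀ {S T} → Pointwise PartEq S T → All (Unique ∘ vertices) S → All (Unique ∘ vertices) T
      pointwise []          []       = []
      pointwise (P≈Q ∷ S≋T) (uP ∷ u) = Unique-resp-↭ (PartEq-vertices P≈Q) uP ∷ pointwise S≋T u
    PartitionEq-Unique (Homogeneous.prep P≈Q p) (uP ∷ u) = Unique-resp-↭ (PartEq-vertices P≈Q) uP ∷ PartitionEq-Unique p u
    PartitionEq-Unique (Homogeneous.swap P≈P′ Q≈Q′ p) (uP ∷ uQ ∷ u) =
      Unique-resp-↭ (PartEq-vertices Q≈Q′) uQ ∷ Unique-resp-↭ (PartEq-vertices P≈P′) uP ∷ PartitionEq-Unique p u
    PartitionEq-Unique (Homogeneous.trans p q) u = PartitionEq-Unique q (PartitionEq-Unique p u)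

    keys-avoid : ∀ (v : Fin n) S → v ∉ allVertices S → All (λ Q → key Q ≢ toℕ v) S
    keys-avoid v []      v∉ = []
    keys-avoid v (Q ∷ S) v∉ =
      (λ kQ≡v → v∉ (∈-++⁺ˡ (minIndex-∈ (vertices Q) v kQ≡v))) ∷ keys-avoid v S (v∉ ∘ ∈-++⁺ʳ (vertices Q))

    bucket : Partition n → ℕ → Partition n
    bucket S j = filter (λ P → key P ≟ j) S

    canonBucket : Partition n → ℕ → List (Part n)
    canonBucket S j = map canon (bucket S j)

    canonBucket-accept : ∀ P S j → key P ≡ j → canonBucket (P ∷ S) j ≡ canon P ∷ canonBucket S j
    canonBucket-accept P S j kP≡j = cong (map canon) (filter-accept (λ P → key P ≟ j) {P} {S} kP≡j)

    canonBucket-reject : ∀ P S j → key P ≢ j → canonBucket (P ∷ S) j ≡ canonBucket S j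
    canonBucket-reject P S j kP≢j = cong (map canon) (filter-reject (λ P → key P ≟ j) {P} {S} kP≢j)

    canonBucket-avoid : ∀ S j → All (λ Q → key Q ≢ j) S → canonBucket S j ≡ []
    canonBucket-avoid S j ≢j = cong (map canon) (filter-none (λ P → key P ≟ j) ≢j)

    key-attained : ∀ P → 0 < length (vertices P) → ∃ λ (m : Fin n) → m ∈ vertices P × toℕ m ≡ key P
    key-attained P ne with vertices P
    ... | x ∷ xs = minIndex-attained x xs

    bucket-length≤1 : ∀ S → WellFormed S → ∀ j → length (bucket S j) ≤ 1
    bucket-length≤1 []      _              j = z≤n
    bucket-length≤1 (P ∷ S) (ne ∷ nes , u) j with key P ≟ j
    ... | no  kP≢j = subst (_≤ 1) (cong length (sym (filter-reject (λ P → key P ≟ j) {P} {S} kP≢j)))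
                           (bucket-length≤1 S (nes , proj₂ (Unique-++⁻ (vertices P) u)) j)
    ... | yes kP≡j with key-attained P ne
    ...   | m , m∈P , m≡k = subst (_≤ 1) (cong length (sym (filter-accept (λ P → key P ≟ j) {P} {S} kP≡j)))
                                  (subst (λ B → suc (length B) ≤ 1) (sym rest-empty) (s≤s z≤n))
      where
      rest-empty : bucket S j ≡ []
      rest-empty = filter-none (λ Q → key Q ≟ j)
        (subst (λ k → All (λ Q → key Q ≢ k) S) (trans m≡k kP≡j) (keys-avoid m S (Unique-++-disjoint (vertices P) u m∈P)))

    private
      canonBucket-step : ∀ {P Q} → PartEq P Q → Unique (vertices P) → ∀ S T j →
                         canonBucket S j ↭ canonBucket T j → canonBucket (P ∷ S) j ↭ canonBucket (Q ∷ T) j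
      canonBucket-step {P} {Q} P≈Q uP S T j S↭T with key P ≟ j
      ... | yes kP≡j rewrite canonBucket-accept P S j kP≡j | canonBucket-accept Q T j (trans (sym (key-PartEq P≈Q)) kP≡j)
                           | canon-PartEq P≈Q uP = prep (canon Q) S↭T
      ... | no  kP≢j rewrite canonBucket-reject P S j kP≢j | canonBucket-reject Q T j (kP≢j ∘ trans (key-PartEq P≈Q)) = S↭T

      canonBucket-swap : ∀ P Q S j → canonBucket (P ∷ Q ∷ S) j ↭ canonBucket (Q ∷ P ∷ S) j
      canonBucket-swap P Q S j with key P ≟ j | key Q ≟ j
      ... | yes kP | yes kQ rewrite canonBucket-accept P (Q ∷ S) j kP | canonBucket-accept Q S j kQ
                                  | canonBucket-accept Q (P ∷ S) j kQ | canonBucket-accept P S j kP = swap _ _ ↭-refl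
      ... | yes kP | no  kQ rewrite canonBucket-accept P (Q ∷ S) j kP | canonBucket-reject Q S j kQ
                                  | canonBucket-reject Q (P ∷ S) j kQ | canonBucket-accept P S j kP = ↭-refl
      ... | no  kP | yes kQ rewrite canonBucket-reject P (Q ∷ S) j kP | canonBucket-accept Q S j kQ
                                  | canonBucket-accept Q (P ∷ S) j kQ | canonBucket-reject P S j kP = ↭-refl
      ... | no  kP | no  kQ rewrite canonBucket-reject P (Q ∷ S) j kP | canonBucket-reject Q S j kQ
                                  | canonBucket-reject Q (P ∷ S) j kQ | canonBucket-reject P S j kP = ↭-refl

    canonBucket-↭ : ∀ {S T} → PartitionEq S T → All (Unique ∘ vertices) S → ∀ j → canonBucket S j ↭ canonBucket T j
    canonBucket-↭ (Homogeneous.refl S≋T) u j = pointwise S≋T u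
      where
      pointwise : ∀ {S T} → Pointwise PartEq S T → All (Unique ∘ vertices) S → canonBucket S j ↭ canonBucket T j
      pointwise []          []       = ↭-refl
      pointwise (P≈Q ∷ S≋T) (uP ∷ u) = canonBucket-step P≈Q uP _ _ j (pointwise S≋T u)
    canonBucket-↭ (Homogeneous.prep P≈Q p) (uP ∷ u) j = canonBucket-step P≈Q uP _ _ j (canonBucket-↭ p u j)
    canonBucket-↭ (Homogeneous.swap {xs} {ys} {P} {Q} {P′} {Q′} P≈P′ Q≈Q′ p) (uP ∷ uQ ∷ u) j =
      ↭-trans (canonBucket-step P≈P′ uP (Q ∷ xs) (Q′ ∷ ys) j (canonBucket-step Q≈Q′ uQ xs ys j (canonBucket-↭ p u j)))
              (canonBucket-swap P′ Q′ ys j)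
    canonBucket-↭ (Homogeneous.trans p q) u j = ↭-trans (canonBucket-↭ p u j) (canonBucket-↭ q (PartitionEq-Unique p u) j)

    PartitionEq⇒canonBucket≡ : ∀ {S T} → PartitionEq S T → WellFormed S → ∀ j → canonBucket S j ≡ canonBucket T j
    PartitionEq⇒canonBucket≡ {S} S≈T wf@(_ , u) j =
      ↭-length≤1⇒≡ (canonBucket-↭ S≈T (parts-unique S u) j)
                  (subst (_≤ 1) (sym (length-map canon (bucket S j))) (bucket-length≤1 S wf j))

    private
      ↭-buckets : ∀ (S : Partition n) js → Unique js → All (λ P → key P ∈ js) S → S ↭ concatMap (bucket S) js
      ↭-buckets []      js u k∈ = subst ([] ↭_) (sym (concatMap-empty js)) ↭-refl
        where
        concatMap-empty : ∀ js → concatMap (bucket []) js ≡ []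
        concatMap-empty []       = refl
        concatMap-empty (j ∷ js) = concatMap-empty js
      ↭-buckets (P ∷ S) js u (kP∈ ∷ k∈) = ↭-trans (prep P (↭-buckets S js u k∈)) (↭-sym (insert js u kP∈))
        where
        skip : ∀ js → All (key P ≢_) js → concatMap (bucket (P ∷ S)) js ≡ concatMap (bucket S) js
        skip []       []            = refl
        skip (j ∷ js) (kP≢j ∷ kP≢js) = cong₂ _++_ (filter-reject (λ P → key P ≟ j) {P} {S} kP≢j) (skip js kP≢js)
        insert : ∀ js → Unique js → key P ∈ js → concatMap (bucket (P ∷ S)) js ↭ P ∷ concatMap (bucket S) js
        insert (j ∷ js) (j∉ ∷ u) kP∈ with key P ≟ j
        ... | yes kP≡j rewrite filter-accept (λ P → key P ≟ j) {P} {S} kP≡j =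
              prep P (subst (λ B → bucket S j ++ B ↭ bucket S j ++ concatMap (bucket S) js)
                            (sym (skip js (All.map (λ j≢i kP≡i → j≢i (trans (sym kP≡j) kP≡i)) j∉))) ↭-refl)
        ... | no  kP≢j rewrite filter-reject (λ P → key P ≟ j) {P} {S} kP≢j with kP∈
        ...   | here kP≡j  = ⊥-elim (kP≢j kP≡j)
        ...   | there kP∈′ = ↭-trans (++⁺ˡ (bucket S j) (insert js u kP∈′)) (shift P (bucket S j) (concatMap (bucket S) js))

    normalForm : Partition n → Partition n
    normalForm S = concatMap (canonBucket S) (upTo n)

    PartitionEq-normalForm : ∀ S → WellFormed S → PartitionEq S (normalForm S)
    PartitionEq-normalForm S (ne , _) =
      Homogeneous.trans (↭⇒PartitionEq (↭-buckets S (upTo n) (upTo⁺ n) (All.map (λ {P} → key∈ {P}) ne)))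
        (subst (PartitionEq (concatMap (bucket S) (upTo n))) (map-concatMap canon (bucket S) (upTo n))
               (PartitionEq-canon (concatMap (bucket S) (upTo n))))
      where
      key∈ : ∀ {P} → 0 < length (vertices P) → key P ∈ upTo n
      key∈ {P} ne with key-attained P ne
      ... | m , _ , m≡k = ∈-upTo⁺ (subst (_< n) m≡k (toℕ<n m))

    SameBuckets : Partition n → Partition n → Set
    SameBuckets S T = All (λ j → canonBucket S j ≡ canonBucket T j) (upTo n)

    _≟ₚ_ : DecidableEquality (Part n)
    pair a b ≟ₚ pair c d with a ≟ᶠ c | b ≟ᶠ d
    ... | yes refl | yes refl = yes refl
    ... | no  a≢c  | _        = no (λ { refl → a≢c refl })
    ... | yes _    | no  b≢d  = no (λ { refl → b≢d refl })
    pair a b ≟ₚ cyc vs   = no (λ ())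
    cyc us   ≟ₚ pair c d = no (λ ())
    cyc us   ≟ₚ cyc vs with ≡-dec _≟ᶠ_ us vs
    ... | yes refl  = yes refl
    ... | no  us≢vs = no (λ { refl → us≢vs refl })

    sameBuckets? : ∀ S T → Dec (SameBuckets S T)
    sameBuckets? S T = All.all? (λ j → ≡-dec _≟ₚ_ (canonBucket S j) (canonBucket T j)) (upTo n)

    PartitionEq⇒SameBuckets : ∀ {S T} → PartitionEq S T → WellFormed S → SameBuckets S T
    PartitionEq⇒SameBuckets S≈T wf = All.tabulate (λ {j} _ → PartitionEq⇒canonBucket≡ S≈T wf j)

    SameBuckets⇒PartitionEq : ∀ {S T} → WellFormed S → WellFormed T → SameBuckets S T → PartitionEq S T
    SameBuckets⇒PartitionEq {S} {T} wfS wfT same =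
      Homogeneous.trans (PartitionEq-normalForm S wfS)
        (subst (λ N → PartitionEq N T) (sym (concatMap-cong same)) (PartitionEq-sym (PartitionEq-normalForm T wfT)))
      where
      concatMap-cong : ∀ {js} → All (λ j → canonBucket S j ≡ canonBucket T j) js →
                       concatMap (canonBucket S) js ≡ concatMap (canonBucket T) js
      concatMap-cong []           = refl
      concatMap-cong (eq ∷ eqs) = cong₂ _++_ eq (concatMap-cong eqs)

    SameBuckets-trans : ∀ {R S T} → SameBuckets R S → SameBuckets R T → SameBuckets S T
    SameBuckets-trans R~S R~T = All.zipWith (λ (eq₁ , eq₂) → trans (sym eq₁) eq₂) (R~S , R~T)

    allVertices-↭ : ∀ {S T : Partition n} → PartitionEq S T → allVertices S ↭ allVertices T
    allVertices-↭ (Homogeneous.refl S≋T) = pointwise S≋T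
      where
      pointwise : ∀ {S T} → Pointwise PartEq S T → allVertices S ↭ allVertices T
      pointwise []          = ↭-refl
      pointwise (P≈Q ∷ S≋T) = ++⁺ (PartEq-vertices P≈Q) (pointwise S≋T)
    allVertices-↭ (Homogeneous.prep P≈Q p) = ++⁺ (PartEq-vertices P≈Q) (allVertices-↭ p)
    allVertices-↭ (Homogeneous.swap {x′ = P′} {y′ = Q′} P≈P′ Q≈Q′ p) =
      ↭-trans (++⁺ (PartEq-vertices P≈P′) (++⁺ (PartEq-vertices Q≈Q′) (allVertices-↭ p))) (shifts (vertices P′) (vertices Q′))
    allVertices-↭ (Homogeneous.trans p q) = ↭-trans (allVertices-↭ p) (allVertices-↭ q)

    size-PartitionEq : ∀ {S T : Partition n} → PartitionEq S T → size S ≡ size T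
    size-PartitionEq = ↭-length ∘ allVertices-↭

    SameBuckets-lookup : ∀ {S T} → SameBuckets S T → ∀ {j} → j < n → canonBucket S j ≡ canonBucket T j
    SameBuckets-lookup same j<n = All.lookup same (∈-upTo⁺ j<n)

    dropBucket : ℕ → Partition n → Partition n
    dropBucket j S = filter (λ P → ¬? (key P ≟ j)) S

    module _ {π P₀ : Part n} {Ω S : Partition n} {j : ℕ} (kπ≡j : key π ≡ j) (Ω≢j : All (λ Q → key Q ≢ j) Ω) (S-j : bucket S j ≡ P₀ ∷ []) where

      private
        π∷Ω-j : canonBucket (π ∷ Ω) j ≡ canon π ∷ []
        π∷Ω-j = trans (canonBucket-accept π Ω j kπ≡j) (cong (canon π ∷_) (canonBucket-avoid Ω j Ω≢j))

        dropped-j : canonBucket (dropBucket j S) j ≡ []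
        dropped-j = canonBucket-avoid (dropBucket j S) j (All.all-filter (λ P → ¬? (key P ≟ j)) S)

        π∷Ω-i : ∀ {i} → i ≢ j → canonBucket (π ∷ Ω) i ≡ canonBucket Ω i
        π∷Ω-i i≢j = canonBucket-reject π Ω _ (λ kπ≡i → i≢j (trans (sym kπ≡i) kπ≡j))

        dropped-i : ∀ {i} → i ≢ j → canonBucket (dropBucket j S) i ≡ canonBucket S i
        dropped-i {i} i≢j = cong (map canon) (filter-filter (λ P → key P ≟ i) (λ P → ¬? (key P ≟ j)) (λ P → key P ≟ i)
                                              (λ kP≡i → kP≡i , (λ kP≡j → i≢j (trans (sym kP≡i) kP≡j))) (λ kP≡i _ → kP≡i) S)

      SameBuckets-∷⁻ : j < n → SameBuckets (π ∷ Ω) S → canon π ≡ canon P₀ × SameBuckets Ω (dropBucket j S)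
      SameBuckets-∷⁻ j<n same =
        ∷-injectiveˡ (trans (sym π∷Ω-j) (trans (SameBuckets-lookup {π ∷ Ω} {S} same j<n) (cong (map canon) S-j))) ,
        All.tabulate (λ {i} i∈ → bucket-i i (All.lookup same i∈))
        where
        bucket-i : ∀ i → canonBucket (π ∷ Ω) i ≡ canonBucket S i → canonBucket Ω i ≡ canonBucket (dropBucket j S) i
        bucket-i i eq with i ≟ j
        ... | yes refl = trans (canonBucket-avoid Ω j Ω≢j) (sym dropped-j)
        ... | no  i≢j  = trans (sym (π∷Ω-i i≢j)) (trans eq (sym (dropped-i i≢j)))

      SameBuckets-∷⁺ : canon π ≡ canon P₀ → SameBuckets Ω (dropBucket j S) → SameBuckets (π ∷ Ω) S
      SameBuckets-∷⁺ π≡P₀ same = All.tabulate (λ {i} i∈ → bucket-i i (All.lookup same i∈))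
        where
        bucket-i : ∀ i → canonBucket Ω i ≡ canonBucket (dropBucket j S) i → canonBucket (π ∷ Ω) i ≡ canonBucket S i
        bucket-i i eq with i ≟ j
        ... | yes refl = trans π∷Ω-j (trans (cong (_∷ []) π≡P₀) (sym (cong (map canon) S-j)))
        ... | no  i≢j  = trans (π∷Ω-i i≢j) (trans eq (dropped-i i≢j))

module Fibres where

  open Sums
  open Lists
  open Arrangements
  open Sachs using (module Weights)
  open CanonicalParts
  open PartitionNormalForm
  open import Defs using (Part; pair; cyc; vertices; rotate; Partition; allVertices)
  open import Data.Empty using (⊥-elim)
  open import Data.Fin using (Fin; toℕ)
  open import Data.Fin.Properties using (toℕ-injective; toℕ<n) renaming (_≟_ to _≟ᶠ_)
  open import Data.Integer using (ℤ; +_; _+_; _*_; 0ℤ; 1ℤ)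
  open import Data.Integer.Properties using (+-identityˡ; +-identityʳ; *-assoc; *-distribʳ-+)
  open import Data.Integer.Tactic.RingSolver using (solve-∀)
  open import Data.Nat as ℕ using (ℕ; suc; _≤_; _<_; z≤n; s≤s)
  open import Data.Nat.Properties using (n≤1+n; ≤-refl; ≤-pred; <⇒≤; <⇒≱; <-irrefl; ≤-trans)
  open import Data.List using (List; []; _∷_; [_]; _++_; map; concat; length; reverse; allFin)
  open import Data.List.Properties using (length-filter; reverse-involutive; length-reverse)
  open import Data.List.Membership.Propositional using (_∈_; _∉_; find)
  open import Data.List.Membership.Propositional.Properties using (∈-∃++; ∈-filter⁺; ∈-++⁺ˡ; ∈-++⁺ʳ)
  open import Data.List.Relation.Unary.All as All using (All; []; _∷_)
  import Data.List.Relation.Unary.All.Properties as All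
  open import Data.List.Relation.Unary.AllPairs as AllPairs using (AllPairs)
  import Data.List.Relation.Unary.AllPairs.Properties as AllPairs
  import Data.List.Relation.Unary.Any as Any
  import Data.List.Relation.Unary.Any.Properties as Any
  open import Data.List.Relation.Unary.Any using (here; there)
  open import Data.List.Relation.Unary.Unique.Propositional using (Unique; []; _∷_)
  open import Data.List.Relation.Binary.Permutation.Propositional using (_↭_; ↭-refl; ↭-sym)
  open import Data.List.Relation.Binary.Permutation.Propositional.Properties using (↭-reverse; ↭-length; All-resp-↭; ∈-resp-↭)
  open import Data.Product using (_×_; _,_; proj₁; proj₂; ∃)
  open import Data.Sum as Sum using (_⊎_; inj₁; inj₂)
  open import Data.Unit using (⊤)
  open import Function using (_∘_)
  open import Relation.Binary.PropositionalEquality using (_≡_; _≢_; refl; sym; trans; cong; cong₂; subst; module ≡-Reasoning)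
  open import Relation.Nullary using (Dec; yes; no; ¬_)

  module _ {n : ℕ} where

    toPart : List (Fin n) → Part n
    toPart []              = cyc []
    toPart (v ∷ [])        = cyc (v ∷ [])
    toPart (v ∷ x ∷ [])    = pair v x
    toPart (v ∷ x ∷ y ∷ r) = cyc (v ∷ x ∷ y ∷ r)

    vertices-toPart : ∀ c → vertices (toPart c) ≡ c
    vertices-toPart []              = refl
    vertices-toPart (v ∷ [])        = refl
    vertices-toPart (v ∷ x ∷ [])    = refl
    vertices-toPart (v ∷ x ∷ y ∷ r) = refl

    toPartition : List (List (Fin n)) → Partition n
    toPartition = map toPart

    allVertices-toPartition : ∀ ω → allVertices (toPartition ω) ≡ concat ω
    allVertices-toPartition []      = refl
    allVertices-toPartition (c ∷ ω) = cong₂ _++_ (vertices-toPart c) (allVertices-toPartition ω)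

    Sorted : List (Fin n) → Set
    Sorted = AllPairs (λ x y → toℕ x < toℕ y)

    Sorted⇒Unique : ∀ {W} → Sorted W → Unique W
    Sorted⇒Unique = AllPairs.map (λ x<y x≡y → <-irrefl (cong toℕ x≡y) x<y)

    WellShaped : Part n → Set
    WellShaped (pair _ _) = ⊤
    WellShaped (cyc us)   = 3 ≤ length us

    reverse-nonempty : ∀ (x : Fin n) xs → reverse (x ∷ xs) ≢ []
    reverse-nonempty x xs rev≡[] with () ← trans (sym (length-reverse (x ∷ xs))) (cong length rev≡[])

    allFin-sorted : Sorted (allFin n)
    allFin-sorted = AllPairs.tabulate⁺-< (λ i<j → i<j)

    module _ {v : Fin n} {W′ : List (Fin n)} (sorted : Sorted (v ∷ W′)) where

      open Removal (_≟ᶠ_ {n}) using (_≟ₗ_)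

      head-≤ : ∀ {z} → z ∈ v ∷ W′ → toℕ v ≤ toℕ z
      head-≤ (here refl) = ≤-refl
      head-≤ (there z∈)  = <⇒≤ (All.lookup (AllPairs.head sorted) z∈)

      ∈-tail : ∀ {z} → z ∈ v ∷ W′ → toℕ z ≢ toℕ v → z ∈ W′
      ∈-tail (here refl) z≢v = ⊥-elim (z≢v refl)
      ∈-tail (there z∈)  _   = z∈

      v∉W′ : v ∉ W′
      v∉W′ v∈ = <-irrefl refl (All.lookup (AllPairs.head sorted) v∈)

      key-least : ∀ {vs} → All (_∈ v ∷ W′) vs → v ∈ vs → minIndex vs ≡ toℕ v
      key-least vs⊆ v∈ = minIndex-least _ (All.map head-≤ vs⊆) v∈

      key-toPart : ∀ t → All (_∈ W′) t → key (toPart (v ∷ t)) ≡ toℕ v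
      key-toPart t t⊆ = trans (cong minIndex (vertices-toPart (v ∷ t))) (key-least (here refl ∷ All.map there t⊆) (here refl))

      canon-toPart-pair : ∀ {x} → x ∈ W′ → canon (toPart (v ∷ x ∷ [])) ≡ pair v x
      canon-toPart-pair x∈ = canon-pair-≤ v _ (head-≤ (there x∈))

      canon-toPart-cycle : ∀ t → 2 ≤ length t → All (_∈ W′) t → canon (toPart (v ∷ t)) ≡ cyc (orient (v ∷ t))
      canon-toPart-cycle (x ∷ [])    (s≤s ()) _
      canon-toPart-cycle (x ∷ y ∷ r) _ t⊆ = cong cyc (canonCycle-least v (x ∷ y ∷ r) (All.map (head-≤ ∘ there) t⊆))

      𝟙-canon-cycle : ∀ {x y r} → let q = x ∷ y ∷ r in Unique q → All (_∈ W′) q → headIndex q ≤ lastIndex q →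
                      ∀ t → t ≢ [] → All (_∈ W′) t → 𝟙 (canon (toPart (v ∷ t)) ≟ₚ cyc (v ∷ q)) ≡ 𝟙 (t ≟ₗ q) + 𝟙 (t ≟ₗ reverse q)
      𝟙-canon-cycle {x} {y} {r} uq q⊆ h≤l []          t≢[] _         = ⊥-elim (t≢[] refl)
      𝟙-canon-cycle {x} {y} {r} uq q⊆ h≤l (z ∷ [])    _    (z∈ ∷ []) =
        trans (cong (λ C → 𝟙 (C ≟ₚ cyc (v ∷ x ∷ y ∷ r))) (canon-toPart-pair z∈))
              (sym (cong₂ _+_ (𝟙-no (z ∷ [] ≟ₗ x ∷ y ∷ r) (λ ())) (𝟙-no (z ∷ [] ≟ₗ reverse (x ∷ y ∷ r)) short)))
        where
        short : z ∷ [] ≢ reverse (x ∷ y ∷ r)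
        short z≡ with () ← trans (cong length z≡) (length-reverse (x ∷ y ∷ r))
      𝟙-canon-cycle {x} {y} {r} uq q⊆ h≤l t@(_ ∷ _ ∷ _) _ t⊆ =
        𝟙-⊎ (canon (toPart (v ∷ t)) ≟ₚ cyc (v ∷ q)) (t ≟ₗ q) (t ≟ₗ reverse q) either
            (λ t≡q → subst (λ t → canon (toPart (v ∷ t)) ≡ cyc (v ∷ q)) (sym t≡q) canon-q)
            (λ t≡rq → subst (λ t → canon (toPart (v ∷ t)) ≡ cyc (v ∷ q)) (sym t≡rq) canon-rq)
            (λ (t≡q , t≡rq) → q≢rq (trans (sym t≡q) t≡rq))
        where
        q : List (Fin n)
        q = x ∷ y ∷ r
        q≢rq : q ≢ reverse q
        q≢rq q≡rq = headIndex≢lastIndex uq (trans (cong headIndex q≡rq) (headIndex-reverse q))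
        canon-q : canon (toPart (v ∷ q)) ≡ cyc (v ∷ q)
        canon-q = trans (canon-toPart-cycle q (s≤s (s≤s z≤n)) q⊆) (cong cyc (orient-fixed v uq h≤l))
        canon-rq : canon (toPart (v ∷ reverse q)) ≡ cyc (v ∷ q)
        canon-rq = trans (canon-toPart-cycle (reverse q) (subst (2 ≤_) (sym (length-reverse q)) (s≤s (s≤s z≤n)))
                                             (All-resp-↭ (↭-sym (↭-reverse q)) q⊆))
                         (cong cyc (trans (orient-reverse v q uq) (orient-fixed v uq h≤l)))
        tail-≡ : ∀ {t′} → orient (v ∷ t) ≡ v ∷ t′ → cyc (orient (v ∷ t)) ≡ cyc (v ∷ q) → t′ ≡ q
        tail-≡ o≡ c≡ with trans (cong cyc (sym o≡)) c≡
        ... | refl = refl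
        either : canon (toPart (v ∷ t)) ≡ cyc (v ∷ q) → t ≡ q ⊎ t ≡ reverse q
        either eq with orient-spec v t | trans (sym (canon-toPart-cycle t (s≤s (s≤s z≤n)) t⊆)) eq
        ... | _ , o≡ , inj₁ refl , _ | c≡ = inj₁ (tail-≡ o≡ c≡)
        ... | _ , o≡ , inj₂ refl , _ | c≡ = inj₂ (trans (sym (reverse-involutive t)) (cong reverse (tail-≡ o≡ c≡)))

  module Counting {n : ℕ} (A : Fin n → Fin n → ℤ) (A-sym : ∀ u v → A u v ≡ A v u) where

    open Weights A
    open Removal (_≟ᶠ_ {n})
    open import Data.List.Membership.DecPropositional (_≟ᶠ_ {n}) using (_∈?_)

    -- the expansion meets a cycle of length at least three in both orientations, a pair only once
    partWeight : Part n → ℤ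
    partWeight (pair a b) = cycleWeight (a ∷ b ∷ [])
    partWeight (cyc us)   = + 2 * cycleWeight us

    partWeight-canon : ∀ P → partWeight (canon P) ≡ partWeight P
    partWeight-canon (pair a b) with toℕ a ℕ.≤? toℕ b
    ... | yes _ = refl
    ... | no  _ = cycleWeight-++-comm [ b ] [ a ]
    partWeight-canon (cyc us) = cong (+ 2 *_) (begin
        cycleWeight (orient (rotateTo (minIndex us) us))  ≡⟨ cycleWeight-orient (rotateTo (minIndex us) us) ⟩
        cycleWeight (rotateTo (minIndex us) us)           ≡⟨ cong cycleWeight (sym (rotateTo-is-rotate (minIndex us) us)) ⟩
        cycleWeight (rotate i us)                         ≡⟨ cycleWeight-rotate i us ⟩
        cycleWeight us                                    ∎)
      where
      open ≡-Reasoning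
      i : ℕ
      i = length (proj₁ (breakAt (minIndex us) us))
      cycleWeight-orient : ∀ vs → cycleWeight (orient vs) ≡ cycleWeight vs
      cycleWeight-orient []      = refl
      cycleWeight-orient (m ∷ q) with orient-spec m q
      ... | _ , eq , inj₁ refl , _ = cong cycleWeight eq
      ... | _ , eq , inj₂ refl , _ = trans (cong cycleWeight eq) (cycleWeight-reverseTail A-sym m q)

    module _ {v : Fin n} {W′ : List (Fin n)} (sorted : Sorted (v ∷ W′)) where

      orbitSum : ℕ → Part n → ℤ
      orbitSum g C = ∑ (λ (t , _) → 𝟙 (canon (toPart (v ∷ t)) ≟ₚ C) * cycleWeight (v ∷ t)) (arrangements⁺ g W′)

      private
        uW′ : Unique W′
        uW′ = AllPairs.tail (Sorted⇒Unique sorted)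

        ∑-𝟙-cycleWeight : ∀ g t₀ → length W′ ≤ g → t₀ ≢ [] → Unique t₀ → All (_∈ W′) t₀ →
                          ∑ (λ (t , _) → 𝟙 (t ≟ₗ t₀) * cycleWeight (v ∷ t)) (arrangements⁺ g W′) ≡ cycleWeight (v ∷ t₀)
        ∑-𝟙-cycleWeight g []       len t₀≢[] _  _  = ⊥-elim (t₀≢[] refl)
        ∑-𝟙-cycleWeight g (y ∷ t₀) len _     ut t⊆ = ∑-arrangements⁺-𝟙 g W′ y t₀ (λ t → cycleWeight (v ∷ t)) uW′ ut t⊆ len

        orbitSum-cong : ∀ g C (I : List (Fin n) → ℤ) →
                        (∀ t → t ≢ [] → All (_∈ W′) t → 𝟙 (canon (toPart (v ∷ t)) ≟ₚ C) ≡ I t) →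
                        orbitSum g C ≡ ∑ (λ (t , _) → I t * cycleWeight (v ∷ t)) (arrangements⁺ g W′)
        orbitSum-cong g C I eq = ∑-arrangements⁺-cong g W′ uW′ (λ t t≢[] t⊆ _ → cong (_* cycleWeight (v ∷ t)) (eq t t≢[] t⊆))

      orbitSum-pair : ∀ g {y} → length W′ ≤ g → y ∈ W′ → orbitSum g (pair v y) ≡ cycleWeight (v ∷ y ∷ [])
      orbitSum-pair g {y} len y∈ =
        trans (orbitSum-cong g (pair v y) (λ t → 𝟙 (t ≟ₗ y ∷ [])) indicator)
              (∑-𝟙-cycleWeight g (y ∷ []) len (λ ()) ([] ∷ []) (y∈ ∷ []))
        where
        indicator : ∀ t → t ≢ [] → All (_∈ W′) t → 𝟙 (canon (toPart (v ∷ t)) ≟ₚ pair v y) ≡ 𝟙 (t ≟ₗ y ∷ [])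
        indicator []          t≢[] _          = ⊥-elim (t≢[] refl)
        indicator (x ∷ [])    _    (x∈ ∷ [])  = trans (cong (λ C → 𝟙 (C ≟ₚ pair v y)) (canon-toPart-pair sorted x∈))
          (𝟙-cong (pair v x ≟ₚ pair v y) (x ∷ [] ≟ₗ y ∷ []) (λ { refl → refl }) (λ { refl → refl }))
        indicator (x ∷ z ∷ r) _    t⊆         = trans (cong (λ C → 𝟙 (C ≟ₚ pair v y)) (canon-toPart-cycle sorted (x ∷ z ∷ r) (s≤s (s≤s z≤n)) t⊆))
          (𝟙-cong (cyc (orient (v ∷ x ∷ z ∷ r)) ≟ₚ pair v y) (x ∷ z ∷ r ≟ₗ y ∷ []) (λ ()) (λ ()))

      orbitSum-cycle : ∀ g {x y r} → let q = x ∷ y ∷ r in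
                       length W′ ≤ g → Unique q → All (_∈ W′) q → headIndex q ≤ lastIndex q →
                       orbitSum g (cyc (v ∷ q)) ≡ + 2 * cycleWeight (v ∷ q)
      orbitSum-cycle g {x} {y} {r} len uq q⊆ h≤l = begin
          orbitSum g (cyc (v ∷ q))
        ≡⟨ orbitSum-cong g (cyc (v ∷ q)) (λ t → 𝟙 (t ≟ₗ q) + 𝟙 (t ≟ₗ reverse q)) (𝟙-canon-cycle sorted uq q⊆ h≤l) ⟩
          ∑ (λ (t , _) → (𝟙 (t ≟ₗ q) + 𝟙 (t ≟ₗ reverse q)) * cycleWeight (v ∷ t)) (arrangements⁺ g W′)
        ≡⟨ ∑-cong (λ (t , _) → *-distribʳ-+ (cycleWeight (v ∷ t)) (𝟙 (t ≟ₗ q)) _) (arrangements⁺ g W′) ⟩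
          ∑ (λ (t , _) → 𝟙 (t ≟ₗ q) * cycleWeight (v ∷ t) + 𝟙 (t ≟ₗ reverse q) * cycleWeight (v ∷ t)) (arrangements⁺ g W′)
        ≡⟨ ∑-+ (λ (t , _) → 𝟙 (t ≟ₗ q) * cycleWeight (v ∷ t)) _ (arrangements⁺ g W′) ⟩
          ∑ (λ (t , _) → 𝟙 (t ≟ₗ q) * cycleWeight (v ∷ t)) (arrangements⁺ g W′)
            + ∑ (λ (t , _) → 𝟙 (t ≟ₗ reverse q) * cycleWeight (v ∷ t)) (arrangements⁺ g W′)
        ≡⟨ cong₂ _+_ (∑-𝟙-cycleWeight g q len (λ ()) uq q⊆)
                     (∑-𝟙-cycleWeight g (reverse q) len (reverse-nonempty x (y ∷ r))
                                      (Unique-resp-↭ (↭-sym (↭-reverse q)) uq) (All-resp-↭ (↭-sym (↭-reverse q)) q⊆)) ⟩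
          cycleWeight (v ∷ q) + cycleWeight (v ∷ reverse q)
        ≡⟨ cong (λ c → cycleWeight (v ∷ q) + c) (cycleWeight-reverseTail A-sym v q) ⟩
          cycleWeight (v ∷ q) + cycleWeight (v ∷ q)
        ≡⟨ double (cycleWeight (v ∷ q)) ⟩
          + 2 * cycleWeight (v ∷ q) ∎
        where
        open ≡-Reasoning
        q : List (Fin n)
        q = x ∷ y ∷ r
        double : ∀ c → c + c ≡ + 2 * c
        double = solve-∀

      orbitSum-part : ∀ g P₀ → length W′ ≤ g → WellShaped P₀ → Unique (vertices P₀) → v ∈ vertices P₀ →
                      All (_∈ v ∷ W′) (vertices P₀) → orbitSum g (canon P₀) ≡ partWeight P₀
      orbitSum-part g (pair .v b) len _ ((v≢b ∷ []) ∷ _) (here refl) (_ ∷ b∈ ∷ []) =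
        trans (cong (orbitSum g) (canon-pair-≤ v b (head-≤ sorted b∈))) (orbitSum-pair g len (∈-tail sorted b∈ (v≢b ∘ toℕ-injective ∘ sym)))
      orbitSum-part g (pair a .v) len _ ((a≢v ∷ []) ∷ _) (there (here refl)) (a∈ ∷ _ ∷ []) =
        trans (cong (orbitSum g) (canon-pair-> a v (<⇒≱ (All.lookup (AllPairs.head sorted) a∈′))))
              (trans (orbitSum-pair g len a∈′) (cycleWeight-++-comm [ v ] [ a ]))
        where
        a∈′ : a ∈ W′
        a∈′ = ∈-tail sorted a∈ (a≢v ∘ toℕ-injective)
      orbitSum-part g (cyc us) len three u v∈ us⊆ with ∈-∃++ v∈
      ... | a , b , refl with orient-spec v (b ++ a) | Unique-resp-↭ (↭-front a v b) u
      ... | q , o≡ , which , h≤l | v∉ba ∷ uba = begin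
          orbitSum g (canon (cyc (a ++ v ∷ b)))  ≡⟨ cong (orbitSum g) canon≡ ⟩
          orbitSum g (cyc (v ∷ q))               ≡⟨ long q (subst (2 ≤_) (sym (↭-length q↭)) two≤) uq q⊆ h≤l ⟩
          partWeight (cyc (v ∷ q))               ≡⟨ cong partWeight (sym canon≡) ⟩
          partWeight (canon (cyc (a ++ v ∷ b)))  ≡⟨ partWeight-canon (cyc (a ++ v ∷ b)) ⟩
          partWeight (cyc (a ++ v ∷ b))          ∎
        where
        open ≡-Reasoning
        canon≡ : canon (cyc (a ++ v ∷ b)) ≡ cyc (v ∷ q)
        canon≡ = cong cyc (trans (cong (λ k → orient (rotateTo k (a ++ v ∷ b))) (key-least sorted us⊆ v∈))
                                (trans (cong orient (rotateTo-at (toℕ v) a v b (proj₁ (Unique-avoids a u)) refl)) o≡))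
        q↭ : q ↭ b ++ a
        q↭ = Sum.[ (λ q≡ → subst (_↭ b ++ a) (sym q≡) ↭-refl) , (λ q≡ → subst (_↭ b ++ a) (sym q≡) (↭-reverse (b ++ a))) ] which
        uq : Unique q
        uq = Unique-resp-↭ (↭-sym q↭) uba
        q⊆ : All (_∈ W′) q
        q⊆ with All-resp-↭ (↭-front a v b) us⊆
        ... | _ ∷ ba⊆ = All-resp-↭ (↭-sym q↭) (All.zipWith (λ (z∈ , v≢z) → ∈-tail sorted z∈ (v≢z ∘ toℕ-injective ∘ sym)) (ba⊆ , v∉ba))
        two≤ : 2 ≤ length (b ++ a)
        two≤ = ≤-pred (subst (3 ≤_) (↭-length (↭-front a v b)) three)
        long : ∀ q → 2 ≤ length q → Unique q → All (_∈ W′) q → headIndex q ≤ lastIndex q →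
               orbitSum g (cyc (v ∷ q)) ≡ + 2 * cycleWeight (v ∷ q)
        long (x ∷ [])    (s≤s ())
        long (x ∷ y ∷ r) _ = orbitSum-cycle g len

    fibreSum : ℕ → List (Fin n) → Partition n → ℤ
    fibreSum f W S = ∑ (λ (ω , _) → 𝟙 (sameBuckets? (toPartition ω) S) * ∏ cycleWeight ω) (configurations f W)

    Fibre : ℕ → Set
    Fibre f = ∀ W → length W ≤ f → Sorted W → ∀ S → WellFormed S → All WellShaped S → All (_∈ W) (allVertices S) →
              fibreSum f W S ≡ ∏ partWeight S

    private
      cycleTerms : ℕ → Fin n → List (Fin n) → Partition n → List (Fin n) → List (Fin n) → ℤ
      cycleTerms f v W′ S t R =
        ∑ (λ (ω , _) → 𝟙 (sameBuckets? (toPart (v ∷ t) ∷ toPartition ω) S) * (cycleWeight (v ∷ t) * ∏ cycleWeight ω))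
          (configurations f R)

      fibreSum-∷ : ∀ f v W′ S → fibreSum (suc f) (v ∷ W′) S
                                 ≡ fibreSum f W′ S + ∑ (λ (t , R) → cycleTerms f v W′ S t R) (arrangements⁺ (suc f) W′)
      fibreSum-∷ f v W′ S = ∑-configurations-∷ f v W′ (λ (ω , _) → 𝟙 (sameBuckets? (toPartition ω) S) * ∏ cycleWeight ω)

      configuration-avoids : ∀ {R ω k} (v : Fin n) → v ∉ R → IsConfiguration R (ω , k) → All (λ Q → key Q ≢ toℕ v) (toPartition ω)
      configuration-avoids {ω = ω} v v∉R (ω⊆ , _) =
        keys-avoid v (toPartition ω) (λ v∈ → v∉R (All.lookup ω⊆ (subst (v ∈_) (allVertices-toPartition ω) v∈)))

      module Uncovered {f : ℕ} (IH : Fibre f) {v : Fin n} {W′ : List (Fin n)} {S : Partition n} (sorted : Sorted (v ∷ W′)) (len : length W′ ≤ f)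
                       (wf : WellFormed S) (shaped : All WellShaped S) (S⊆ : All (_∈ v ∷ W′) (allVertices S))
                       (v∉S : v ∉ allVertices S) where

        no-cycle-through-v : ∀ t → All (_∈ W′) t → ∀ R → cycleTerms f v W′ S t R ≡ 0ℤ
        no-cycle-through-v t t⊆ R =
          ∑-zero _ (λ (ω , _) → cong (_* _) (𝟙-no (sameBuckets? (toPart (v ∷ t) ∷ toPartition ω) S) (mismatch ω))) (configurations f R)
          where
          mismatch : ∀ ω → ¬ SameBuckets (toPart (v ∷ t) ∷ toPartition ω) S
          mismatch ω same with trans (sym (canonBucket-accept (toPart (v ∷ t)) (toPartition ω) (toℕ v) (key-toPart sorted t t⊆)))
                                     (trans (SameBuckets-lookup {S = toPart (v ∷ t) ∷ toPartition ω} {T = S} same (toℕ<n v))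
                                            (canonBucket-avoid S (toℕ v) (keys-avoid v S v∉S)))
          ... | ()

        fibre-uncovered : fibreSum (suc f) (v ∷ W′) S ≡ ∏ partWeight S
        fibre-uncovered = begin
            fibreSum (suc f) (v ∷ W′) S
          ≡⟨ fibreSum-∷ f v W′ S ⟩
            fibreSum f W′ S + ∑ (λ (t , R) → cycleTerms f v W′ S t R) (arrangements⁺ (suc f) W′)
          ≡⟨ cong₂ _+_ (IH W′ len (AllPairs.tail sorted) S wf shaped S⊆W′)
                       (trans (∑-arrangements⁺-cong (suc f) W′ (AllPairs.tail (Sorted⇒Unique sorted))
                                                    (λ t _ t⊆ _ → no-cycle-through-v t t⊆ (W′ ∖ t)))
                              (∑-zero _ (λ _ → refl) (arrangements⁺ (suc f) W′))) ⟩
            ∏ partWeight S + 0ℤ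
          ≡⟨ +-identityʳ _ ⟩
            ∏ partWeight S ∎
          where
          open ≡-Reasoning
          S⊆W′ : All (_∈ W′) (allVertices S)
          S⊆W′ = All.tabulate (λ {z} z∈S → ∈-tail sorted (All.lookup S⊆ z∈S)
                                                  (λ z≡v → v∉S (subst (_∈ allVertices S) (toℕ-injective z≡v) z∈S)))

      module Covered {f : ℕ} (IH : Fibre f) {v : Fin n} {W′ : List (Fin n)} {S : Partition n} (sorted : Sorted (v ∷ W′)) (len : length W′ ≤ f)
                     (wf : WellFormed S) (shaped : All WellShaped S) (S⊆ : All (_∈ v ∷ W′) (allVertices S))
                     (v∈S : v ∈ allVertices S) where

        uW′ : Unique W′
        uW′ = AllPairs.tail (Sorted⇒Unique sorted)

        ∈-allVertices : ∀ {z Q} → Q ∈ S → z ∈ vertices Q → z ∈ allVertices S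
        ∈-allVertices {z} {Q} Q∈S z∈Q = Any.concatMap⁺ vertices {xs = S} (Any.map (λ { refl → z∈Q }) Q∈S)

        part-through-v : ∃ λ P → P ∈ S × v ∈ vertices P
        part-through-v = find (Any.concatMap⁻ vertices {xs = S} v∈S)

        P : Part n
        P = proj₁ part-through-v
        P∈S : P ∈ S
        P∈S = proj₁ (proj₂ part-through-v)
        v∈P : v ∈ vertices P
        v∈P = proj₂ (proj₂ part-through-v)

        P⊆ : All (_∈ v ∷ W′) (vertices P)
        P⊆ = All.tabulate (λ z∈P → All.lookup S⊆ (∈-allVertices P∈S z∈P))

        S-v : bucket S (toℕ v) ≡ P ∷ []
        S-v = ∈-length≤1⇒≡ (∈-filter⁺ (λ Q → key Q ℕ.≟ toℕ v) P∈S (key-least sorted P⊆ v∈P)) (bucket-length≤1 S wf (toℕ v))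

        S₀ : Partition n
        S₀ = dropBucket (toℕ v) S

        S↭ : S ↭ P ∷ S₀
        S↭ = subst (λ B → S ↭ B ++ S₀) S-v (filter-↭ (λ Q → key Q ℕ.≟ toℕ v) S)

        uPS₀ : Unique (vertices P ++ allVertices S₀)
        uPS₀ = Unique-resp-↭ (allVertices-↭ (↭⇒PartitionEq S↭)) (proj₂ wf)

        wf₀ : WellFormed S₀
        wf₀ = All.tail (All-resp-↭ S↭ (proj₁ wf)) , proj₂ (Unique-++⁻ (vertices P) uPS₀)

        first≡0 : fibreSum f W′ S ≡ 0ℤ
        first≡0 = ∑-zeroᴬ (All.map (λ {(ω , _)} spec → cong (_* ∏ cycleWeight ω) (𝟙-no (sameBuckets? (toPartition ω) S) (mismatch spec)))
                                   (configurations-spec f uW′))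
          where
          mismatch : ∀ {ω k} → IsConfiguration W′ (ω , k) → ¬ SameBuckets (toPartition ω) S
          mismatch {ω} spec same with trans (sym (canonBucket-avoid (toPartition ω) (toℕ v) (configuration-avoids v (v∉W′ sorted) spec)))
                                            (trans (SameBuckets-lookup {S = toPartition ω} {T = S} same (toℕ<n v)) (cong (map canon) S-v))
          ... | ()

        S₀⊆ : ∀ t → canon (toPart (v ∷ t)) ≡ canon P → All (_∈ W′ ∖ t) (allVertices S₀)
        S₀⊆ t canon≡ = All.tabulate (λ {z} z∈S₀ → ∈-∖⁺ {t} {W′} (z∈W′ z∈S₀) (z∉t z∈S₀))
          where
          z∉P : ∀ {z} → z ∈ allVertices S₀ → z ∉ vertices P
          z∉P z∈S₀ z∈P = Unique-++-disjoint (vertices P) uPS₀ z∈P z∈S₀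
          z∈W′ : ∀ {z} → z ∈ allVertices S₀ → z ∈ W′
          z∈W′ z∈S₀ = ∈-tail sorted (All.lookup S⊆ (∈-resp-↭ (↭-sym (allVertices-↭ (↭⇒PartitionEq S↭))) (∈-++⁺ʳ (vertices P) z∈S₀)))
                                     (λ z≡v → z∉P z∈S₀ (subst (_∈ vertices P) (sym (toℕ-injective z≡v)) v∈P))
          z∉t : ∀ {z} → z ∈ allVertices S₀ → z ∉ t
          z∉t {z} z∈S₀ z∈t = z∉P z∈S₀ (∈-resp-↭ (vertices-canon P) (subst (λ C → z ∈ vertices C) canon≡
                               (∈-resp-↭ (↭-sym (vertices-canon (toPart (v ∷ t)))) (subst (z ∈_) (sym (vertices-toPart (v ∷ t))) (there z∈t)))))

        term : ∀ t → All (_∈ W′) t →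
               cycleTerms f v W′ S t (W′ ∖ t) ≡ 𝟙 (canon (toPart (v ∷ t)) ≟ₚ canon P) * (cycleWeight (v ∷ t) * ∏ partWeight S₀)
        term t t⊆ = begin
            cycleTerms f v W′ S t (W′ ∖ t)
          ≡⟨ ∑-congᴬ (All.map factor (configurations-spec f (∖-unique t uW′))) ⟩
            ∑ (λ (ω , _) → 𝟙 first? * (c * (𝟙 (sameBuckets? (toPartition ω) S₀) * ∏ cycleWeight ω))) (configurations f (W′ ∖ t))
          ≡⟨ ∑-*ˡ (𝟙 first?) _ (configurations f (W′ ∖ t)) ⟩
            𝟙 first? * ∑ (λ (ω , _) → c * (𝟙 (sameBuckets? (toPartition ω) S₀) * ∏ cycleWeight ω)) (configurations f (W′ ∖ t))
          ≡⟨ cong (𝟙 first? *_) (∑-*ˡ c _ (configurations f (W′ ∖ t))) ⟩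
            𝟙 first? * (c * fibreSum f (W′ ∖ t) S₀)
          ≡⟨ 𝟙-guard first? (λ canon≡ → cong (c *_) (IH (W′ ∖ t) (≤-trans (length-filter _ W′) len)
                                                       (AllPairs.filter⁺ _ (AllPairs.tail sorted)) S₀ wf₀ shaped₀ (S₀⊆ t canon≡))) ⟩
            𝟙 first? * (c * ∏ partWeight S₀) ∎
          where
          open ≡-Reasoning
          c : ℤ
          c = cycleWeight (v ∷ t)
          first? : Dec (canon (toPart (v ∷ t)) ≡ canon P)
          first? = canon (toPart (v ∷ t)) ≟ₚ canon P
          shaped₀ : All WellShaped S₀
          shaped₀ = All.tail (All-resp-↭ S↭ shaped)
          rearrange : ∀ a b c d → a * b * (c * d) ≡ a * (c * (b * d))
          rearrange = solve-∀
          factor : ∀ {(ω , k) : List (List (Fin n)) × ℕ} → IsConfiguration (W′ ∖ t) (ω , k) →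
                   𝟙 (sameBuckets? (toPart (v ∷ t) ∷ toPartition ω) S) * (c * ∏ cycleWeight ω)
                     ≡ 𝟙 first? * (c * (𝟙 (sameBuckets? (toPartition ω) S₀) * ∏ cycleWeight ω))
          factor {ω , _} spec =
            trans (cong (_* (c * ∏ cycleWeight ω))
                        (𝟙-× (sameBuckets? (toPart (v ∷ t) ∷ toPartition ω) S) first? (sameBuckets? (toPartition ω) S₀)
                             (SameBuckets-∷⁻ {π = π} {S = S} kπ Ω≢v S-v (toℕ<n v)) (SameBuckets-∷⁺ {π = π} {S = S} kπ Ω≢v S-v)))
                  (rearrange (𝟙 first?) _ c (∏ cycleWeight ω))
            where
            π : Part n
            π = toPart (v ∷ t)
            kπ : key π ≡ toℕ v
            kπ = key-toPart sorted t t⊆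
            Ω≢v : All (λ Q → key Q ≢ toℕ v) (toPartition ω)
            Ω≢v = configuration-avoids v (λ v∈ → v∉W′ sorted (proj₁ (∈-∖⁻ {t} {W′} v∈))) spec

        fibre-covered : fibreSum (suc f) (v ∷ W′) S ≡ ∏ partWeight S
        fibre-covered = begin
            fibreSum (suc f) (v ∷ W′) S
          ≡⟨ fibreSum-∷ f v W′ S ⟩
            fibreSum f W′ S + ∑ (λ (t , R) → cycleTerms f v W′ S t R) (arrangements⁺ (suc f) W′)
          ≡⟨ cong₂ _+_ first≡0 (∑-arrangements⁺-cong (suc f) W′ uW′ (λ t _ t⊆ _ → term t t⊆)) ⟩
            0ℤ + ∑ (λ (t , _) → 𝟙 (canon (toPart (v ∷ t)) ≟ₚ canon P) * (cycleWeight (v ∷ t) * K)) (arrangements⁺ (suc f) W′)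
          ≡⟨ +-identityˡ _ ⟩
            ∑ (λ (t , _) → 𝟙 (canon (toPart (v ∷ t)) ≟ₚ canon P) * (cycleWeight (v ∷ t) * K)) (arrangements⁺ (suc f) W′)
          ≡⟨ ∑-cong (λ (t , _) → sym (*-assoc (𝟙 (canon (toPart (v ∷ t)) ≟ₚ canon P)) (cycleWeight (v ∷ t)) K)) (arrangements⁺ (suc f) W′) ⟩
            ∑ (λ (t , _) → 𝟙 (canon (toPart (v ∷ t)) ≟ₚ canon P) * cycleWeight (v ∷ t) * K) (arrangements⁺ (suc f) W′)
          ≡⟨ ∑-*ʳ (λ (t , _) → 𝟙 (canon (toPart (v ∷ t)) ≟ₚ canon P) * cycleWeight (v ∷ t)) K (arrangements⁺ (suc f) W′) ⟩
            orbitSum sorted (suc f) (canon P) * K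
          ≡⟨ cong (_* K) (orbitSum-part sorted (suc f) P (≤-trans len (n≤1+n f)) (All.lookup shaped P∈S)
                                        (All.lookup (parts-unique S (proj₂ wf)) P∈S) v∈P P⊆) ⟩
            partWeight P * K
          ≡⟨ ∏-↭ partWeight (↭-sym S↭) ⟩
            ∏ partWeight S ∎
          where
          open ≡-Reasoning
          K : ℤ
          K = ∏ partWeight S₀

    fibre : ∀ f → Fibre f
    fibre f       []       _         _      []      _                _      _  =
      cong (λ x → x * 1ℤ + 0ℤ) (𝟙-yes (sameBuckets? {n} [] []) (All.tabulate (λ _ → refl)))
    fibre f       []       _         _      (P ∷ S) ((ne ∷ _) , _)   _      S⊆ with key-attained P ne
    ... | m , m∈P , _ with All.lookup S⊆ (∈-++⁺ˡ m∈P)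
    ... | ()
    fibre (suc f) (v ∷ W′) (s≤s len) sorted S       wf               shaped S⊆ with v ∈? allVertices S
    ... | yes v∈S = Covered.fibre-covered (fibre f) sorted len wf shaped S⊆ v∈S
    ... | no  v∉S = Uncovered.fibre-uncovered (fibre f) sorted len wf shaped S⊆ v∉S

module Distance where

  open import Defs using (Graph; adj; irrefl; reach; least; dist; diam; antipodal?)
  open import Data.Bool using (Bool; true; false; T; _∧_; not; if_then_else_)
  open import Data.Bool.Properties using (T-≡; T-∧; T-∨)
  open import Data.Empty using (⊥-elim)
  open import Data.Fin using (Fin; zero; suc)
  open import Data.Fin.Properties using (_≟_)
  open import Data.List using (allFin)
  open import Data.List.Membership.Propositional using (find)
  open import Data.List.Membership.Propositional.Properties using (∈-allFin)
  open import Data.List.Relation.Unary.Any as Any using (Any)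
  open import Data.List.Relation.Unary.Any.Properties using (any⁺; any⁻)
  open import Data.Nat using (ℕ; zero; suc; _≡ᵇ_)
  open import Data.Product using (_×_; _,_; ∃)
  open import Data.Sum using (_⊎_; inj₁; inj₂)
  open import Function using (_∘_)
  open import Function.Bundles using (Equivalence)
  open import Relation.Binary.PropositionalEquality using (_≡_; _≢_; refl; sym; trans; cong₂; subst)
  open import Relation.Nullary using (yes; no)
  open import Relation.Nullary.Decidable using (⌊_⌋)

  open Equivalence using (to; from)

  private
    T-ext : ∀ {x y} → (T x → T y) → (T y → T x) → x ≡ y
    T-ext {false} {false} _ _ = refl
    T-ext {false} {true}  _ y⇒x = ⊥-elim (y⇒x _)
    T-ext {true}  {false} x⇒y _ = ⊥-elim (x⇒y _)
    T-ext {true}  {true}  _ _ = refl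

  module _ {n : ℕ} (G : Graph n) where

    Reach : ℕ → Fin n → Fin n → Set
    Reach m u v = T (reach G m u v)

    private
      reach-zero : ∀ {u v} → Reach 0 u v → u ≡ v
      reach-zero {u} {v} r with u ≟ v
      ... | yes u≡v = u≡v

      reach-refl : ∀ v → Reach 0 v v
      reach-refl v with v ≟ v
      ... | yes _   = _
      ... | no  v≢v = ⊥-elim (v≢v refl)

      reach-suc⁻ : ∀ {m u v} → Reach (suc m) u v → Reach m u v ⊎ ∃ λ w → T (adj G u w) × Reach m w v
      reach-suc⁻ {m} {u} {v} r with to T-∨ r
      ... | inj₁ r′ = inj₁ r′
      ... | inj₂ a with find (any⁻ (λ w → adj G u w ∧ reach G m w v) (allFin n) a)
      ...   | w , _ , uw∧wv = inj₂ (w , to T-∧ uw∧wv)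

      reach-suc : ∀ {m u v} → Reach m u v → Reach (suc m) u v
      reach-suc r = from T-∨ (inj₁ r)

      reach-step : ∀ {m u w v} → T (adj G u w) → Reach m w v → Reach (suc m) u v
      reach-step {m} {u} {w} {v} uw r =
        from T-∨ (inj₂ (any⁺ (λ w → adj G u w ∧ reach G m w v) (Any.map (λ { refl → from T-∧ (uw , r) }) (∈-allFin w))))

      reach-snoc : ∀ m {u w v} → Reach m u w → T (adj G w v) → Reach (suc m) u v
      reach-snoc zero    {u} {w} {v} r wv with reach-zero {u} {w} r
      ... | refl = reach-step {0} {u} {v} {v} wv (reach-refl v)
      reach-snoc (suc m) {u} {w} {v} r wv with reach-suc⁻ {m} r
      ... | inj₁ r′             = reach-suc {suc m} {u} {v} (reach-snoc m r′ wv)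
      ... | inj₂ (x , ux , xw)  = reach-step {suc m} {u} {x} {v} ux (reach-snoc m xw wv)

      reach-flip : ∀ m {u v} → Reach m u v → Reach m v u
      reach-flip zero    {u} {v} r with reach-zero {u} {v} r
      ... | refl = r
      reach-flip (suc m) {u} {v} r with reach-suc⁻ {m} r
      ... | inj₁ r′            = reach-suc {m} {v} {u} (reach-flip m r′)
      ... | inj₂ (w , uw , wv) = reach-snoc m {v} {w} {u} (reach-flip m wv) (subst T (Graph.sym G u w) uw)

    reach-sym : ∀ m u v → reach G m u v ≡ reach G m v u
    reach-sym m u v = T-ext (reach-flip m) (reach-flip m)

    dist-sym : ∀ u v → dist G u v ≡ dist G v u
    dist-sym u v = least-cong n (λ m → reach-sym m u v)
      where
      least-cong : ∀ b {f g : ℕ → Bool} → (∀ i → f i ≡ g i) → least b f ≡ least b g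
      least-cong zero    f≗g = refl
      least-cong (suc b) {f} {g} f≗g = cong₂ (λ x t → if x then 0 else suc t) (f≗g 0) (least-cong b (f≗g ∘ suc))

    antipodal?-sym : ∀ u v → antipodal? G u v ≡ antipodal? G v u
    antipodal?-sym u v = cong₂ (λ b d → not b ∧ (d ≡ᵇ diam G)) (≟-sym u v) (dist-sym u v)
      where
      ≟-sym : ∀ (u v : Fin n) → ⌊ u ≟ v ⌋ ≡ ⌊ v ≟ u ⌋
      ≟-sym u v with u ≟ v | v ≟ u
      ... | yes _   | yes _   = refl
      ... | no  _   | no  _   = refl
      ... | yes u≡v | no  v≢u = ⊥-elim (v≢u (sym u≡v))
      ... | no  u≢v | yes v≡u = ⊥-elim (u≢v (sym v≡u))

    adj⇒≢ : ∀ {u v} → adj G u v ≡ true → u ≢ v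
    adj⇒≢ {u} uv refl with () ← trans (sym uv) (irrefl G u)

    dist-adj : ∀ {u v} → adj G u v ≡ true → dist G u v ≡ 1
    dist-adj {u} {v} uv = at-least-two n u v (adj⇒≢ uv) refl
      where
      not-zero : reach G 0 u v ≡ false
      not-zero with u ≟ v
      ... | yes u≡v = ⊥-elim (adj⇒≢ uv u≡v)
      ... | no  _   = refl
      one : reach G 1 u v ≡ true
      one = to T-≡ (reach-step {0} {u} {v} {v} (from T-≡ uv) (reach-refl v))
      at-least-two : ∀ m (x y : Fin m) → x ≢ y → m ≡ n → least n (λ k → reach G k u v) ≡ 1
      at-least-two (suc zero)    zero zero x≢y _    = ⊥-elim (x≢y refl)
      at-least-two (suc (suc m)) _    _    _   refl = least-one m (λ k → reach G k u v) not-zero one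
        where
        least-one : ∀ k (f : ℕ → Bool) → f 0 ≡ false → f 1 ≡ true → least (suc (suc k)) f ≡ 1
        least-one k f f0 f1 rewrite f0 | f1 = refl

module ADMatrix where

  import Algebra.Properties.CommutativeSemigroup
  open Sums
  open Lists
  open ListDeterminant
  open Arrangements
  open Sachs
  open CanonicalParts
  open PartitionNormalForm
  open Fibres
  open Distance
  open import Defs hiding (sym)
  open import Data.Bool using (Bool; true; false; T; if_then_else_)
  open import Data.Bool.Properties using (T-≡)
  open import Data.Empty using (⊥-elim)
  open import Data.Fin using (Fin)
  open import Data.Fin.Properties using (_≟_)
  open import Data.Integer as ℤ using (ℤ; +_; -_; -1ℤ; _*_; _^_)
  import Data.Integer.Properties as ℤ
  open import Data.Integer.Tactic.RingSolver using (solve-∀)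
  open import Data.Nat as ℕ using (ℕ; zero; suc; _≤_; _<_; z≤n; s≤s; _∸_)
  import Data.Nat.Properties as ℕ
  open import Data.Nat.ListAction using (sum)
  open import Data.List using (List; []; _∷_; [_]; _++_; map; zip; concat; length; allFin)
  open import Data.List.Properties using (length-tabulate)
  import Data.List.Relation.Unary.All.Properties as All
  open import Data.List.Relation.Unary.All as All using (All; []; _∷_)
  open import Data.List.Relation.Unary.Any using (Any; here; there)
  open import Data.List.Relation.Unary.AllPairs using (AllPairs; []; _∷_)
  open import Data.List.Membership.Propositional using (find)
  open import Data.List.Membership.Propositional.Properties using (∈-allFin)
  open import Data.List.Relation.Unary.Unique.Propositional using (Unique)
  open import Data.Product using (_×_; _,_; proj₁; proj₂; uncurry)
  open import Data.Sum using (inj₁; inj₂)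
  open import Function using (_∘_; id)
  open import Function.Bundles using (Equivalence)
  open import Relation.Binary.PropositionalEquality using (_≡_; _≢_; refl; sym; trans; cong; cong₂; subst; module ≡-Reasoning)
  open import Relation.Nullary using (Dec; yes; no; ¬_)
  open import Relation.Nullary.Decidable using (⌊_⌋)

  ∑-𝟙-representatives : ∀ {n} (X : Partition n) L → AllPairs (λ S T → ¬ PartitionEq S T) L → All WellFormed L →
                        WellFormed X → Any (PartitionEq X) L → ∑ (λ S → 𝟙 (sameBuckets? X S)) L ≡ ℤ.1ℤ
  ∑-𝟙-representatives X (S ∷ L) (S≉L ∷ distinct) (wfS ∷ wfL) wfX (here X≈S) =
    trans (cong₂ ℤ._+_ (𝟙-yes (sameBuckets? X S) X~S) (∑-zeroᴬ (All.zipWith (λ {T} (S≉T , wfT) → 𝟙-no (sameBuckets? X T) (S≉T ∘ same⇒≈ wfT)) (S≉L , wfL))))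
          (ℤ.+-identityʳ ℤ.1ℤ)
    where
    X~S : SameBuckets X S
    X~S = PartitionEq⇒SameBuckets X≈S wfX
    same⇒≈ : ∀ {T} → WellFormed T → SameBuckets X T → PartitionEq S T
    same⇒≈ {T} wfT X~T = SameBuckets⇒PartitionEq {S = S} {T = T} wfS wfT (SameBuckets-trans {R = X} {S = S} {T = T} X~S X~T)
  ∑-𝟙-representatives X (S ∷ L) (S≉L ∷ distinct) (wfS ∷ wfL) wfX (there X≈L) =
    trans (cong₂ ℤ._+_ (𝟙-no (sameBuckets? X S) X≁S) (∑-𝟙-representatives X L distinct wfL wfX X≈L)) (ℤ.+-identityˡ ℤ.1ℤ)
    where
    X≁S : ¬ SameBuckets X S
    X≁S X~S with find X≈L
    ... | T , T∈L , X≈T = All.lookup S≉L T∈L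
      (SameBuckets⇒PartitionEq {S = S} {T = T} wfS (All.lookup wfL T∈L)
        (SameBuckets-trans {R = X} {S = S} {T = T} X~S (PartitionEq⇒SameBuckets X≈T wfX)))

  ∑≡sumℤ : ∀ {A : Set} (f : A → ℤ) xs → ∑ f xs ≡ sumℤ (map f xs)
  ∑≡sumℤ f []       = refl
  ∑≡sumℤ f (x ∷ xs) = cong (λ s → f x ℤ.+ s) (∑≡sumℤ f xs)

  module _ {n : ℕ} (G : Graph n) where

    private
      d : ℤ
      d = + diam G

    AD-sym : ∀ u v → AD G u v ≡ AD G v u
    AD-sym u v = cong₂ (λ a b → if a then + 1 else (if b then + diam G else + 0)) (Graph.sym G u v) (antipodal?-sym G u v)

    AD-diag : ∀ v → AD G v v ≡ + 0
    AD-diag v rewrite irrefl G v with v ≟ v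
    ... | yes _   = refl
    ... | no  v≢v = ⊥-elim (v≢v refl)

    antipodal?⇒Antipodal : ∀ {u v} → antipodal? G u v ≡ true → Antipodal G u v
    antipodal?⇒Antipodal {u} {v} anti with u ≟ v
    ... | no u≢v = u≢v , ℕ.≡ᵇ⇒≡ (dist G u v) (diam G) (Equivalence.from T-≡ anti)

    Antipodal⇒antipodal? : ∀ {u v} → Antipodal G u v → antipodal? G u v ≡ true
    Antipodal⇒antipodal? {u} {v} (u≢v , dist≡diam) with u ≟ v
    ... | yes u≡v = ⊥-elim (u≢v u≡v)
    ... | no  _   = Equivalence.to T-≡ (ℕ.≡⇒≡ᵇ (dist G u v) (diam G) dist≡diam)

    -- when d = 1 an adjacent pair is also antipodal; both readings give the entry 1
    AD-ADRel : ∀ {u v} → ADRel G u v → AD G u v ≡ d ^ b2n G (antipodal? G u v)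
    AD-ADRel {u} {v} r with adj G u v in uv | antipodal? G u v in anti≡
    ... | true  | false = refl
    ... | true  | true  = cong (λ k → + k * + 1) (sym diam≡1)
      where
      diam≡1 : diam G ≡ 1
      diam≡1 = trans (sym (proj₂ (antipodal?⇒Antipodal anti≡))) (dist-adj G uv)
    ... | false | true  = sym (ℤ.*-identityʳ d)
    AD-ADRel (inj₁ ())   | false | _
    AD-ADRel (inj₂ anti) | false | false with () ← trans (sym (Antipodal⇒antipodal? anti)) anti≡

    ADRel-nonzero : ∀ u v → AD G u v ≢ + 0 → ADRel G u v
    ADRel-nonzero u v nz with adj G u v | antipodal? G u v in anti
    ... | true  | _     = inj₁ refl
    ... | false | true  = inj₂ (antipodal?⇒Antipodal anti)
    ... | false | false = ⊥-elim (nz refl)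

    open Weights (AD G)
    open Counting (AD G) AD-sym
    open Removal (_≟_ {n})

    signedPower : ℕ → ℕ → ℕ → ℕ → ℤ
    signedPower x y z w = -1ℤ ^ (x ℕ.+ y) * (+ 2) ^ y * d ^ (2 ℕ.* z ℕ.+ w)

    signedPower-+ : ∀ x y z w x′ y′ z′ w′ →
      signedPower (x ℕ.+ x′) (y ℕ.+ y′) (z ℕ.+ z′) (w ℕ.+ w′) ≡ signedPower x y z w * signedPower x′ y′ z′ w′
    signedPower-+ x y z w x′ y′ z′ w′ = begin
        -1ℤ ^ ((x ℕ.+ x′) ℕ.+ (y ℕ.+ y′)) * (+ 2) ^ (y ℕ.+ y′) * d ^ (2 ℕ.* (z ℕ.+ z′) ℕ.+ (w ℕ.+ w′))
      ≡⟨ cong₂ (λ e f → -1ℤ ^ e * (+ 2) ^ (y ℕ.+ y′) * d ^ f) (interchange x x′ y y′)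
               (trans (cong (ℕ._+ (w ℕ.+ w′)) (ℕ.*-distribˡ-+ 2 z z′)) (interchange (2 ℕ.* z) (2 ℕ.* z′) w w′)) ⟩
        -1ℤ ^ ((x ℕ.+ y) ℕ.+ (x′ ℕ.+ y′)) * (+ 2) ^ (y ℕ.+ y′) * d ^ ((2 ℕ.* z ℕ.+ w) ℕ.+ (2 ℕ.* z′ ℕ.+ w′))
      ≡⟨ cong₂ _*_ (cong₂ _*_ (ℤ.^-distribˡ-+-* -1ℤ (x ℕ.+ y) (x′ ℕ.+ y′)) (ℤ.^-distribˡ-+-* (+ 2) y y′))
                   (ℤ.^-distribˡ-+-* d (2 ℕ.* z ℕ.+ w) (2 ℕ.* z′ ℕ.+ w′)) ⟩
        (-1ℤ ^ (x ℕ.+ y) * -1ℤ ^ (x′ ℕ.+ y′)) * ((+ 2) ^ y * (+ 2) ^ y′) * (d ^ (2 ℕ.* z ℕ.+ w) * d ^ (2 ℕ.* z′ ℕ.+ w′))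
      ≡⟨ regroup (-1ℤ ^ (x ℕ.+ y)) (-1ℤ ^ (x′ ℕ.+ y′)) ((+ 2) ^ y) ((+ 2) ^ y′) (d ^ (2 ℕ.* z ℕ.+ w)) (d ^ (2 ℕ.* z′ ℕ.+ w′)) ⟩
        signedPower x y z w * signedPower x′ y′ z′ w′ ∎
      where
      open ≡-Reasoning
      open Algebra.Properties.CommutativeSemigroup ℕ.+-commutativeSemigroup using (interchange)
      regroup : ∀ a₁ a₂ b₁ b₂ c₁ c₂ → a₁ * a₂ * (b₁ * b₂) * (c₁ * c₂) ≡ a₁ * b₁ * c₁ * (a₂ * b₂ * c₂)
      regroup = solve-∀

    weightFactor : Part n → ℤ
    weightFactor P = signedPower (isPair G P) (isCyc G P) (antiPair G P) (antiCyc G P)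

    weight≡∏ : ∀ S → weight G S ≡ ∏ weightFactor S
    weight≡∏ []      = refl
    weight≡∏ (P ∷ S) =
      trans (signedPower-+ (isPair G P) (isCyc G P) (antiPair G P) (antiCyc G P) (p G S) (p₁ G S) (a G S) (a₁ G S))
            (cong (weightFactor P *_) (weight≡∏ S))

    private
      pathWeight-zip : ∀ u q v → pathWeight u q v ≡ ∏ (uncurry (AD G)) (zip (u ∷ q) (q ++ [ v ]))
      pathWeight-zip u []      v = sym (ℤ.*-identityʳ (AD G u v))
      pathWeight-zip u (x ∷ q) v = cong (AD G u x *_) (pathWeight-zip x q v)

      ∏-AD : ∀ {es} (h : Fin n × Fin n → ℕ) → (∀ u v → h (u , v) ≡ b2n G (antipodal? G u v)) →
             All (uncurry (ADRel G)) es → ∏ (uncurry (AD G)) es ≡ d ^ sum (map h es)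
      ∏-AD h h≗ []                    = refl
      ∏-AD {(u , v) ∷ es} h h≗ (r ∷ rs) =
        trans (cong₂ _*_ (trans (AD-ADRel r) (cong (d ^_) (sym (h≗ u v)))) (∏-AD h h≗ rs))
              (sym (ℤ.^-distribˡ-+-* d (h (u , v)) _))

      ADRel-sym : ∀ {u v} → ADRel G u v → ADRel G v u
      ADRel-sym {u} {v} (inj₁ uv)           = inj₁ (trans (Graph.sym G v u) uv)
      ADRel-sym {u} {v} (inj₂ (u≢v , anti)) = inj₂ ((λ v≡u → u≢v (sym v≡u)) , trans (dist-sym G v u) anti)

    partWeight-valid : ∀ P → ValidPart G P → partWeight P ≡ weightFactor P
    partWeight-valid (pair u v) r = begin
        - (AD G u v * AD G v u)
      ≡⟨ cong₂ (λ x y → - (x * y)) (AD-ADRel r) (trans (AD-ADRel (ADRel-sym r)) (cong (λ b → d ^ b2n G b) (antipodal?-sym G v u))) ⟩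
        - (d ^ β * d ^ β)
      ≡⟨ cong -_ (sym (ℤ.^-distribˡ-+-* d β β)) ⟩
        - (d ^ (β ℕ.+ β))
      ≡⟨ cong (λ k → - (d ^ k)) (trans (cong (β ℕ.+_) (sym (ℕ.+-identityʳ β))) (sym (ℕ.+-identityʳ (2 ℕ.* β)))) ⟩
        - (d ^ (2 ℕ.* β ℕ.+ 0))
      ≡⟨ signs (d ^ (2 ℕ.* β ℕ.+ 0)) ⟩
        weightFactor (pair u v) ∎
      where
      open ≡-Reasoning
      β : ℕ
      β = b2n G (antipodal? G u v)
      signs : ∀ x → - x ≡ -1ℤ * ℤ.1ℤ * ℤ.1ℤ * x
      signs = solve-∀
    partWeight-valid (cyc [])         (() , _)
    partWeight-valid (cyc (u ∷ rest)) (_ , _ , edges) = begin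
        + 2 * - pathWeight u rest u
      ≡⟨ cong (λ x → + 2 * - x) (trans (pathWeight-zip u rest u) (∏-AD _ (λ _ _ → refl) edges)) ⟩
        + 2 * - (d ^ antiCyc G (cyc (u ∷ rest)))
      ≡⟨ signs (d ^ antiCyc G (cyc (u ∷ rest))) ⟩
        weightFactor (cyc (u ∷ rest)) ∎
      where
      open ≡-Reasoning
      signs : ∀ x → + 2 * - x ≡ -1ℤ * ℤ.1ℤ * (+ 2 * ℤ.1ℤ) * x
      signs = solve-∀

    coeff≡∑configurations : ∀ k → coeff G k ≡ ∑ (λ (ω , m) → ∏ cycleWeight ω * δ m (n ∸ k)) (configurations n (allFin n))
    coeff≡∑configurations k =
      trans (det≡detL charEntry n _ id id entries (n ∸ k))
            (detL≡∑configurations n (allFin n) (ℕ.≤-reflexive (length-tabulate id)) (Sorted⇒Unique allFin-sorted) (n ∸ k))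
      where
      open Expansion _≟_ (AD G) AD-diag
      entries : ∀ r c i → ((if ⌊ r ≟ c ⌋ then varP else constP (+ 0)) +P (-P constP (AD G r c))) i ≡ linearPoly (charEntry r c) i
      entries r c i with r ≟ c
      entries r c zero          | yes _ = ℤ.+-identityˡ _
      entries r c (suc zero)    | yes _ = refl
      entries r c (suc (suc i)) | yes _ = refl
      entries r c zero          | no  _ = ℤ.+-identityˡ _
      entries r c (suc zero)    | no  _ = refl
      entries r c (suc (suc i)) | no  _ = refl

    private
      validCycle : ∀ c → 2 ≤ length c → Unique c → cycleWeight c ≢ + 0 → ValidPart G (toPart c)
      validCycle (v ∷ [])        (s≤s ()) _ _
      validCycle (v ∷ x ∷ [])    _ _ nz = ADRel-nonzero v x (λ vx≡0 → nz (cong (λ y → - (y * AD G x v)) vx≡0))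
      validCycle (v ∷ x ∷ y ∷ r) _ u nz =
        s≤s (s≤s (s≤s z≤n)) , u ,
        All.map (λ {(a , b)} → ADRel-nonzero a b)
                (∏≢0 (uncurry (AD G)) _ (λ ∏≡0 → nz (cong -_ (trans (pathWeight-zip v (x ∷ y ∷ r) v) ∏≡0))))

    configuration-valid : ∀ {ω m} → IsConfiguration (allFin n) (ω , m) → ∏ cycleWeight ω ≢ + 0 → IsADPartition G (toPartition ω)
    configuration-valid {ω} (_ , uω , long , _) nz = valid ω long uω nz , subst Unique (sym (allVertices-toPartition ω)) uω
      where
      valid : ∀ ω → All (λ c → 2 ≤ length c) ω → Unique (concat ω) → ∏ cycleWeight ω ≢ + 0 → All (ValidPart G) (toPartition ω)
      valid []      []           _ _  = []
      valid (c ∷ ω) (two ∷ long) u nz with Unique-++⁻ c u | ∏≢0 cycleWeight (c ∷ ω) nz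
      ... | uc , uω | c≢0 ∷ _ =
        validCycle c two uc c≢0 ∷ valid ω long uω (λ ∏≡0 → nz (trans (cong (cycleWeight c *_) ∏≡0) (ℤ.*-zeroʳ (cycleWeight c))))

    configuration-size : ∀ {ω m} → IsConfiguration (allFin n) (ω , m) → size (toPartition ω) ℕ.+ m ≡ n
    configuration-size {ω} (_ , _ , _ , len) =
      trans (cong (λ vs → length vs ℕ.+ _) (allVertices-toPartition ω)) (trans len (length-tabulate id))

    configuration-wellFormed : ∀ {ω m} → IsConfiguration (allFin n) (ω , m) → WellFormed (toPartition ω)
    configuration-wellFormed {ω} (_ , uω , long , _) =
      All.map⁺ (All.map (λ {c} two → subst (λ vs → 0 < length vs) (sym (vertices-toPart c)) (ℕ.<-≤-trans (s≤s z≤n) two)) long) ,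
      subst Unique (sym (allVertices-toPartition ω)) uω

    ADPartition-wellFormed : ∀ {S} → IsADPartition G S → WellFormed S × All WellShaped S
    ADPartition-wellFormed {S} (valid , u) = (All.map nonempty valid , u) , All.map shape valid
      where
      nonempty : ∀ {P} → ValidPart G P → 0 < length (vertices P)
      nonempty {pair _ _} _              = s≤s z≤n
      nonempty {cyc _}    (three , _ , _) = ℕ.<-≤-trans (s≤s z≤n) three
      shape : ∀ {P} → ValidPart G P → WellShaped P
      shape {pair _ _} _              = _
      shape {cyc _}    (three , _ , _) = three

  module Regroup {n : ℕ} (G : Graph n) {k : ℕ} (k≤n : k ≤ n) {L : List (Partition n)}
                 (L-valid : All (λ S → IsADPartition G S × size S ≡ k) L) where

    open Weights (AD G)
    open Counting (AD G) (AD-sym G)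
    open Removal (_≟_ {n})

    configs : List (List (List (Fin n)) × ℕ)
    configs = configurations n (allFin n)

    term : List (List (Fin n)) × ℕ → ℤ
    term (ω , m) = ∏ cycleWeight ω * δ m (n ∸ k)

    _≈?_ : ∀ (c : List (List (Fin n)) × ℕ) S → Dec (SameBuckets (toPartition (proj₁ c)) S)
    (ω , _) ≈? S = sameBuckets? (toPartition ω) S

    private
      configs-spec : All (IsConfiguration (allFin n)) configs
      configs-spec = configurations-spec n (Sorted⇒Unique allFin-sorted)

      term-sized : ∀ {ω m} → IsConfiguration (allFin n) (ω , m) → size (toPartition ω) ≡ k → term (ω , m) ≡ ∏ cycleWeight ω
      term-sized {ω} {m} spec refl =
        trans (cong (λ i → ∏ cycleWeight ω * δ i (n ∸ k)) m≡n∸k)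
              (trans (cong (∏ cycleWeight ω *_) (δ-refl (n ∸ k))) (ℤ.*-identityʳ (∏ cycleWeight ω)))
        where
        m≡n∸k : m ≡ n ∸ size (toPartition ω)
        m≡n∸k = sym (trans (cong (_∸ size (toPartition ω)) (sym (configuration-size G spec))) (ℕ.m+n∸m≡n (size (toPartition ω)) m))

      term-nonzero : ∀ {ω m} → IsConfiguration (allFin n) (ω , m) → term (ω , m) ≢ + 0 →
                     ∏ cycleWeight ω ≢ + 0 × size (toPartition ω) ≡ k
      term-nonzero {ω} {m} spec t≢0 =
        (λ ∏≡0 → t≢0 (cong (_* δ m (n ∸ k)) ∏≡0)) ,
        ℕ.+-cancelʳ-≡ m _ k (trans (configuration-size G spec) (sym (trans (cong (k ℕ.+_) m≡n∸k) (ℕ.m+[n∸m]≡n k≤n))))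
        where
        m≡n∸k : m ≡ n ∸ k
        m≡n∸k = δ-nonzero m (n ∸ k) (λ δ≡0 → t≢0 (trans (cong (∏ cycleWeight ω *_) δ≡0) (ℤ.*-zeroʳ (∏ cycleWeight ω))))

    configuration-counted-once :
      (∀ S → IsADPartition G S → size S ≡ k → Any (PartitionEq S) L) → AllPairs (λ S T → ¬ PartitionEq S T) L →
      All (λ c → term c ≡ ∑ (λ S → 𝟙 (c ≈? S) * term c) L) configs
    configuration-counted-once L-complete L-distinct = All.map once configs-spec
      where
      once : ∀ {c} → IsConfiguration (allFin n) c → term c ≡ ∑ (λ S → 𝟙 (c ≈? S) * term c) L
      once {c@(ω , _)} spec with term c ℤ.≟ + 0
      ... | yes t≡0 = trans t≡0 (sym (∑-zero _ (λ S → trans (cong (𝟙 (c ≈? S) *_) t≡0) (ℤ.*-zeroʳ (𝟙 (c ≈? S)))) L))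
      ... | no  t≢0 = sym (trans (∑-*ʳ (λ S → 𝟙 (c ≈? S)) (term c) L) (trans (cong (_* term c) count) (ℤ.*-identityˡ (term c))))
        where
        count : ∑ (λ S → 𝟙 (c ≈? S)) L ≡ ℤ.1ℤ
        count = ∑-𝟙-representatives (toPartition ω) L L-distinct (All.map (proj₁ ∘ ADPartition-wellFormed G ∘ proj₁) L-valid)
                  (configuration-wellFormed G spec)
                  (L-complete (toPartition ω) (configuration-valid G spec (proj₁ (term-nonzero spec t≢0))) (proj₂ (term-nonzero spec t≢0)))

    partition-weight : All (λ S → ∑ (λ c → 𝟙 (c ≈? S) * term c) configs ≡ weight G S) L
    partition-weight = All.map per-partition L-valid
      where
      per-partition : ∀ {S} → IsADPartition G S × size S ≡ k → ∑ (λ c → 𝟙 (c ≈? S) * term c) configs ≡ weight G S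
      per-partition {S} (valid , size≡k) = begin
          ∑ (λ c → 𝟙 (c ≈? S) * term c) configs
        ≡⟨ ∑-congᴬ (All.map (λ {c} spec → 𝟙-guard (c ≈? S) (λ same → term-sized spec (same-size spec same))) configs-spec) ⟩
          fibreSum n (allFin n) S
        ≡⟨ fibre n (allFin n) (ℕ.≤-reflexive (length-tabulate id)) allFin-sorted S wf shaped (All.tabulate (λ {z} _ → ∈-allFin z)) ⟩
          ∏ partWeight S
        ≡⟨ ∏-congᴬ (All.map (partWeight-valid G _) (proj₁ valid)) ⟩
          ∏ (weightFactor G) S
        ≡⟨ sym (weight≡∏ G S) ⟩
          weight G S ∎
        where
        open ≡-Reasoning
        wf : WellFormed S
        wf = proj₁ (ADPartition-wellFormed G valid)
        shaped : All WellShaped S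
        shaped = proj₂ (ADPartition-wellFormed G valid)
        same-size : ∀ {ω m} → IsConfiguration (allFin n) (ω , m) → SameBuckets (toPartition ω) S → size (toPartition ω) ≡ k
        same-size {ω} spec same =
          trans (size-PartitionEq (SameBuckets⇒PartitionEq {S = toPartition ω} {T = S} (configuration-wellFormed G spec) wf same)) size≡k

open import Defs
open import Data.Nat using (ℕ; _≤_)
open import Data.Integer using (_*_)
open import Data.List using (List; map)
open import Data.List.Relation.Unary.All using (All)
open import Data.List.Relation.Unary.Any using (Any)
open import Data.List.Relation.Unary.AllPairs using (AllPairs)
open import Data.Product using (_×_)
open import Relation.Binary.PropositionalEquality using (_≡_; module ≡-Reasoning)
open import Relation.Nullary using (¬_)

open Sums
open ADMatrix

mainTheorem5 : ∀ {n} (G : Graph n) → Connected G →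
    ∀ (k : ℕ) → 1 ≤ k → k ≤ n →
    (L : List (Partition n)) →
    All (λ S → IsADPartition G S × size S ≡ k) L →
    (∀ S → IsADPartition G S → size S ≡ k → Any (PartitionEq S) L) →
    AllPairs (λ S T → ¬ PartitionEq S T) L →
    coeff G k ≡ sumℤ (map (weight G) L)
mainTheorem5 G _ k _ k≤n L L-valid L-complete L-distinct = begin
    coeff G k
  ≡⟨ coeff≡∑configurations G k ⟩
    ∑ term configs
  ≡⟨ ∑-congᴬ (configuration-counted-once L-complete L-distinct) ⟩
    ∑ (λ c → ∑ (λ S → 𝟙 (c ≈? S) * term c) L) configs
  ≡⟨ ∑-comm (λ c S → 𝟙 (c ≈? S) * term c) configs L ⟩
    ∑ (λ S → ∑ (λ c → 𝟙 (c ≈? S) * term c) configs) L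
  ≡⟨ ∑-congᴬ partition-weight ⟩
    ∑ (weight G) L
  ≡⟨ ∑≡sumℤ (weight G) L ⟩
    sumℤ (map (weight G) L) ∎
  where
  open ≡-Reasoning
  open Regroup G k≤n L-valid
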